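{- As formal power series in $q$, \[ \sum_{n\ge0}g_{1,2}(n)q^n=\sum_{n\ge1}\frac{nq^{n^2+n}(-q;q^2)_{n+1}}{(q^2;q^2)_n}, \] \[ \sum_{n\ge0}g_{2,2}(n)q^n=\frac{1}{(q,q^5,q^6;q^8)_\infty}\left(\frac{q^5+q^6+q^9}{1-q^8}+\frac{q^2+q^{10}-q^{11}+q^{12}}{1-q^{16}}\right). \]
   Context: $(a;q)_n=\prod_{i=0}^{n-1}(1-aq^i)$, $(a;q)_\infty=\prod_{i\ge0}(1-aq^i)$, $(a_1,\dots,a_k;q)_\infty=\prod_j(a_j;q)_\infty$. A partition $\lambda=(\lambda_1\ge\cdots\ge\lambda_k)$ has conjugate $\lambda'$ with $\lambda'_j=\#\{i:\lambda_i\ge j\}$; the hook length of cell $(i,j)$ is $\lambda_i+\lambda'_j-i-j+1$, and a $t$-hook is a cell of hook length $t$. $g_{1,2}(n)$ is the total number of $2$-hooks over all partitions of $n$ in which consecutive parts differ by at least $2$ and $\lambda_i-\lambda_{i+1}>2$ whenever $\lambda_i$ is odd (no two odd parts differ by exactly 2); $g_{2,2}(n)$ is the total number of $2$-hooks over all partitions of $n$ with all parts congruent to $1$, $5$ or $6$ modulo $8$. -}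

module Defs where

open import Data.Bool using (Bool; true; false; _∧_; _∨_; if_then_else_)
open import Data.Nat using (ℕ; zero; suc; _+_; _*_; _∸_; _≤ᵇ_; _≡ᵇ_; _%_)
open import Data.Nat.Divisibility using (_∣?_)
open import Data.Integer using (ℤ; +_; 0ℤ; 1ℤ) renaming (_+_ to _+ℤ_; _*_ to _*ℤ_)
open import Data.List using (List; []; _∷_; map; concatMap; upTo; length; filterᵇ; foldr)
open import Data.Nat.ListAction using (sum)
open import Data.Bool.ListAction using (and)
open import Relation.Nullary.Decidable using (isYes)

allᵇ : {A : Set} → (A → Bool) → List A → Bool
allᵇ p xs = and (map p xs)

listsOf : ℕ → ℕ → List (List ℕ)
listsOf zero    n = [] ∷ []
listsOf (suc k) n = concatMap (λ p → map (p ∷_) (listsOf k n)) (map suc (upTo n))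

nonincreasing : List ℕ → Bool
nonincreasing (a ∷ b ∷ r) = (b ≤ᵇ a) ∧ nonincreasing (b ∷ r)
nonincreasing _           = true

isPartitionOf : ℕ → List ℕ → Bool
isPartitionOf n l = nonincreasing l ∧ allᵇ (1 ≤ᵇ_) l ∧ (sum l ≡ᵇ n)

-- every partition of n has at most n parts, each in {1,…,n};
-- lists of different lengths are distinct, so each partition occurs once
partitions : ℕ → List (List ℕ)
partitions n = filterᵇ (isPartitionOf n) (concatMap (λ k → listsOf k n) (upTo (suc n)))

conj : List ℕ → ℕ → ℕ
conj l j = length (filterᵇ (j ≤ᵇ_) l)

-- number of cells (i,j) (1 ≤ i ≤ k, 1 ≤ j ≤ λ_i) whose hook length
-- λ_i + λ'_j - i - j + 1 equals t  (written without truncated subtraction)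
numHooks : ℕ → List ℕ → ℕ
numHooks t lam = go 1 lam
  where
  rowCount : ℕ → ℕ → ℕ
  rowCount i li = sum (map (λ j → if (li + conj lam j + 1 ≡ᵇ t + i + j) then 1 else 0)
                           (map suc (upTo li)))
  go : ℕ → List ℕ → ℕ
  go i []        = 0
  go i (li ∷ r) = rowCount i li + go (suc i) r

isOdd : ℕ → Bool
isOdd n = n % 2 ≡ᵇ 1

cond12 : List ℕ → Bool
cond12 (a ∷ b ∷ r) = (b + 2 ≤ᵇ a) ∧ (if isOdd a then b + 3 ≤ᵇ a else true) ∧ cond12 (b ∷ r)
cond12 _           = true

cond22 : List ℕ → Bool
cond22 = allᵇ (λ x → (x % 8 ≡ᵇ 1) ∨ (x % 8 ≡ᵇ 5) ∨ (x % 8 ≡ᵇ 6))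

g12 : ℕ → ℕ
g12 n = sum (map (numHooks 2) (filterᵇ cond12 (partitions n)))

g22 : ℕ → ℕ
g22 n = sum (map (numHooks 2) (filterᵇ cond22 (partitions n)))

PS : Set
PS = ℕ → ℤ

sumℤ : List ℤ → ℤ
sumℤ = foldr _+ℤ_ 0ℤ

_⊕_ : PS → PS → PS
(f ⊕ g) n = f n +ℤ g n

_⊛_ : PS → PS → PS
(f ⊛ g) n = sumℤ (map (λ k → f k *ℤ g (n ∸ k)) (upTo (suc n)))

infixl 6 _⊕_
infixl 7 _⊛_

mono : ℤ → ℕ → PS
mono c e n = if (n ≡ᵇ e) then c else 0ℤ

one : PS
one = mono 1ℤ 0

prodPS : List PS → PS
prodPS = foldr _⊛_ one

-- 1 / (1 - q^k)  (= Σ_m q^{k m}); used only for k ≥ 1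
geom : ℕ → PS
geom k n = if isYes (k ∣? n) then 1ℤ else 0ℤ

term1 : ℕ → PS
term1 n = mono (+ n) (n * n + n)
        ⊛ prodPS (map (λ i → one ⊕ mono 1ℤ (2 * i + 1)) (upTo (suc n)))
        ⊛ prodPS (map (λ i → geom (2 * suc i)) (upTo n))

-- coefficient of q^N in Σ_{n ≥ 1} term1 n.  This is exact: term1 n has
-- order n² + n > N for n > N, so only n = 1,…,N contribute.
rhs1 : PS
rhs1 N = sumℤ (map (λ m → term1 (suc m) N) (upTo N))

-- ∏_{i < M} 1/((1-q^{8i+1})(1-q^{8i+5})(1-q^{8i+6})): the truncation of
-- 1/(q,q⁵,q⁶;q⁸)_∞ to its first M factors-triples.  Factors with i ≥ M
-- are ≡ 1 mod q^{8M+1}, so coefficients of q^N with N ≤ 8M agree with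
-- those of the infinite product.
invProd156 : ℕ → PS
invProd156 M = prodPS (map (λ i → geom (8 * i + 1) ⊛ geom (8 * i + 5) ⊛ geom (8 * i + 6)) (upTo M))

bracket2 : PS
bracket2 = (mono 1ℤ 5 ⊕ mono 1ℤ 6 ⊕ mono 1ℤ 9) ⊛ geom 8
         ⊕ (mono 1ℤ 2 ⊕ mono 1ℤ 10 ⊕ mono (Data.Integer.-_ 1ℤ) 11 ⊕ mono 1ℤ 12) ⊛ geom 16

rhs2 : PS
rhs2 N = (invProd156 (suc N) ⊛ bracket2) N

-- Both identities count 2-hooks row by row.  A row of length s has a 2-hook in
-- its last cell iff exactly the next row also has length s, and in its last but
-- one cell iff s ≥ 2 and the next row is shorter than s - 1.  Partitions of N are
-- enumerated as words of length ≤ N over {1, …, N}, so everything is proved for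
-- coefficients of degree ≤ N only.
--
-- Class 12: consecutive parts differ by at least 2, so every row but the last
-- has one 2-hook, and the last row has one iff it is ≥ 2.  Hence g₁₂ is
-- Σₖ (k - 1)·#(k parts) + #(k parts, all ≥ 2).  Removing the smallest part and
-- subtracting 2 from the others shows that the partitions with n parts, all ≥ 2,
-- have generating function Φₙ = q^(n²+n) (-q;q²)ₙ / (q²;q²)ₙ, and Abel summation
-- over k turns the sum into Σₙ n (1 + q^(2n+1)) Φₙ.
--
-- Class 22: with S = {1, 5, 6 mod 8} and Pᵦ = Π_{x ≤ b, x ∈ S} 1/(1 - q^x),
-- adding a largest part s gives Hₛ = Hₛ₋₁ + [s ∈ S] (q^(2s) Pₛ₋₁ + [s ≥ 2] q^s Pₛ₋₂ + q^s Hₛ)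
-- for the hook generating function Hᵦ of the partitions with parts in S bounded
-- by b.  As Pₛ₋₂ = (1 - q^(s-1)) Pₛ₋₁ when s - 1 ∈ S, the solution is
-- Hᵦ = Pᵦ Σ_{s ≤ b, s ∈ S} (q^(2s) + [s ≥ 2] q^s - [s - 1 ∈ S] q^(2s-1)),
-- and this sum is 8-periodic in s, which produces the bracket.

module Submission where

open import Defs
open import Data.Bool using (Bool; true; false; if_then_else_; _∧_; _∨_)
import Data.Bool.Properties as Bool
open import Data.Nat using (ℕ; zero; suc; _+_; _*_; _∸_; _≤_; _<_; z≤n; s≤s; _≤ᵇ_; _≡ᵇ_; _<ᵇ_; _%_)
import Data.Nat.Properties as ℕ
open import Data.Nat.Divisibility using (_∣_; _∣?_; ∣m∸n∣n⇒∣m; ∣m+n∣m⇒∣n; ∣⇒≤; ∣-refl)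
open import Data.Nat.DivMod using ([m+kn]%n≡m%n)
open import Data.Nat.Induction using (<-rec)
open import Data.Nat.ListAction using (sum)
open import Data.Nat.ListAction.Properties using (sum-++)
open import Data.Nat.Tactic.RingSolver using () renaming (solve-∀ to solve-∀ℕ)
open import Data.Integer using (ℤ; +_; 0ℤ; 1ℤ; -_) renaming (_+_ to _+ℤ_; _*_ to _*ℤ_)
import Data.Integer.Properties as ℤ
open import Data.Integer.Tactic.RingSolver using (solve-∀)
open import Data.List using (List; []; _∷_; map; upTo; applyUpTo; length; filterᵇ; concatMap; _++_; _∷ʳ_; [_])
import Data.List.Properties as List
open import Data.List.Relation.Unary.All as All using (All; []; _∷_)
open import Data.Product using (_×_; _,_; proj₁; proj₂)
open import Function using (_∘_; Equivalence)
open import Level using (0ℓ)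
open import Relation.Binary using (Setoid; tri<; tri≈; tri>)
open import Relation.Binary.PropositionalEquality hiding ([_])
import Relation.Binary.Reasoning.Setoid as SetoidReasoning
open import Relation.Nullary using (yes; no; contradiction)
open import Relation.Nullary.Reflects using (Reflects; ofʸ; ofⁿ)

𝟙 : Bool → ℤ
𝟙 b = if b then 1ℤ else 0ℤ

𝟙-∧ : ∀ a b → 𝟙 (a ∧ b) ≡ 𝟙 a *ℤ 𝟙 b
𝟙-∧ true  b = sym (ℤ.*-identityˡ (𝟙 b))
𝟙-∧ false b = refl

𝟙-* : ∀ b x → 𝟙 b *ℤ x ≡ (if b then x else 0ℤ)
𝟙-* true  x = ℤ.*-identityˡ x
𝟙-* false x = ℤ.*-zeroˡ x

𝟙-false-* : ∀ {b} x → b ≡ false → 𝟙 b *ℤ x ≡ 0ℤ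
𝟙-false-* x refl = ℤ.*-zeroˡ x

𝟙-idem : ∀ b → 𝟙 b *ℤ 𝟙 b ≡ 𝟙 b
𝟙-idem true  = refl
𝟙-idem false = refl

∧-true : ∀ {a b} → a ∧ b ≡ true → a ≡ true × b ≡ true
∧-true {true} {true} _ = refl , refl

≤ᵇ-true : ∀ {m n} → m ≤ n → (m ≤ᵇ n) ≡ true
≤ᵇ-true m≤n = Equivalence.to Bool.T-≡ (ℕ.≤⇒≤ᵇ m≤n)

≤ᵇ-false : ∀ {m n} → n < m → (m ≤ᵇ n) ≡ false
≤ᵇ-false {m} {n} n<m with m ≤ᵇ n | ℕ.≤ᵇ-reflects-≤ m n
... | false | _      = refl
... | true  | ofʸ m≤n = contradiction m≤n (ℕ.<⇒≱ n<m)

≤ᵇ⇒≤ : ∀ {m n} → (m ≤ᵇ n) ≡ true → m ≤ n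
≤ᵇ⇒≤ {m} {n} eq = ℕ.≤ᵇ⇒≤ m n (Equivalence.from Bool.T-≡ eq)

≡ᵇ-refl : ∀ n → (n ≡ᵇ n) ≡ true
≡ᵇ-refl n = Equivalence.to Bool.T-≡ (ℕ.≡⇒≡ᵇ n n refl)

≡ᵇ-false : ∀ {m n} → m ≢ n → (m ≡ᵇ n) ≡ false
≡ᵇ-false {m} {n} m≢n with m ≡ᵇ n in eq
... | false = refl
... | true  = contradiction (ℕ.≡ᵇ⇒≡ m n (Equivalence.from Bool.T-≡ eq)) m≢n

≡ᵇ-+ : ∀ p a b → (p + a ≡ᵇ p + b) ≡ (a ≡ᵇ b)
≡ᵇ-+ zero    a b = refl
≡ᵇ-+ (suc p) a b = ≡ᵇ-+ p a b

+-≡ᵇ : ∀ x y m → (x + y ≡ᵇ m) ≡ (y ≤ᵇ m) ∧ (x ≡ᵇ m ∸ y)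
+-≡ᵇ x zero    m       = cong (_≡ᵇ m) (ℕ.+-identityʳ x)
+-≡ᵇ x (suc y) zero    = cong (_≡ᵇ 0) (ℕ.+-suc x y)
+-≡ᵇ x (suc y) (suc m) = trans (cong (_≡ᵇ suc m) (ℕ.+-suc x y)) (trans (+-≡ᵇ x y m) (cong (_∧ (x ≡ᵇ m ∸ y)) (≤ᵇ-suc y)))
  where
  ≤ᵇ-suc : ∀ y → (y ≤ᵇ m) ≡ (suc y ≤ᵇ suc m)
  ≤ᵇ-suc zero    = refl
  ≤ᵇ-suc (suc y) = refl

-- Finite sums

infix 10 ∑

∑ : ℕ → (ℕ → ℤ) → ℤ
∑ zero    f = 0ℤ
∑ (suc n) f = f 0 +ℤ ∑ n (f ∘ suc)

syntax ∑ n (λ k → e) = ∑[ k < n ] e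

sumℤ-upTo : ∀ f n → sumℤ (map f (upTo n)) ≡ ∑ n f
sumℤ-upTo f n = trans (cong sumℤ (List.map-upTo f n)) (sumℤ-applyUpTo f n)
  where
  sumℤ-applyUpTo : ∀ f n → sumℤ (applyUpTo f n) ≡ ∑ n f
  sumℤ-applyUpTo f zero    = refl
  sumℤ-applyUpTo f (suc n) = cong (f 0 +ℤ_) (sumℤ-applyUpTo (f ∘ suc) n)

∑-cong-< : ∀ {f g} n → (∀ k → k < n → f k ≡ g k) → ∑ n f ≡ ∑ n g
∑-cong-< zero    f≡g = refl
∑-cong-< (suc n) f≡g = cong₂ _+ℤ_ (f≡g 0 (s≤s z≤n)) (∑-cong-< n (λ k k<n → f≡g (suc k) (s≤s k<n)))

∑-cong : ∀ {f g} n → (∀ k → f k ≡ g k) → ∑ n f ≡ ∑ n g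
∑-cong n f≡g = ∑-cong-< n (λ k _ → f≡g k)

∑-zero : ∀ {f} n → (∀ k → k < n → f k ≡ 0ℤ) → ∑ n f ≡ 0ℤ
∑-zero zero    f≡0 = refl
∑-zero (suc n) f≡0 = cong₂ _+ℤ_ (f≡0 0 (s≤s z≤n)) (∑-zero n (λ k k<n → f≡0 (suc k) (s≤s k<n)))

∑-distrib-+ : ∀ f g n → ∑[ k < n ] (f k +ℤ g k) ≡ ∑ n f +ℤ ∑ n g
∑-distrib-+ f g zero    = refl
∑-distrib-+ f g (suc n) = trans (cong (f 0 +ℤ g 0 +ℤ_) (∑-distrib-+ (f ∘ suc) (g ∘ suc) n)) (exchange (f 0) (g 0) _ _)
  where
  exchange : ∀ a b c d → (a +ℤ b) +ℤ (c +ℤ d) ≡ (a +ℤ c) +ℤ (b +ℤ d)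
  exchange = solve-∀

∑-*ˡ : ∀ c f n → ∑[ k < n ] (c *ℤ f k) ≡ c *ℤ ∑ n f
∑-*ˡ c f zero    = sym (ℤ.*-zeroʳ c)
∑-*ˡ c f (suc n) = trans (cong (c *ℤ f 0 +ℤ_) (∑-*ˡ c (f ∘ suc) n)) (sym (ℤ.*-distribˡ-+ c (f 0) _))

∑-*ʳ : ∀ c f n → ∑[ k < n ] (f k *ℤ c) ≡ ∑ n f *ℤ c
∑-*ʳ c f n = trans (∑-cong n (λ k → ℤ.*-comm (f k) c)) (trans (∑-*ˡ c f n) (ℤ.*-comm c _))

∑-init-last : ∀ f n → ∑ (suc n) f ≡ ∑ n f +ℤ f n
∑-init-last f zero    = ℤ.+-comm (f 0) 0ℤ
∑-init-last f (suc n) = trans (cong (f 0 +ℤ_) (∑-init-last (f ∘ suc) n)) (sym (ℤ.+-assoc (f 0) _ _))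

∑-init : ∀ f n → f n ≡ 0ℤ → ∑ (suc n) f ≡ ∑ n f
∑-init f n fn≡0 = trans (∑-init-last f n) (trans (cong (∑ n f +ℤ_) fn≡0) (ℤ.+-identityʳ _))

∑-reverse : ∀ f n → ∑ n f ≡ ∑[ k < n ] f (n ∸ suc k)
∑-reverse f zero    = refl
∑-reverse f (suc n) = begin
  ∑ (suc n) f                             ≡⟨ ∑-init-last f n ⟩
  ∑ n f +ℤ f n                            ≡⟨ cong (_+ℤ f n) (∑-reverse f n) ⟩
  ∑[ k < n ] f (n ∸ suc k) +ℤ f n         ≡⟨ ℤ.+-comm _ (f n) ⟩
  f n +ℤ ∑[ k < n ] f (n ∸ suc k)         ∎
  where open ≡-Reasoning

∑-comm : ∀ (f : ℕ → ℕ → ℤ) m n → ∑[ i < m ] ∑[ j < n ] f i j ≡ ∑[ j < n ] ∑[ i < m ] f i j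
∑-comm f zero    n = sym (∑-zero n (λ _ _ → refl))
∑-comm f (suc m) n = begin
  ∑[ i < suc m ] ∑[ j < n ] f i j                        ≡⟨ cong (∑[ j < n ] f 0 j +ℤ_) (∑-comm (f ∘ suc) m n) ⟩
  ∑[ j < n ] f 0 j +ℤ ∑[ j < n ] ∑[ i < m ] f (suc i) j  ≡⟨ ∑-distrib-+ (f 0) _ n ⟨
  ∑[ j < n ] ∑[ i < suc m ] f i j                        ∎
  where open ≡-Reasoning

∑-triangle : ∀ (F : ℕ → ℕ → ℤ) n →
  ∑[ m < suc n ] ∑[ k < suc m ] F k m ≡ ∑[ k < suc n ] ∑[ j < suc (n ∸ k) ] F k (k + j)
∑-triangle F zero    = refl
∑-triangle F (suc n) = begin
  ∑[ m < suc (suc n) ] ∑[ k < suc m ] F k m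
    ≡⟨ ∑-init-last (λ m → ∑[ k < suc m ] F k m) (suc n) ⟩
  ∑[ m < suc n ] ∑[ k < suc m ] F k m +ℤ ∑[ k < suc (suc n) ] F k (suc n)
    ≡⟨ cong₂ _+ℤ_ (∑-triangle F n) (∑-init-last (λ k → F k (suc n)) (suc n)) ⟩
  Row n +ℤ (∑[ k < suc n ] F k (suc n) +ℤ F (suc n) (suc n))
    ≡⟨ ℤ.+-assoc (Row n) _ _ ⟨
  (Row n +ℤ ∑[ k < suc n ] F k (suc n)) +ℤ F (suc n) (suc n)
    ≡⟨ cong₂ _+ℤ_ (∑-distrib-+ (λ k → ∑[ j < suc (n ∸ k) ] F k (k + j)) (λ k → F k (suc n)) (suc n)) (ℤ.+-identityʳ (F (suc n) (suc n))) ⟨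
  ∑[ k < suc n ] (∑[ j < suc (n ∸ k) ] F k (k + j) +ℤ F k (suc n)) +ℤ (F (suc n) (suc n) +ℤ 0ℤ)
    ≡⟨ cong₂ _+ℤ_ (∑-cong-< (suc n) extend) lastColumn ⟩
  ∑[ k < suc n ] Col k +ℤ Col (suc n)
    ≡⟨ ∑-init-last Col (suc n) ⟨
  ∑[ k < suc (suc n) ] Col k
    ∎
  where
  open ≡-Reasoning
  Row : ℕ → ℤ
  Row n = ∑[ k < suc n ] ∑[ j < suc (n ∸ k) ] F k (k + j)
  Col : ℕ → ℤ
  Col k = ∑[ j < suc (suc n ∸ k) ] F k (k + j)
  lastColumn : F (suc n) (suc n) +ℤ 0ℤ ≡ Col (suc n)
  lastColumn = sym (trans (cong (λ d → ∑[ j < suc d ] F (suc n) (suc n + j)) (ℕ.n∸n≡0 n))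
                          (cong (λ i → F (suc n) i +ℤ 0ℤ) (ℕ.+-identityʳ (suc n))))
  extend : ∀ k → k < suc n →
    ∑[ j < suc (n ∸ k) ] F k (k + j) +ℤ F k (suc n) ≡ ∑[ j < suc (suc n ∸ k) ] F k (k + j)
  extend k (s≤s k≤n) = begin
    ∑[ j < suc (n ∸ k) ] F k (k + j) +ℤ F k (suc n)
      ≡⟨ cong (λ i → ∑[ j < suc (n ∸ k) ] F k (k + j) +ℤ F k i) k+[1+n∸k]≡1+n ⟨
    ∑[ j < suc (n ∸ k) ] F k (k + j) +ℤ F k (k + suc (n ∸ k))
      ≡⟨ ∑-init-last (λ j → F k (k + j)) (suc (n ∸ k)) ⟨
    ∑[ j < suc (suc (n ∸ k)) ] F k (k + j)
      ≡⟨ cong (λ d → ∑[ j < suc d ] F k (k + j)) (ℕ.+-∸-assoc 1 k≤n) ⟨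
    ∑[ j < suc (suc n ∸ k) ] F k (k + j)
      ∎
    where
    k+[1+n∸k]≡1+n : k + suc (n ∸ k) ≡ suc n
    k+[1+n∸k]≡1+n = trans (ℕ.+-suc k (n ∸ k)) (cong suc (ℕ.m+[n∸m]≡n k≤n))

∑-δ : ∀ f e n → ∑[ k < n ] (if k ≡ᵇ e then f k else 0ℤ) ≡ (if e <ᵇ n then f e else 0ℤ)
∑-δ f zero    zero    = refl
∑-δ f zero    (suc n) = trans (cong (f 0 +ℤ_) (∑-zero n (λ _ _ → refl))) (ℤ.+-identityʳ _)
∑-δ f (suc e) zero    = refl
∑-δ f (suc e) (suc n) = trans (ℤ.+-identityˡ _) (∑-δ (f ∘ suc) e n)

∑-pick : ∀ f e n → (n ≤ e → f e ≡ 0ℤ) → ∑[ k < n ] (𝟙 (k ≡ᵇ e) *ℤ f k) ≡ f e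
∑-pick f e n out = trans (∑-cong n (λ k → 𝟙-* (k ≡ᵇ e) (f k))) (trans (∑-δ f e n) (inside (e <ᵇ n) (ℕ.<ᵇ-reflects-< e n)))
  where
  inside : ∀ b → Reflects (e < n) b → (if b then f e else 0ℤ) ≡ f e
  inside true  _         = refl
  inside false (ofⁿ e≮n) = sym (out (ℕ.≮⇒≥ e≮n))

-- Abel summation: Σ (k - 1)·A k + B k collapses once A (n + 1) = C n + B (n + 1).
∑-telescope : ∀ (A B C : ℕ → ℤ) → A 0 ≡ B 0 → (∀ n → A (suc n) ≡ C n +ℤ B (suc n)) → ∀ L →
  ∑[ k < suc L ] ((+ k +ℤ - 1ℤ) *ℤ A k +ℤ B k) +ℤ + L *ℤ C L ≡ ∑[ m < L ] (+ suc m *ℤ (B (suc m) +ℤ C (suc m)))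
∑-telescope A B C A₀ Aₙ zero = begin
  ((0ℤ +ℤ - 1ℤ) *ℤ A 0 +ℤ B 0 +ℤ 0ℤ) +ℤ 0ℤ *ℤ C 0 ≡⟨ cong (λ a → ((0ℤ +ℤ - 1ℤ) *ℤ a +ℤ B 0 +ℤ 0ℤ) +ℤ 0ℤ *ℤ C 0) A₀ ⟩
  ((0ℤ +ℤ - 1ℤ) *ℤ B 0 +ℤ B 0 +ℤ 0ℤ) +ℤ 0ℤ *ℤ C 0 ≡⟨ cancel (B 0) (C 0) ⟩
  0ℤ                                                ∎
  where
  open ≡-Reasoning
  cancel : ∀ b c → ((0ℤ +ℤ - 1ℤ) *ℤ b +ℤ b +ℤ 0ℤ) +ℤ 0ℤ *ℤ c ≡ 0ℤ
  cancel = solve-∀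
∑-telescope A B C A₀ Aₙ (suc L) = begin
  ∑ (suc (suc L)) F +ℤ + suc L *ℤ C (suc L)
    ≡⟨ cong (_+ℤ + suc L *ℤ C (suc L)) (∑-init-last F (suc L)) ⟩
  (∑ (suc L) F +ℤ ((+ suc L +ℤ - 1ℤ) *ℤ A (suc L) +ℤ B (suc L))) +ℤ + suc L *ℤ C (suc L)
    ≡⟨ cong (λ a → (∑ (suc L) F +ℤ ((+ suc L +ℤ - 1ℤ) *ℤ a +ℤ B (suc L))) +ℤ + suc L *ℤ C (suc L)) (Aₙ L) ⟩
  (∑ (suc L) F +ℤ ((+ suc L +ℤ - 1ℤ) *ℤ (C L +ℤ B (suc L)) +ℤ B (suc L))) +ℤ + suc L *ℤ C (suc L)
    ≡⟨ regroup (+ L) (∑ (suc L) F) (C L) (B (suc L)) (C (suc L)) ⟩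
  (∑ (suc L) F +ℤ + L *ℤ C L) +ℤ + suc L *ℤ (B (suc L) +ℤ C (suc L))
    ≡⟨ cong (_+ℤ G L) (∑-telescope A B C A₀ Aₙ L) ⟩
  ∑ L G +ℤ G L
    ≡⟨ ∑-init-last G L ⟨
  ∑ (suc L) G
    ∎
  where
  open ≡-Reasoning
  F G : ℕ → ℤ
  F k = (+ k +ℤ - 1ℤ) *ℤ A k +ℤ B k
  G m = + suc m *ℤ (B (suc m) +ℤ C (suc m))
  regroup : ∀ l s c b c′ → s +ℤ (((1ℤ +ℤ l) +ℤ - 1ℤ) *ℤ (c +ℤ b) +ℤ b) +ℤ (1ℤ +ℤ l) *ℤ c′
                          ≡ (s +ℤ l *ℤ c) +ℤ (1ℤ +ℤ l) *ℤ (b +ℤ c′)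
  regroup = solve-∀

cong-+₃ : ∀ {a a′ b b′ c c′ : ℤ} → a ≡ a′ → b ≡ b′ → c ≡ c′ → a +ℤ b +ℤ c ≡ a′ +ℤ b′ +ℤ c′
cong-+₃ refl refl refl = refl

-- Formal power series

infix 4 _≋_
_≋_ : PS → PS → Set
f ≋ g = ∀ n → f n ≡ g n

≋-refl : ∀ {f} → f ≋ f
≋-refl n = refl

≋-sym : ∀ {f g} → f ≋ g → g ≋ f
≋-sym f≋g n = sym (f≋g n)

≋-trans : ∀ {f g h} → f ≋ g → g ≋ h → f ≋ h
≋-trans f≋g g≋h n = trans (f≋g n) (g≋h n)

≋-setoid : Setoid 0ℓ 0ℓ
≋-setoid = record
  { Carrier = PS ; _≈_ = _≋_
  ; isEquivalence = record { refl = λ {f} → ≋-refl {f} ; sym = ≋-sym ; trans = ≋-trans } }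

𝟎 : PS
𝟎 _ = 0ℤ

infix 8 q^_
q^_ : ℕ → PS
q^ e = mono 1ℤ e

⊛-coeff : ∀ f g n → (f ⊛ g) n ≡ ∑[ k < suc n ] (f k *ℤ g (n ∸ k))
⊛-coeff f g n = sumℤ-upTo (λ k → f k *ℤ g (n ∸ k)) (suc n)

⊛-cong-≤ : ∀ f {g g′} n → (∀ i → i ≤ n → g i ≡ g′ i) → (f ⊛ g) n ≡ (f ⊛ g′) n
⊛-cong-≤ f {g} {g′} n g≡g′ = begin
  (f ⊛ g) n                              ≡⟨ ⊛-coeff f g n ⟩
  ∑[ k < suc n ] (f k *ℤ g (n ∸ k))      ≡⟨ ∑-cong (suc n) (λ k → cong (f k *ℤ_) (g≡g′ (n ∸ k) (ℕ.m∸n≤m n k))) ⟩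
  ∑[ k < suc n ] (f k *ℤ g′ (n ∸ k))     ≡⟨ ⊛-coeff f g′ n ⟨
  (f ⊛ g′) n                             ∎
  where open ≡-Reasoning

⊛-cong : ∀ {f f′ g g′} → f ≋ f′ → g ≋ g′ → f ⊛ g ≋ f′ ⊛ g′
⊛-cong {f} {f′} {g} {g′} f≋f′ g≋g′ n = begin
  (f ⊛ g) n                              ≡⟨ ⊛-coeff f g n ⟩
  ∑[ k < suc n ] (f k *ℤ g (n ∸ k))      ≡⟨ ∑-cong (suc n) (λ k → cong₂ _*ℤ_ (f≋f′ k) (g≋g′ (n ∸ k))) ⟩
  ∑[ k < suc n ] (f′ k *ℤ g′ (n ∸ k))    ≡⟨ ⊛-coeff f′ g′ n ⟨
  (f′ ⊛ g′) n                            ∎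
  where open ≡-Reasoning

⊛-congˡ : ∀ f {g g′} → g ≋ g′ → f ⊛ g ≋ f ⊛ g′
⊛-congˡ f = ⊛-cong (≋-refl {f})

⊛-congʳ : ∀ g {f f′} → f ≋ f′ → f ⊛ g ≋ f′ ⊛ g
⊛-congʳ g f≋f′ = ⊛-cong f≋f′ (≋-refl {g})

⊕-cong : ∀ {f f′ g g′} → f ≋ f′ → g ≋ g′ → f ⊕ g ≋ f′ ⊕ g′
⊕-cong f≋f′ g≋g′ n = cong₂ _+ℤ_ (f≋f′ n) (g≋g′ n)

⊛-comm : ∀ f g → f ⊛ g ≋ g ⊛ f
⊛-comm f g n = begin
  (f ⊛ g) n                                       ≡⟨ ⊛-coeff f g n ⟩
  ∑[ k < suc n ] (f k *ℤ g (n ∸ k))               ≡⟨ ∑-reverse (λ k → f k *ℤ g (n ∸ k)) (suc n) ⟩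
  ∑[ k < suc n ] (f (n ∸ k) *ℤ g (n ∸ (n ∸ k)))   ≡⟨ ∑-cong-< (suc n) flip ⟩
  ∑[ k < suc n ] (g k *ℤ f (n ∸ k))               ≡⟨ ⊛-coeff g f n ⟨
  (g ⊛ f) n                                       ∎
  where
  open ≡-Reasoning
  flip : ∀ k → k < suc n → f (n ∸ k) *ℤ g (n ∸ (n ∸ k)) ≡ g k *ℤ f (n ∸ k)
  flip k (s≤s k≤n) = trans (cong (λ i → f (n ∸ k) *ℤ g i) (ℕ.m∸[m∸n]≡n k≤n)) (ℤ.*-comm (f (n ∸ k)) (g k))

⊛-assoc : ∀ f g h → (f ⊛ g) ⊛ h ≋ f ⊛ (g ⊛ h)
⊛-assoc f g h n = begin
  ((f ⊛ g) ⊛ h) n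
    ≡⟨ ⊛-coeff (f ⊛ g) h n ⟩
  ∑[ m < suc n ] ((f ⊛ g) m *ℤ h (n ∸ m))
    ≡⟨ ∑-cong (suc n) (λ m → trans (cong (_*ℤ h (n ∸ m)) (⊛-coeff f g m)) (sym (∑-*ʳ (h (n ∸ m)) (λ k → f k *ℤ g (m ∸ k)) (suc m)))) ⟩
  ∑[ m < suc n ] ∑[ k < suc m ] (f k *ℤ g (m ∸ k) *ℤ h (n ∸ m))
    ≡⟨ ∑-triangle (λ k m → f k *ℤ g (m ∸ k) *ℤ h (n ∸ m)) n ⟩
  ∑[ k < suc n ] ∑[ j < suc (n ∸ k) ] (f k *ℤ g (k + j ∸ k) *ℤ h (n ∸ (k + j)))
    ≡⟨ ∑-cong (suc n) (λ k → trans (∑-cong (suc (n ∸ k)) (reassoc k)) (∑-*ˡ (f k) (λ j → g j *ℤ h (n ∸ k ∸ j)) (suc (n ∸ k)))) ⟩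
  ∑[ k < suc n ] (f k *ℤ ∑[ j < suc (n ∸ k) ] (g j *ℤ h (n ∸ k ∸ j)))
    ≡⟨ ∑-cong (suc n) (λ k → cong (f k *ℤ_) (⊛-coeff g h (n ∸ k))) ⟨
  ∑[ k < suc n ] (f k *ℤ (g ⊛ h) (n ∸ k))
    ≡⟨ ⊛-coeff f (g ⊛ h) n ⟨
  (f ⊛ (g ⊛ h)) n
    ∎
  where
  open ≡-Reasoning
  reassoc : ∀ k j → f k *ℤ g (k + j ∸ k) *ℤ h (n ∸ (k + j)) ≡ f k *ℤ (g j *ℤ h (n ∸ k ∸ j))
  reassoc k j = trans (cong₂ (λ a b → f k *ℤ g a *ℤ h b) (ℕ.m+n∸m≡n k j) (sym (ℕ.∸-+-assoc n k j)))
                      (ℤ.*-assoc (f k) _ _)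

⊛-distribˡ-⊕ : ∀ f g h → f ⊛ (g ⊕ h) ≋ f ⊛ g ⊕ f ⊛ h
⊛-distribˡ-⊕ f g h n = begin
  (f ⊛ (g ⊕ h)) n
    ≡⟨ ⊛-coeff f (g ⊕ h) n ⟩
  ∑[ k < suc n ] (f k *ℤ (g (n ∸ k) +ℤ h (n ∸ k)))
    ≡⟨ ∑-cong (suc n) (λ k → ℤ.*-distribˡ-+ (f k) (g (n ∸ k)) (h (n ∸ k))) ⟩
  ∑[ k < suc n ] (f k *ℤ g (n ∸ k) +ℤ f k *ℤ h (n ∸ k))
    ≡⟨ ∑-distrib-+ (λ k → f k *ℤ g (n ∸ k)) (λ k → f k *ℤ h (n ∸ k)) (suc n) ⟩
  ∑[ k < suc n ] (f k *ℤ g (n ∸ k)) +ℤ ∑[ k < suc n ] (f k *ℤ h (n ∸ k))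
    ≡⟨ cong₂ _+ℤ_ (⊛-coeff f g n) (⊛-coeff f h n) ⟨
  (f ⊛ g ⊕ f ⊛ h) n
    ∎
  where open ≡-Reasoning

⊛-distribʳ-⊕ : ∀ f g h → (g ⊕ h) ⊛ f ≋ g ⊛ f ⊕ h ⊛ f
⊛-distribʳ-⊕ f g h =
  ≋-trans (⊛-comm (g ⊕ h) f) (≋-trans (⊛-distribˡ-⊕ f g h) (⊕-cong (⊛-comm f g) (⊛-comm f h)))

⊛-swap : ∀ f g h → f ⊛ (g ⊛ h) ≋ g ⊛ (f ⊛ h)
⊛-swap f g h =
  ≋-trans (≋-sym (⊛-assoc f g h)) (≋-trans (⊛-congʳ h (⊛-comm f g)) (⊛-assoc g f h))

mono-⊛-coeff : ∀ c e f n → (mono c e ⊛ f) n ≡ (if e ≤ᵇ n then c *ℤ f (n ∸ e) else 0ℤ)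
mono-⊛-coeff c e f n = begin
  (mono c e ⊛ f) n
    ≡⟨ ⊛-coeff (mono c e) f n ⟩
  ∑[ k < suc n ] (mono c e k *ℤ f (n ∸ k))
    ≡⟨ ∑-cong (suc n) (λ k → if-*ℤ (k ≡ᵇ e) {k}) ⟩
  ∑[ k < suc n ] (if k ≡ᵇ e then c *ℤ f (n ∸ k) else 0ℤ)
    ≡⟨ ∑-δ (λ k → c *ℤ f (n ∸ k)) e (suc n) ⟩
  (if e <ᵇ suc n then c *ℤ f (n ∸ e) else 0ℤ)
    ≡⟨ cong (if_then c *ℤ f (n ∸ e) else 0ℤ) (<ᵇ-suc e) ⟩
  (if e ≤ᵇ n then c *ℤ f (n ∸ e) else 0ℤ)
    ∎
  where
  open ≡-Reasoning
  <ᵇ-suc : ∀ e → (e <ᵇ suc n) ≡ (e ≤ᵇ n)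
  <ᵇ-suc zero    = refl
  <ᵇ-suc (suc e) = refl
  if-*ℤ : ∀ b {k} → (if b then c else 0ℤ) *ℤ f (n ∸ k) ≡ (if b then c *ℤ f (n ∸ k) else 0ℤ)
  if-*ℤ true        = refl
  if-*ℤ false {k}   = ℤ.*-zeroˡ (f (n ∸ k))

q^-⊛-coeff : ∀ e f n → (q^ e ⊛ f) n ≡ (if e ≤ᵇ n then f (n ∸ e) else 0ℤ)
q^-⊛-coeff e f n with e ≤ᵇ n | mono-⊛-coeff 1ℤ e f n
... | true  | eq = trans eq (ℤ.*-identityˡ _)
... | false | eq = eq

q^-⊛-< : ∀ e f {n} → n < e → (q^ e ⊛ f) n ≡ 0ℤ
q^-⊛-< e f {n} n<e = trans (q^-⊛-coeff e f n) (cong (if_then f (n ∸ e) else 0ℤ) (≤ᵇ-false n<e))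

q^-⊛-≥ : ∀ e f {n} → e ≤ n → (q^ e ⊛ f) n ≡ f (n ∸ e)
q^-⊛-≥ e f {n} e≤n = trans (q^-⊛-coeff e f n) (cong (if_then f (n ∸ e) else 0ℤ) (≤ᵇ-true e≤n))

⊛-identityˡ : ∀ f → one ⊛ f ≋ f
⊛-identityˡ f n = q^-⊛-≥ 0 f z≤n

⊛-identityʳ : ∀ f → f ⊛ one ≋ f
⊛-identityʳ f = ≋-trans (⊛-comm f one) (⊛-identityˡ f)

mono-⊛-mono : ∀ a b e e′ → mono a e ⊛ mono b e′ ≋ mono (a *ℤ b) (e + e′)
mono-⊛-mono a b e e′ n with e ≤ᵇ n | ℕ.≤ᵇ-reflects-≤ e n | mono-⊛-coeff a e (mono b e′) n
... | true  | ofʸ e≤n | eq = trans eq (*-if (n ∸ e ≡ᵇ e′) (∸-≡ᵇ e n e≤n))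
  where
  ∸-≡ᵇ : ∀ e n → e ≤ n → (n ∸ e ≡ᵇ e′) ≡ (n ≡ᵇ e + e′)
  ∸-≡ᵇ zero    n       _         = refl
  ∸-≡ᵇ (suc e) (suc n) (s≤s e≤n) = ∸-≡ᵇ e n e≤n
  *-if : ∀ c {c′} → c ≡ c′ → a *ℤ (if c then b else 0ℤ) ≡ (if c′ then a *ℤ b else 0ℤ)
  *-if true  refl = refl
  *-if false refl = ℤ.*-zeroʳ a
... | false | ofⁿ e≰n | eq = trans eq (sym (cong (if_then a *ℤ b else 0ℤ) (≡ᵇ-false n≢e+e′)))
  where
  n≢e+e′ : n ≢ e + e′
  n≢e+e′ refl = e≰n (ℕ.m≤m+n e e′)

q^-⊛-q^ : ∀ a b f → q^ a ⊛ (q^ b ⊛ f) ≋ q^ (a + b) ⊛ f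
q^-⊛-q^ a b f = ≋-trans (≋-sym (⊛-assoc (q^ a) (q^ b) f)) (⊛-congʳ f (mono-⊛-mono 1ℤ 1ℤ a b))

mono-0 : ∀ e n → mono 0ℤ e n ≡ 0ℤ
mono-0 e n with n ≡ᵇ e
... | true  = refl
... | false = refl

mono-neg : ∀ e n → mono (- 1ℤ) e n ≡ - (q^ e) n
mono-neg e n with n ≡ᵇ e
... | true  = refl
... | false = refl

mono-0-⊛ : ∀ e f m → (mono 0ℤ e ⊛ f) m ≡ 0ℤ
mono-0-⊛ e f m with e ≤ᵇ m | mono-⊛-coeff 0ℤ e f m
... | true  | eq = eq
... | false | eq = eq

mono-neg-⊛ : ∀ c e f m → (mono (- c) e ⊛ f) m ≡ - (mono c e ⊛ f) m
mono-neg-⊛ c e f m with e ≤ᵇ m | mono-⊛-coeff (- c) e f m | mono-⊛-coeff c e f m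
... | true  | eq | eq′ = trans eq (trans (sym (ℤ.neg-distribˡ-* c (f (m ∸ e)))) (cong -_ (sym eq′)))
... | false | eq | eq′ = trans eq (cong -_ (sym eq′))

𝟙-≤ᵇ-q^ : ∀ e f m → 𝟙 (e ≤ᵇ m) *ℤ f (m ∸ e) ≡ (q^ e ⊛ f) m
𝟙-≤ᵇ-q^ e f m = trans (𝟙-* (e ≤ᵇ m) (f (m ∸ e))) (sym (q^-⊛-coeff e f m))

𝟙-∧-≤ᵇ-q^ : ∀ c e f n → 𝟙 (c ∧ (e ≤ᵇ n)) *ℤ f (n ∸ e) ≡ 𝟙 c *ℤ (q^ e ⊛ f) n
𝟙-∧-≤ᵇ-q^ c e f n =
  trans (cong (_*ℤ f (n ∸ e)) (𝟙-∧ c (e ≤ᵇ n))) (trans (ℤ.*-assoc (𝟙 c) _ _) (cong (𝟙 c *ℤ_) (𝟙-≤ᵇ-q^ e f n)))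

geom-≥ : ∀ k {n} → 1 ≤ k → k ≤ n → geom k n ≡ geom k (n ∸ k)
geom-≥ k {n} 1≤k k≤n with k ∣? n | k ∣? (n ∸ k)
... | yes _   | yes _   = refl
... | no  _   | no  _   = refl
... | yes k∣n | no  k∤d = contradiction (∣m+n∣m⇒∣n (subst (k ∣_) (sym (ℕ.m+[n∸m]≡n k≤n)) k∣n) ∣-refl) k∤d
... | no  k∤n | yes k∣d = contradiction (∣m∸n∣n⇒∣m k k≤n k∣d ∣-refl) k∤n

geom-< : ∀ k {n} → 1 ≤ n → n < k → geom k n ≡ 0ℤ
geom-< k {suc n} _ n<k with k ∣? suc n
... | yes k∣n = contradiction (∣⇒≤ k∣n) (ℕ.<⇒≱ n<k)
... | no  _   = refl

geom-unfold : ∀ k → 1 ≤ k → geom k ≋ one ⊕ q^ k ⊛ geom k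
geom-unfold k@(suc _) _ zero = refl
geom-unfold k 1≤k (suc n) with k ≤ᵇ suc n | ℕ.≤ᵇ-reflects-≤ k (suc n) | q^-⊛-coeff k (geom k) (suc n)
... | true  | ofʸ k≤n | eq = trans (geom-≥ k 1≤k k≤n) (trans (sym (ℤ.+-identityˡ _)) (cong (0ℤ +ℤ_) (sym eq)))
... | false | ofⁿ k≰n | eq = trans (geom-< k (s≤s z≤n) (ℕ.≰⇒> k≰n)) (cong (0ℤ +ℤ_) (sym eq))

geom-⊛ : ∀ k f → 1 ≤ k → geom k ⊛ f ≋ f ⊕ q^ k ⊛ (geom k ⊛ f)
geom-⊛ k f 1≤k =
  ≋-trans (⊛-congʳ f (geom-unfold k 1≤k))
  (≋-trans (⊛-distribʳ-⊕ f one (q^ k ⊛ geom k))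
  (⊕-cong (⊛-identityˡ f) (⊛-assoc (q^ k) (geom k) f)))

q^-⊛-series : ∀ a k A → 1 ≤ k → q^ a ⊛ (A ⊛ geom k) ≋ q^ a ⊛ A ⊕ q^ (a + k) ⊛ (A ⊛ geom k)
q^-⊛-series a k A 1≤k = begin
  q^ a ⊛ (A ⊛ geom k)                              ≈⟨ ⊛-congˡ (q^ a) (≋-trans (⊛-comm A (geom k)) (geom-⊛ k A 1≤k)) ⟩
  q^ a ⊛ (A ⊕ q^ k ⊛ (geom k ⊛ A))                 ≈⟨ ⊛-distribˡ-⊕ (q^ a) A (q^ k ⊛ (geom k ⊛ A)) ⟩
  q^ a ⊛ A ⊕ q^ a ⊛ (q^ k ⊛ (geom k ⊛ A))          ≈⟨ ⊕-cong (≋-refl {q^ a ⊛ A}) (≋-trans (q^-⊛-q^ a k (geom k ⊛ A)) (⊛-congˡ (q^ (a + k)) (⊛-comm (geom k) A))) ⟩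
  q^ a ⊛ A ⊕ q^ (a + k) ⊛ (A ⊛ geom k)             ∎
  where open SetoidReasoning ≋-setoid

prodPS-upTo-suc : ∀ (F : ℕ → PS) M → prodPS (map F (upTo (suc M))) ≋ F M ⊛ prodPS (map F (upTo M))
prodPS-upTo-suc F M n = begin
  prodPS (map F (upTo (suc M))) n          ≡⟨ cong (λ l → prodPS (map F l) n) (List.upTo-∷ʳ M) ⟨
  prodPS (map F (upTo M ++ [ M ])) n       ≡⟨ cong (λ l → prodPS l n) (List.map-++ F (upTo M) [ M ]) ⟩
  prodPS (map F (upTo M) ++ [ F M ]) n     ≡⟨ prodPS-∷ʳ (map F (upTo M)) (F M) n ⟩
  (F M ⊛ prodPS (map F (upTo M))) n        ∎
  where
  open ≡-Reasoning
  prodPS-∷ʳ : ∀ fs g → prodPS (fs ++ [ g ]) ≋ g ⊛ prodPS fs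
  prodPS-∷ʳ []       g = ≋-refl
  prodPS-∷ʳ (f ∷ fs) g = ≋-trans (⊛-congˡ f (prodPS-∷ʳ fs g)) (⊛-swap f g (prodPS fs))

recurrence-unique : ∀ e c {f g A B : PS} N → 1 ≤ e →
  (∀ m → m ≤ N → A m ≡ B m) →
  (∀ m → m ≤ N → f m ≡ A m +ℤ c *ℤ (q^ e ⊛ f) m) →
  (∀ m → m ≤ N → g m ≡ B m +ℤ c *ℤ (q^ e ⊛ g) m) →
  ∀ m → m ≤ N → f m ≡ g m
recurrence-unique e c {f} {g} {A} {B} N 1≤e A≡B f-rec g-rec = <-rec (λ m → m ≤ N → f m ≡ g m) step
  where
  step : ∀ m → (∀ {i} → i < m → i ≤ N → f i ≡ g i) → m ≤ N → f m ≡ g m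
  step m ih m≤N = begin
    f m                              ≡⟨ f-rec m m≤N ⟩
    A m +ℤ c *ℤ (q^ e ⊛ f) m         ≡⟨ cong₂ (λ a x → a +ℤ c *ℤ x) (A≡B m m≤N) shifted ⟩
    B m +ℤ c *ℤ (q^ e ⊛ g) m         ≡⟨ g-rec m m≤N ⟨
    g m                              ∎
    where
    open ≡-Reasoning
    shifted : (q^ e ⊛ f) m ≡ (q^ e ⊛ g) m
    shifted with e ≤ᵇ m | ℕ.≤ᵇ-reflects-≤ e m | q^-⊛-coeff e f m | q^-⊛-coeff e g m
    ... | false | _        | f≡ | g≡ = trans f≡ (sym g≡)
    ... | true  | ofʸ e≤m | f≡ | g≡ =
      trans f≡ (trans (ih (ℕ.∸-monoʳ-< 1≤e e≤m) (ℕ.≤-trans (ℕ.m∸n≤m m e) m≤N)) (sym g≡))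

-- Hooks

+-sum : ∀ {A : Set} (f : A → ℕ) xs → + sum (map f xs) ≡ sumℤ (map (λ x → + f x) xs)
+-sum f []       = refl
+-sum f (x ∷ xs) = trans (sym (ℤ.pos-+ (f x) _)) (cong (+ f x +ℤ_) (+-sum f xs))

+-if : ∀ b → + (if b then 1 else 0) ≡ 𝟙 b
+-if true  = refl
+-if false = refl

hookRow : ℕ → List ℕ → ℕ → ℕ → ℕ
hookRow t lam i li = sum (map (λ j → if (li + conj lam j + 1 ≡ᵇ t + i + j) then 1 else 0)
                              (map suc (upTo li)))

-- numHooks sums over the rows with a local function that is out of scope;
-- hooksFrom is that function, recovered by unification in numHooks-unfold.
mutual
  hooksFrom : ℕ → List ℕ → ℕ → List ℕ → ℕ
  hooksFrom = _

  numHooks-unfold : ∀ t a r → numHooks t (a ∷ r) ≡ hookRow t (a ∷ r) 1 a + hooksFrom t (a ∷ r) 2 r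
  numHooks-unfold t a r with a ∷ r | 2
  ... | lam | i = refl

numHooks-hooksFrom : ∀ t l → numHooks t l ≡ hooksFrom t l 1 l
numHooks-hooksFrom t []      = refl
numHooks-hooksFrom t (a ∷ r) = numHooks-unfold t a r

hookRow-∑ : ∀ t lam i li →
  + hookRow t lam i li ≡ ∑[ j < li ] 𝟙 (li + conj lam (suc j) + 1 ≡ᵇ t + i + suc j)
hookRow-∑ t lam i li = begin
  + hookRow t lam i li
    ≡⟨ cong (λ xs → + sum xs) (List.map-∘ (upTo li)) ⟨
  + sum (map (Cell ∘ suc) (upTo li))
    ≡⟨ +-sum (Cell ∘ suc) (upTo li) ⟩
  sumℤ (map (λ j → + Cell (suc j)) (upTo li))
    ≡⟨ sumℤ-upTo (λ j → + Cell (suc j)) li ⟩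
  ∑[ j < li ] (+ Cell (suc j))
    ≡⟨ ∑-cong li (λ j → +-if (li + conj lam (suc j) + 1 ≡ᵇ t + i + suc j)) ⟩
  ∑[ j < li ] 𝟙 (li + conj lam (suc j) + 1 ≡ᵇ t + i + suc j)
    ∎
  where
  open ≡-Reasoning
  Cell : ℕ → ℕ
  Cell j = if (li + conj lam j + 1 ≡ᵇ t + i + j) then 1 else 0

Nonincreasing : List ℕ → Set
Nonincreasing l = nonincreasing l ≡ true

firstPart : List ℕ → ℕ
firstPart []      = 0
firstPart (x ∷ _) = x

Nonincreasing-tail : ∀ x s → Nonincreasing (x ∷ s) → Nonincreasing s
Nonincreasing-tail x []      _  = refl
Nonincreasing-tail x (y ∷ s) ni with y ≤ᵇ x
... | true = ni

Nonincreasing-head : ∀ x s → Nonincreasing (x ∷ s) → firstPart s ≤ x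
Nonincreasing-head x []      _  = z≤n
Nonincreasing-head x (y ∷ s) ni with y ≤ᵇ x in y≤ᵇx
... | true = ℕ.≤ᵇ⇒≤ y x (Equivalence.from Bool.T-≡ y≤ᵇx)

conj-∷ : ∀ x s j → conj (x ∷ s) j ≡ (if j ≤ᵇ x then suc (conj s j) else conj s j)
conj-∷ x s j with j ≤ᵇ x
... | true  = refl
... | false = refl

conj-∷-≤ : ∀ x s {j} → j ≤ x → conj (x ∷ s) j ≡ suc (conj s j)
conj-∷-≤ x s {j} j≤x = trans (conj-∷ x s j) (cong (if_then suc (conj s j) else conj s j) (≤ᵇ-true j≤x))

conj-> : ∀ r {j} → Nonincreasing r → firstPart r < j → conj r j ≡ 0
conj-> []      _  _ = refl
conj-> (x ∷ r) {j} ni x<j = begin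
  conj (x ∷ r) j  ≡⟨ conj-∷ x r j ⟩
  (if j ≤ᵇ x then suc (conj r j) else conj r j)
                  ≡⟨ cong (if_then suc (conj r j) else conj r j) (≤ᵇ-false x<j) ⟩
  conj r j        ≡⟨ conj-> r (Nonincreasing-tail x r ni) (ℕ.≤-<-trans (Nonincreasing-head x r ni) x<j) ⟩
  0               ∎
  where open ≡-Reasoning

hookRow-shift : ∀ t L p s x → (∀ j → j ≤ x → conj L j ≡ p + conj s j) →
                hookRow t L (suc p) x ≡ hookRow t s 1 x
hookRow-shift t L p s x conjL≡ = ℤ.+-injective (begin
  + hookRow t L (suc p) x
    ≡⟨ hookRow-∑ t L (suc p) x ⟩
  ∑[ j < x ] 𝟙 (x + conj L (suc j) + 1 ≡ᵇ t + suc p + suc j)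
    ≡⟨ ∑-cong-< x (λ j j<x → cong 𝟙 (cell j j<x)) ⟩
  ∑[ j < x ] 𝟙 (x + conj s (suc j) + 1 ≡ᵇ t + 1 + suc j)
    ≡⟨ hookRow-∑ t s 1 x ⟨
  + hookRow t s 1 x
    ∎)
  where
  open ≡-Reasoning
  lhs : ∀ x p c → x + (p + c) + 1 ≡ p + (x + c + 1)
  lhs = solve-∀ℕ
  rhs : ∀ t p j → t + suc p + j ≡ p + (t + 1 + j)
  rhs = solve-∀ℕ
  cell : ∀ j → j < x → (x + conj L (suc j) + 1 ≡ᵇ t + suc p + suc j) ≡ (x + conj s (suc j) + 1 ≡ᵇ t + 1 + suc j)
  cell j j<x = trans (cong₂ _≡ᵇ_ (trans (cong (λ c → x + c + 1) (conjL≡ (suc j) j<x)) (lhs x p _)) (rhs t p (suc j)))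
                     (≡ᵇ-+ p _ _)

-- Deleting the first rows of a partition lowers all column lengths of the
-- remaining rows uniformly and shifts the row index by the same amount, so
-- hook lengths in the remaining rows do not change.
hooksFrom-shift : ∀ t L p s → Nonincreasing s → (∀ j → j ≤ firstPart s → conj L j ≡ p + conj s j) →
                  hooksFrom t L (suc p) s ≡ hooksFrom t s 1 s
hooksFrom-shift t L p []      _  _      = refl
hooksFrom-shift t L p (x ∷ s) ni conjL≡ = cong₂ _+_
  (hookRow-shift t L p (x ∷ s) x conjL≡)
  (trans (hooksFrom-shift t L (suc p) s ni′ conjL≡′) (sym (hooksFrom-shift t (x ∷ s) 1 s ni′ conj∷≡)))
  where
  ni′ : Nonincreasing s
  ni′ = Nonincreasing-tail x s ni
  below : ∀ {j} → j ≤ firstPart s → j ≤ x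
  below j≤ = ℕ.≤-trans j≤ (Nonincreasing-head x s ni)
  conj∷≡ : ∀ j → j ≤ firstPart s → conj (x ∷ s) j ≡ 1 + conj s j
  conj∷≡ j j≤ = conj-∷-≤ x s (below j≤)
  conjL≡′ : ∀ j → j ≤ firstPart s → conj L j ≡ suc p + conj s j
  conjL≡′ j j≤ = trans (conjL≡ j (below j≤)) (trans (cong (λ c → p + c) (conj∷≡ j j≤)) (ℕ.+-suc p _))

numHooks-∷ : ∀ t a r → Nonincreasing (a ∷ r) → numHooks t (a ∷ r) ≡ hookRow t (a ∷ r) 1 a + numHooks t r
numHooks-∷ t a r ni = trans (numHooks-unfold t a r) (cong (λ h → hookRow t (a ∷ r) 1 a + h)
  (trans (hooksFrom-shift t (a ∷ r) 1 r (Nonincreasing-tail a r ni) conj∷≡) (sym (numHooks-hooksFrom t r))))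
  where
  conj∷≡ : ∀ j → j ≤ firstPart r → conj (a ∷ r) j ≡ 1 + conj r j
  conj∷≡ j j≤ = conj-∷-≤ a r (ℕ.≤-trans j≤ (Nonincreasing-head a r ni))

-- The 2-hooks of the first row sit in its last cell (exactly when one more row
-- reaches column λ₁) and in its last but one cell (when no other row reaches
-- column λ₁ - 1).
twoHooks-firstRow : ∀ m r →
  + hookRow 2 (suc m ∷ r) 1 (suc m) ≡ 𝟙 (conj r (suc m) ≡ᵇ 1) +ℤ 𝟙 ((2 ≤ᵇ suc m) ∧ (conj r m ≡ᵇ 0))
twoHooks-firstRow m r = begin
  + hookRow 2 (suc m ∷ r) 1 (suc m)
    ≡⟨ hookRow-∑ 2 (suc m ∷ r) 1 (suc m) ⟩
  ∑[ j < suc m ] 𝟙 (suc m + conj (suc m ∷ r) (suc j) + 1 ≡ᵇ 2 + 1 + suc j)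
    ≡⟨ ∑-cong-< (suc m) (λ j j≤m → cong 𝟙 (cell j j≤m)) ⟩
  ∑[ j < suc m ] Cell j
    ≡⟨ ∑-init-last Cell m ⟩
  ∑[ j < m ] Cell j +ℤ Cell m
    ≡⟨ cong₂ _+ℤ_ (earlierCells m r) (cong 𝟙 (trans (cong (m + conj r (suc m) ≡ᵇ_) (ℕ.+-comm 1 m)) (≡ᵇ-+ m _ 1))) ⟩
  𝟙 ((2 ≤ᵇ suc m) ∧ (conj r m ≡ᵇ 0)) +ℤ 𝟙 (conj r (suc m) ≡ᵇ 1)
    ≡⟨ ℤ.+-comm (𝟙 ((2 ≤ᵇ suc m) ∧ (conj r m ≡ᵇ 0))) _ ⟩
  𝟙 (conj r (suc m) ≡ᵇ 1) +ℤ 𝟙 ((2 ≤ᵇ suc m) ∧ (conj r m ≡ᵇ 0))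
    ∎
  where
  open ≡-Reasoning
  Cell : ℕ → ℤ
  Cell j = 𝟙 (m + conj r (suc j) ≡ᵇ suc j)
  arith : ∀ m c → suc m + suc c + 1 ≡ 3 + (m + c)
  arith = solve-∀ℕ
  cell : ∀ j → j < suc m → (suc m + conj (suc m ∷ r) (suc j) + 1 ≡ᵇ 2 + 1 + suc j) ≡ (m + conj r (suc j) ≡ᵇ suc j)
  cell j j<1+m = trans (cong (λ c → suc m + c + 1 ≡ᵇ 3 + suc j) (conj-∷-≤ (suc m) r j<1+m))
                       (trans (cong (_≡ᵇ 3 + suc j) (arith m (conj r (suc j)))) (≡ᵇ-+ 3 (m + conj r (suc j)) (suc j)))
  earlierCells : ∀ m r → ∑[ j < m ] 𝟙 (m + conj r (suc j) ≡ᵇ suc j) ≡ 𝟙 ((2 ≤ᵇ suc m) ∧ (conj r m ≡ᵇ 0))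
  earlierCells zero    r = refl
  earlierCells (suc m) r = begin
    ∑[ j < suc m ] C j        ≡⟨ ∑-init-last C m ⟩
    ∑[ j < m ] C j +ℤ C m     ≡⟨ cong₂ _+ℤ_ (∑-zero m (λ j j<m → cong 𝟙 (≡ᵇ-false (tooShort j j<m)))) lastCell ⟩
    0ℤ +ℤ 𝟙 (conj r (suc m) ≡ᵇ 0)
                              ≡⟨ ℤ.+-identityˡ _ ⟩
    𝟙 (conj r (suc m) ≡ᵇ 0)   ∎
    where
    C : ℕ → ℤ
    C j = 𝟙 (suc m + conj r (suc j) ≡ᵇ suc j)
    tooShort : ∀ j → j < m → suc m + conj r (suc j) ≢ suc j
    tooShort j j<m eq = ℕ.<⇒≱ (s≤s j<m) (subst (suc m ≤_) eq (ℕ.m≤m+n (suc m) _))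
    lastCell : C m ≡ 𝟙 (conj r (suc m) ≡ᵇ 0)
    lastCell = cong 𝟙 (trans (cong (suc m + conj r (suc m) ≡ᵇ_) (sym (ℕ.+-identityʳ (suc m))))
                             (≡ᵇ-+ (suc m) _ 0))

numHooks₂-∷ : ∀ m r → Nonincreasing (suc m ∷ r) →
  + numHooks 2 (suc m ∷ r) ≡ 𝟙 (conj r (suc m) ≡ᵇ 1) +ℤ 𝟙 ((2 ≤ᵇ suc m) ∧ (conj r m ≡ᵇ 0)) +ℤ + numHooks 2 r
numHooks₂-∷ m r ni = begin
  + numHooks 2 (suc m ∷ r)                                     ≡⟨ cong +_ (numHooks-∷ 2 (suc m) r ni) ⟩
  + (hookRow 2 (suc m ∷ r) 1 (suc m) + numHooks 2 r)           ≡⟨ ℤ.pos-+ _ (numHooks 2 r) ⟩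
  + hookRow 2 (suc m ∷ r) 1 (suc m) +ℤ + numHooks 2 r          ≡⟨ cong (_+ℤ + numHooks 2 r) (twoHooks-firstRow m r) ⟩
  𝟙 (conj r (suc m) ≡ᵇ 1) +ℤ 𝟙 ((2 ≤ᵇ suc m) ∧ (conj r m ≡ᵇ 0)) +ℤ + numHooks 2 r ∎
  where open ≡-Reasoning

-- Sums over words and partitions

∑words : ℕ → ℕ → (List ℕ → ℤ) → ℤ
∑words N zero    F = F []
∑words N (suc k) F = ∑[ p < N ] ∑words N k (λ l → F (suc p ∷ l))

InRange : ℕ → ℕ → Set
InRange N x = 1 ≤ x × x ≤ N

∑words-cong : ∀ N k {F G} → (∀ l → All (InRange N) l → length l ≡ k → F l ≡ G l) →
              ∑words N k F ≡ ∑words N k G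
∑words-cong N zero    F≡G = F≡G [] [] refl
∑words-cong N (suc k) F≡G = ∑-cong-< N (λ p p<N →
  ∑words-cong N k (λ l inR len → F≡G (suc p ∷ l) ((s≤s z≤n , p<N) ∷ inR) (cong suc len)))

∑words-const-0 : ∀ N k → ∑words N k (λ _ → 0ℤ) ≡ 0ℤ
∑words-const-0 N zero    = refl
∑words-const-0 N (suc k) = ∑-zero N (λ _ _ → ∑words-const-0 N k)

∑words-zero : ∀ N k {F} → (∀ l → All (InRange N) l → length l ≡ k → F l ≡ 0ℤ) → ∑words N k F ≡ 0ℤ
∑words-zero N k F≡0 = trans (∑words-cong N k F≡0) (∑words-const-0 N k)

∑words-distrib-+ : ∀ N k F G → ∑words N k (λ l → F l +ℤ G l) ≡ ∑words N k F +ℤ ∑words N k G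
∑words-distrib-+ N zero    F G = refl
∑words-distrib-+ N (suc k) F G =
  trans (∑-cong N (λ p → ∑words-distrib-+ N k (F ∘ (suc p ∷_)) (G ∘ (suc p ∷_)))) (∑-distrib-+ _ _ N)

∑words-*ˡ : ∀ N k c F → ∑words N k (λ l → c *ℤ F l) ≡ c *ℤ ∑words N k F
∑words-*ˡ N zero    c F = refl
∑words-*ˡ N (suc k) c F = trans (∑-cong N (λ p → ∑words-*ˡ N k c (F ∘ (suc p ∷_)))) (∑-*ˡ c _ N)

∑words-∑ : ∀ N k n (F : ℕ → List ℕ → ℤ) → ∑words N k (λ l → ∑[ p < n ] F p l) ≡ ∑[ p < n ] ∑words N k (F p)
∑words-∑ N zero    n F = refl
∑words-∑ N (suc k) n F =
  trans (∑-cong N (λ q → ∑words-∑ N k n (λ p l → F p (suc q ∷ l))))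
        (∑-comm (λ q p → ∑words N k (λ l → F p (suc q ∷ l))) N n)

∑words-∷ʳ : ∀ N k F → ∑words N (suc k) F ≡ ∑words N k (λ l → ∑[ p < N ] F (l ∷ʳ suc p))
∑words-∷ʳ N zero    F = refl
∑words-∷ʳ N (suc k) F = ∑-cong N (λ p → ∑words-∷ʳ N k (F ∘ (suc p ∷_)))

sumℤ-++ : ∀ xs ys → sumℤ (xs ++ ys) ≡ sumℤ xs +ℤ sumℤ ys
sumℤ-++ []       ys = sym (ℤ.+-identityˡ _)
sumℤ-++ (x ∷ xs) ys = trans (cong (x +ℤ_) (sumℤ-++ xs ys)) (sym (ℤ.+-assoc x _ _))

sumℤ-concatMap : ∀ {A B : Set} (f : B → ℤ) (g : A → List B) xs →
                 sumℤ (map f (concatMap g xs)) ≡ sumℤ (map (λ x → sumℤ (map f (g x))) xs)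
sumℤ-concatMap f g []       = refl
sumℤ-concatMap f g (x ∷ xs) =
  trans (cong sumℤ (List.map-++ f (g x) (concatMap g xs)))
  (trans (sumℤ-++ (map f (g x)) _) (cong (sumℤ (map f (g x)) +ℤ_) (sumℤ-concatMap f g xs)))

sumℤ-filterᵇ : ∀ {A : Set} (f : A → ℤ) p xs → sumℤ (map f (filterᵇ p xs)) ≡ sumℤ (map (λ x → 𝟙 (p x) *ℤ f x) xs)
sumℤ-filterᵇ f p []       = refl
sumℤ-filterᵇ f p (x ∷ xs) with p x
... | true  = cong₂ _+ℤ_ (sym (ℤ.*-identityˡ (f x))) (sumℤ-filterᵇ f p xs)
... | false = trans (sumℤ-filterᵇ f p xs) (sym (ℤ.+-identityˡ _))

sumℤ-listsOf : ∀ N k F → sumℤ (map F (listsOf k N)) ≡ ∑words N k F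
sumℤ-listsOf N zero    F = ℤ.+-identityʳ (F [])
sumℤ-listsOf N (suc k) F = begin
  sumℤ (map F (concatMap (λ p → map (p ∷_) (listsOf k N)) (map suc (upTo N))))
    ≡⟨ sumℤ-concatMap F (λ p → map (p ∷_) (listsOf k N)) (map suc (upTo N)) ⟩
  sumℤ (map (λ p → sumℤ (map F (map (p ∷_) (listsOf k N)))) (map suc (upTo N)))
    ≡⟨ cong sumℤ (List.map-∘ (upTo N)) ⟨
  sumℤ (map (λ p → sumℤ (map F (map (suc p ∷_) (listsOf k N)))) (upTo N))
    ≡⟨ sumℤ-upTo (λ p → sumℤ (map F (map (suc p ∷_) (listsOf k N)))) N ⟩
  ∑[ p < N ] sumℤ (map F (map (suc p ∷_) (listsOf k N)))
    ≡⟨ ∑-cong N (λ p → trans (cong sumℤ (sym (List.map-∘ (listsOf k N)))) (sumℤ-listsOf N k (F ∘ (suc p ∷_)))) ⟩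
  ∑[ p < N ] ∑words N k (F ∘ (suc p ∷_))
    ∎
  where open ≡-Reasoning

∑-partitions : ∀ (c : List ℕ → Bool) (h : List ℕ → ℕ) N →
  + sum (map h (filterᵇ c (partitions N)))
    ≡ ∑[ k < suc N ] ∑words N k (λ l → 𝟙 (isPartitionOf N l) *ℤ (𝟙 (c l) *ℤ + h l))
∑-partitions c h N = begin
  + sum (map h (filterᵇ c (partitions N)))
    ≡⟨ +-sum h (filterᵇ c (partitions N)) ⟩
  sumℤ (map (λ l → + h l) (filterᵇ c (partitions N)))
    ≡⟨ sumℤ-filterᵇ (λ l → + h l) c (partitions N) ⟩
  sumℤ (map (λ l → 𝟙 (c l) *ℤ + h l) (partitions N))
    ≡⟨ sumℤ-filterᵇ (λ l → 𝟙 (c l) *ℤ + h l) (isPartitionOf N) (concatMap (λ k → listsOf k N) (upTo (suc N))) ⟩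
  sumℤ (map F (concatMap (λ k → listsOf k N) (upTo (suc N))))
    ≡⟨ sumℤ-concatMap F (λ k → listsOf k N) (upTo (suc N)) ⟩
  sumℤ (map (λ k → sumℤ (map F (listsOf k N))) (upTo (suc N)))
    ≡⟨ sumℤ-upTo (λ k → sumℤ (map F (listsOf k N))) (suc N) ⟩
  ∑[ k < suc N ] sumℤ (map F (listsOf k N))
    ≡⟨ ∑-cong (suc N) (λ k → sumℤ-listsOf N k F) ⟩
  ∑[ k < suc N ] ∑words N k F
    ∎
  where
  open ≡-Reasoning
  F : List ℕ → ℤ
  F l = 𝟙 (isPartitionOf N l) *ℤ (𝟙 (c l) *ℤ + h l)

∑words≤ : ℕ → (List ℕ → ℤ) → ℤ
∑words≤ N F = ∑[ k < suc N ] ∑words N k F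

∑words≤-cong : ∀ N {F G} → (∀ l → All (InRange N) l → F l ≡ G l) → ∑words≤ N F ≡ ∑words≤ N G
∑words≤-cong N F≡G = ∑-cong (suc N) (λ k → ∑words-cong N k (λ l inR _ → F≡G l inR))

∑words≤-distrib-+ : ∀ N F G → ∑words≤ N (λ l → F l +ℤ G l) ≡ ∑words≤ N F +ℤ ∑words≤ N G
∑words≤-distrib-+ N F G = trans (∑-cong (suc N) (λ k → ∑words-distrib-+ N k F G)) (∑-distrib-+ (λ k → ∑words N k F) (λ k → ∑words N k G) (suc N))

∑words≤-*ˡ : ∀ N c F → ∑words≤ N (λ l → c *ℤ F l) ≡ c *ℤ ∑words≤ N F
∑words≤-*ˡ N c F = trans (∑-cong (suc N) (λ k → ∑words-*ˡ N k c F)) (∑-*ˡ c (λ k → ∑words N k F) (suc N))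

∑words≤-∷ : ∀ N F → (∀ p l → All (InRange N) l → length l ≡ N → F (suc p ∷ l) ≡ 0ℤ) →
            ∑words≤ N F ≡ F [] +ℤ ∑[ p < N ] ∑words≤ N (λ l → F (suc p ∷ l))
∑words≤-∷ N F long≡0 = cong (F [] +ℤ_) (begin
  ∑[ k < N ] ∑[ p < N ] ∑words N k (F ∘ (suc p ∷_))         ≡⟨ ∑-comm (λ k p → ∑words N k (F ∘ (suc p ∷_))) N N ⟩
  ∑[ p < N ] ∑[ k < N ] ∑words N k (F ∘ (suc p ∷_))         ≡⟨ ∑-cong N (λ p → ∑-init (λ k → ∑words N k (F ∘ (suc p ∷_))) N (∑words-zero N N (long≡0 p))) ⟨
  ∑[ p < N ] ∑words≤ N (F ∘ (suc p ∷_))                     ∎)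
  where open ≡-Reasoning

sum-∷ʳ : ∀ l x → sum (l ∷ʳ x) ≡ sum l + x
sum-∷ʳ l x = trans (sum-++ l [ x ]) (cong (λ y → sum l + y) (ℕ.+-identityʳ x))

sum-∷ʳ-≡ᵇ : ∀ l x m → (sum (l ∷ʳ x) ≡ᵇ m) ≡ (x ≤ᵇ m) ∧ (sum l ≡ᵇ m ∸ x)
sum-∷ʳ-≡ᵇ l x m = trans (cong (_≡ᵇ m) (sum-∷ʳ l x)) (+-≡ᵇ (sum l) x m)

length*≤sum : ∀ c l → All (c ≤_) l → length l * c ≤ sum l
length*≤sum c []      []         = z≤n
length*≤sum c (x ∷ l) (c≤x ∷ c≤l) = ℕ.+-mono-≤ c≤x (length*≤sum c l c≤l)

𝟙-∧-sum≢ : ∀ b {l m} → sum l ≢ m → 𝟙 (b ∧ (sum l ≡ᵇ m)) ≡ 0ℤ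
𝟙-∧-sum≢ b sum≢m = cong 𝟙 (trans (cong (b ∧_) (≡ᵇ-false sum≢m)) (Bool.∧-zeroʳ b))

allᵇ-positive : ∀ {N} l → All (InRange N) l → allᵇ (1 ≤ᵇ_) l ≡ true
allᵇ-positive []      []               = refl
allᵇ-positive (x ∷ l) ((1≤x , _) ∷ inR) = cong₂ _∧_ (≤ᵇ-true 1≤x) (allᵇ-positive l inR)

-- Class 12

gap12 : ℕ → ℕ → Bool
gap12 a b = (b + 2 ≤ᵇ a) ∧ (if isOdd a then b + 3 ≤ᵇ a else true)

gap12⇒≤ : ∀ {a b} → gap12 a b ≡ true → b + 2 ≤ a
gap12⇒≤ = ≤ᵇ⇒≤ ∘ proj₁ ∘ ∧-true

gap12-< : ∀ {a b} → a < b + 2 → gap12 a b ≡ false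
gap12-< {a} {b} a<b+2 = cong (_∧ (if isOdd a then b + 3 ≤ᵇ a else true)) (≤ᵇ-false a<b+2)

gap12-2+ : ∀ a b → gap12 (2 + a) (2 + b) ≡ gap12 a b
gap12-2+ a b = cong₂ _∧_ (<ᵇ-suc (b + 2) a) (cong (if isOdd a then_else true) (<ᵇ-suc (b + 3) a))
  where
  <ᵇ-suc : ∀ x y → (x <ᵇ suc y) ≡ (x ≤ᵇ y)
  <ᵇ-suc zero    y = refl
  <ᵇ-suc (suc x) y = refl

if-same : ∀ (b : Bool) → (if b then true else true) ≡ true
if-same true  = refl
if-same false = refl

gap12-0 : ∀ q → gap12 q 0 ≡ (2 ≤ᵇ q)
gap12-0 0 = refl
gap12-0 1 = refl
gap12-0 2 = refl
gap12-0 (suc (suc (suc q))) = if-same (isOdd (3 + q))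

gap12-1 : ∀ q → gap12 q 1 ≡ gap12 q 2
gap12-1 0 = refl
gap12-1 1 = refl
gap12-1 2 = refl
gap12-1 3 = refl
gap12-1 4 = refl
gap12-1 (suc (suc (suc (suc (suc q))))) = trans (if-same (isOdd (5 + q))) (sym (if-same (isOdd (5 + q))))

𝟙-gap12-0 : ∀ q → 𝟙 (gap12 q 0) ≡ 𝟙 (q ≡ᵇ 2) +ℤ 𝟙 (q ≡ᵇ 3) +ℤ 𝟙 (gap12 q 2)
𝟙-gap12-0 0 = refl
𝟙-gap12-0 1 = refl
𝟙-gap12-0 2 = refl
𝟙-gap12-0 3 = refl
𝟙-gap12-0 4 = refl
𝟙-gap12-0 (suc (suc (suc (suc (suc q))))) =
  trans (cong 𝟙 (if-same (isOdd (5 + q)))) (cong (λ b → 0ℤ +ℤ 0ℤ +ℤ 𝟙 b) (sym (if-same (isOdd (5 + q)))))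

𝟙-gap12-1+ : ∀ q → 1ℤ ≡ 𝟙 (suc q ≡ᵇ 1) +ℤ 𝟙 (gap12 (suc q) 0)
𝟙-gap12-1+ 0 = refl
𝟙-gap12-1+ 1 = refl
𝟙-gap12-1+ (suc (suc q)) = cong (λ b → 0ℤ +ℤ 𝟙 b) (sym (if-same (isOdd (3 + q))))

cond12-∷∷ : ∀ a b r → cond12 (a ∷ b ∷ r) ≡ gap12 a b ∧ cond12 (b ∷ r)
cond12-∷∷ a b r = sym (Bool.∧-assoc (b + 2 ≤ᵇ a) _ _)

cond12⇒Nonincreasing : ∀ l → cond12 l ≡ true → Nonincreasing l
cond12⇒Nonincreasing []          _ = refl
cond12⇒Nonincreasing (a ∷ [])    _ = refl
cond12⇒Nonincreasing (a ∷ b ∷ r) c = cong₂ _∧_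
  (≤ᵇ-true (ℕ.≤-trans (ℕ.m≤m+n b 2) (gap12⇒≤ (proj₁ c′))))
  (cond12⇒Nonincreasing (b ∷ r) (proj₂ c′))
  where
  c′ : gap12 a b ≡ true × cond12 (b ∷ r) ≡ true
  c′ = ∧-true (trans (sym (cond12-∷∷ a b r)) c)

lastGap : List ℕ → ℕ → Bool
lastGap []          s = true
lastGap (a ∷ [])    s = gap12 a s
lastGap (a ∷ b ∷ t) s = lastGap (b ∷ t) s

cond12-∷ʳ : ∀ l s → cond12 (l ∷ʳ s) ≡ cond12 l ∧ lastGap l s
cond12-∷ʳ []          s = refl
cond12-∷ʳ (a ∷ [])    s = cong ((s + 2 ≤ᵇ a) ∧_) (Bool.∧-identityʳ _)
cond12-∷ʳ (a ∷ b ∷ t) s = begin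
  cond12 (a ∷ b ∷ t ∷ʳ s)                          ≡⟨ cond12-∷∷ a b (t ∷ʳ s) ⟩
  gap12 a b ∧ cond12 (b ∷ t ∷ʳ s)                  ≡⟨ cong (gap12 a b ∧_) (cond12-∷ʳ (b ∷ t) s) ⟩
  gap12 a b ∧ (cond12 (b ∷ t) ∧ lastGap (b ∷ t) s) ≡⟨ Bool.∧-assoc (gap12 a b) _ _ ⟨
  (gap12 a b ∧ cond12 (b ∷ t)) ∧ lastGap (b ∷ t) s ≡⟨ cong (_∧ lastGap (b ∷ t) s) (cond12-∷∷ a b t) ⟨
  cond12 (a ∷ b ∷ t) ∧ lastGap (b ∷ t) s           ∎
  where open ≡-Reasoning

cond12-∷ʳ-∷ʳ : ∀ l x y → cond12 (l ∷ʳ x ∷ʳ y) ≡ cond12 (l ∷ʳ x) ∧ gap12 x y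
cond12-∷ʳ-∷ʳ l x y = trans (cond12-∷ʳ (l ∷ʳ x) y) (cong (cond12 (l ∷ʳ x) ∧_) (lastGap-∷ʳ l))
  where
  lastGap-∷ʳ : ∀ l → lastGap (l ∷ʳ x) y ≡ gap12 x y
  lastGap-∷ʳ []          = refl
  lastGap-∷ʳ (a ∷ [])    = refl
  lastGap-∷ʳ (a ∷ b ∷ t) = lastGap-∷ʳ (b ∷ t)

cond12-∷ʳ⇒≥ : ∀ l s → cond12 (l ∷ʳ s) ≡ true → All (s + 2 ≤_) l
cond12-∷ʳ⇒≥ []          s c = []
cond12-∷ʳ⇒≥ (a ∷ [])    s c = gap12⇒≤ (trans (sym (Bool.∧-identityʳ (gap12 a s))) (trans (sym (cond12-∷∷ a s [])) c)) ∷ []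
cond12-∷ʳ⇒≥ (a ∷ b ∷ t) s c =
  let gap , c′ = ∧-true (trans (sym (cond12-∷∷ a b (t ∷ʳ s))) c)
      rest     = cond12-∷ʳ⇒≥ (b ∷ t) s c′
  in ℕ.≤-trans (All.head rest) (ℕ.≤-trans (ℕ.m≤m+n b 2) (gap12⇒≤ gap)) ∷ rest

numHooks₂-∷-isolated : ∀ m r → Nonincreasing (suc m ∷ r) → conj r (suc m) ≡ 0 → conj r m ≡ 0 →
  + numHooks 2 (suc m ∷ r) ≡ 𝟙 (2 ≤ᵇ suc m) +ℤ + numHooks 2 r
numHooks₂-∷-isolated m r ni c₁ c₀ = begin
  + numHooks 2 (suc m ∷ r)
    ≡⟨ numHooks₂-∷ m r ni ⟩
  𝟙 (conj r (suc m) ≡ᵇ 1) +ℤ 𝟙 ((2 ≤ᵇ suc m) ∧ (conj r m ≡ᵇ 0)) +ℤ + numHooks 2 r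
    ≡⟨ cong₂ (λ c c′ → 𝟙 (c ≡ᵇ 1) +ℤ 𝟙 ((2 ≤ᵇ suc m) ∧ (c′ ≡ᵇ 0)) +ℤ + numHooks 2 r) c₁ c₀ ⟩
  0ℤ +ℤ 𝟙 ((2 ≤ᵇ suc m) ∧ true) +ℤ + numHooks 2 r
    ≡⟨ cong (λ b → 0ℤ +ℤ 𝟙 b +ℤ + numHooks 2 r) (Bool.∧-identityʳ (2 ≤ᵇ suc m)) ⟩
  0ℤ +ℤ 𝟙 (2 ≤ᵇ suc m) +ℤ + numHooks 2 r
    ≡⟨ cong (_+ℤ + numHooks 2 r) (ℤ.+-identityˡ (𝟙 (2 ≤ᵇ suc m))) ⟩
  𝟙 (2 ≤ᵇ suc m) +ℤ + numHooks 2 r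
    ∎
  where open ≡-Reasoning

-- In a class-12 partition each row but the last carries exactly one 2-hook
-- (in its last but one cell), and the last row carries one iff it is ≥ 2.
numHooks₂-cond12 : ∀ l → cond12 l ≡ true → All (1 ≤_) l →
  + numHooks 2 l ≡ (+ length l +ℤ - 1ℤ) +ℤ 𝟙 (cond12 (l ∷ʳ 0))
numHooks₂-cond12 []               _ _ = refl
numHooks₂-cond12 (zero ∷ _)       _ (() ∷ _)
numHooks₂-cond12 (suc m ∷ [])     _ _ = begin
  + numHooks 2 (suc m ∷ [])     ≡⟨ numHooks₂-∷-isolated m [] refl refl refl ⟩
  𝟙 (2 ≤ᵇ suc m) +ℤ 0ℤ          ≡⟨ ℤ.+-identityʳ _ ⟩
  𝟙 (2 ≤ᵇ suc m)                ≡⟨ cong 𝟙 (gap12-0 (suc m)) ⟨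
  𝟙 (gap12 (suc m) 0)           ≡⟨ cong 𝟙 (trans (sym (Bool.∧-identityʳ _)) (sym (cond12-∷∷ (suc m) 0 []))) ⟩
  𝟙 (cond12 (suc m ∷ 0 ∷ []))   ≡⟨ ℤ.+-identityˡ (𝟙 (cond12 (suc m ∷ 0 ∷ []))) ⟨
  0ℤ +ℤ 𝟙 (cond12 (suc m ∷ 0 ∷ [])) ∎
  where open ≡-Reasoning
numHooks₂-cond12 (suc m ∷ b ∷ r) c (_ ∷ pos) = begin
  + numHooks 2 (suc m ∷ b ∷ r)
    ≡⟨ numHooks₂-∷-isolated m (b ∷ r) (cond12⇒Nonincreasing (suc m ∷ b ∷ r) c)
         (conj-> (b ∷ r) ni (ℕ.m≤n⇒m≤1+n b<m)) (conj-> (b ∷ r) ni b<m) ⟩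
  𝟙 (2 ≤ᵇ suc m) +ℤ + numHooks 2 (b ∷ r)
    ≡⟨ cong₂ _+ℤ_ (cong 𝟙 (≤ᵇ-true (ℕ.≤-trans (ℕ.m≤n+m 2 b) b+2≤1+m))) (numHooks₂-cond12 (b ∷ r) c′ pos) ⟩
  1ℤ +ℤ ((+ length (b ∷ r) +ℤ - 1ℤ) +ℤ 𝟙 (cond12 (b ∷ r ∷ʳ 0)))
    ≡⟨ reassoc (+ length (b ∷ r)) (𝟙 (cond12 (b ∷ r ∷ʳ 0))) ⟩
  ((1ℤ +ℤ + length (b ∷ r)) +ℤ - 1ℤ) +ℤ 𝟙 (cond12 (b ∷ r ∷ʳ 0))
    ≡⟨ cong (λ x → (+ length (suc m ∷ b ∷ r) +ℤ - 1ℤ) +ℤ 𝟙 x)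
            (sym (trans (cond12-∷∷ (suc m) b (r ∷ʳ 0)) (cong (_∧ cond12 (b ∷ r ∷ʳ 0)) gap))) ⟩
  (+ length (suc m ∷ b ∷ r) +ℤ - 1ℤ) +ℤ 𝟙 (cond12 (suc m ∷ b ∷ r ∷ʳ 0))
    ∎
  where
  open ≡-Reasoning
  reassoc : ∀ a x → 1ℤ +ℤ ((a +ℤ - 1ℤ) +ℤ x) ≡ ((1ℤ +ℤ a) +ℤ - 1ℤ) +ℤ x
  reassoc = solve-∀
  split : gap12 (suc m) b ≡ true × cond12 (b ∷ r) ≡ true
  split = ∧-true (trans (sym (cond12-∷∷ (suc m) b r)) c)
  gap : gap12 (suc m) b ≡ true
  gap = proj₁ split
  c′ : cond12 (b ∷ r) ≡ true
  c′ = proj₂ split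
  b+2≤1+m : b + 2 ≤ suc m
  b+2≤1+m = gap12⇒≤ gap
  b<m : b < m
  b<m = ℕ.≤-pred (subst (_≤ suc m) (ℕ.+-comm b 2) b+2≤1+m)
  ni : Nonincreasing (b ∷ r)
  ni = cond12⇒Nonincreasing (b ∷ r) c′

count12 : ℕ → ℕ → ℕ → ℤ
count12 N k m = ∑words N k (λ l → 𝟙 (cond12 l ∧ (sum l ≡ᵇ m)))

count12∷ʳ : ℕ → ℕ → ℕ → ℕ → ℤ
count12∷ʳ N k s m = ∑words N k (λ l → 𝟙 (cond12 (l ∷ʳ s) ∧ (sum l ≡ᵇ m)))

g12-expand : ∀ N → + g12 N ≡ ∑[ k < suc N ] ((+ k +ℤ - 1ℤ) *ℤ count12 N k N +ℤ count12∷ʳ N k 0 N)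
g12-expand N = trans (∑-partitions cond12 (numHooks 2) N) (∑-cong (suc N) (λ k →
  trans (∑words-cong N k (weight k))
  (trans (∑words-distrib-+ N k _ _) (cong (_+ℤ count12∷ʳ N k 0 N) (∑words-*ˡ N k (+ k +ℤ - 1ℤ) _)))))
  where
  weight : ∀ k l → All (InRange N) l → length l ≡ k →
    𝟙 (isPartitionOf N l) *ℤ (𝟙 (cond12 l) *ℤ + numHooks 2 l)
      ≡ (+ k +ℤ - 1ℤ) *ℤ 𝟙 (cond12 l ∧ (sum l ≡ᵇ N)) +ℤ 𝟙 (cond12 (l ∷ʳ 0) ∧ (sum l ≡ᵇ N))
  weight k l inR refl with cond12 l in c
  ... | false = begin
    𝟙 (isPartitionOf N l) *ℤ (0ℤ *ℤ + numHooks 2 l)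
      ≡⟨ trans (cong (𝟙 (isPartitionOf N l) *ℤ_) (ℤ.*-zeroˡ (+ numHooks 2 l))) (ℤ.*-zeroʳ (𝟙 (isPartitionOf N l))) ⟩
    0ℤ
      ≡⟨ cong₂ _+ℤ_ (ℤ.*-zeroʳ (+ length l +ℤ - 1ℤ)) (cong (λ b → 𝟙 (b ∧ (sum l ≡ᵇ N))) (trans (cond12-∷ʳ l 0) (cong (_∧ lastGap l 0) c))) ⟨
    (+ length l +ℤ - 1ℤ) *ℤ 0ℤ +ℤ 𝟙 (cond12 (l ∷ʳ 0) ∧ (sum l ≡ᵇ N))
      ∎
    where open ≡-Reasoning
  ... | true = begin
    𝟙 (nonincreasing l ∧ allᵇ (1 ≤ᵇ_) l ∧ (sum l ≡ᵇ N)) *ℤ (1ℤ *ℤ + numHooks 2 l)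
      ≡⟨ cong₂ (λ a b → 𝟙 (a ∧ b ∧ (sum l ≡ᵇ N)) *ℤ (1ℤ *ℤ + numHooks 2 l))
               (cond12⇒Nonincreasing l c) (allᵇ-positive l inR) ⟩
    𝟙 (sum l ≡ᵇ N) *ℤ (1ℤ *ℤ + numHooks 2 l)
      ≡⟨ cong (λ h → 𝟙 (sum l ≡ᵇ N) *ℤ (1ℤ *ℤ h)) (numHooks₂-cond12 l c (All.map proj₁ inR)) ⟩
    𝟙 (sum l ≡ᵇ N) *ℤ (1ℤ *ℤ ((+ length l +ℤ - 1ℤ) +ℤ 𝟙 (cond12 (l ∷ʳ 0))))
      ≡⟨ distribute (𝟙 (sum l ≡ᵇ N)) (+ length l +ℤ - 1ℤ) (𝟙 (cond12 (l ∷ʳ 0))) ⟩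
    (+ length l +ℤ - 1ℤ) *ℤ 𝟙 (sum l ≡ᵇ N) +ℤ 𝟙 (cond12 (l ∷ʳ 0)) *ℤ 𝟙 (sum l ≡ᵇ N)
      ≡⟨ cong ((+ length l +ℤ - 1ℤ) *ℤ 𝟙 (sum l ≡ᵇ N) +ℤ_) (𝟙-∧ (cond12 (l ∷ʳ 0)) (sum l ≡ᵇ N)) ⟨
    (+ length l +ℤ - 1ℤ) *ℤ 𝟙 (sum l ≡ᵇ N) +ℤ 𝟙 (cond12 (l ∷ʳ 0) ∧ (sum l ≡ᵇ N))
      ∎
    where
    open ≡-Reasoning
    distribute : ∀ s a c → s *ℤ (1ℤ *ℤ (a +ℤ c)) ≡ a *ℤ s +ℤ c *ℤ s
    distribute = solve-∀

count12∷ʳ-suc : ∀ N k s m → count12∷ʳ N (suc k) s m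
  ≡ ∑[ q < N ] (𝟙 (gap12 (suc q) s) *ℤ (𝟙 (suc q ≤ᵇ m) *ℤ count12∷ʳ N k (suc q) (m ∸ suc q)))
count12∷ʳ-suc N k s m = begin
  count12∷ʳ N (suc k) s m
    ≡⟨ ∑words-∷ʳ N k (λ l → 𝟙 (cond12 (l ∷ʳ s) ∧ (sum l ≡ᵇ m))) ⟩
  ∑words N k (λ l → ∑[ q < N ] 𝟙 (cond12 (l ∷ʳ suc q ∷ʳ s) ∧ (sum (l ∷ʳ suc q) ≡ᵇ m)))
    ≡⟨ ∑words-cong N k (λ l _ _ → ∑-cong N (λ q → weight l (suc q))) ⟩
  ∑words N k (λ l → ∑[ q < N ] W q l)
    ≡⟨ ∑words-∑ N k N W ⟩
  ∑[ q < N ] ∑words N k (W q)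
    ≡⟨ ∑-cong N (λ q → trans (∑words-*ˡ N k (𝟙 (gap12 (suc q) s)) _)
                              (cong (𝟙 (gap12 (suc q) s) *ℤ_) (∑words-*ˡ N k (𝟙 (suc q ≤ᵇ m)) _))) ⟩
  ∑[ q < N ] (𝟙 (gap12 (suc q) s) *ℤ (𝟙 (suc q ≤ᵇ m) *ℤ count12∷ʳ N k (suc q) (m ∸ suc q)))
    ∎
  where
  open ≡-Reasoning
  W : ℕ → List ℕ → ℤ
  W q l = 𝟙 (gap12 (suc q) s) *ℤ (𝟙 (suc q ≤ᵇ m) *ℤ 𝟙 (cond12 (l ∷ʳ suc q) ∧ (sum l ≡ᵇ m ∸ suc q)))
  shuffle : ∀ C g le S → 𝟙 ((C ∧ g) ∧ (le ∧ S)) ≡ 𝟙 g *ℤ (𝟙 le *ℤ 𝟙 (C ∧ S))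
  shuffle C g le S = begin
    𝟙 ((C ∧ g) ∧ (le ∧ S))            ≡⟨ trans (𝟙-∧ (C ∧ g) (le ∧ S)) (cong₂ _*ℤ_ (𝟙-∧ C g) (𝟙-∧ le S)) ⟩
    (𝟙 C *ℤ 𝟙 g) *ℤ (𝟙 le *ℤ 𝟙 S)     ≡⟨ reorder (𝟙 C) (𝟙 g) (𝟙 le) (𝟙 S) ⟩
    𝟙 g *ℤ (𝟙 le *ℤ (𝟙 C *ℤ 𝟙 S))     ≡⟨ cong (λ x → 𝟙 g *ℤ (𝟙 le *ℤ x)) (𝟙-∧ C S) ⟨
    𝟙 g *ℤ (𝟙 le *ℤ 𝟙 (C ∧ S))        ∎
    where
    reorder : ∀ c g l s → (c *ℤ g) *ℤ (l *ℤ s) ≡ g *ℤ (l *ℤ (c *ℤ s))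
    reorder = solve-∀
  weight : ∀ l x → 𝟙 (cond12 (l ∷ʳ x ∷ʳ s) ∧ (sum (l ∷ʳ x) ≡ᵇ m))
                 ≡ 𝟙 (gap12 x s) *ℤ (𝟙 (x ≤ᵇ m) *ℤ 𝟙 (cond12 (l ∷ʳ x) ∧ (sum l ≡ᵇ m ∸ x)))
  weight l x = trans (cong₂ (λ a b → 𝟙 (a ∧ b)) (cond12-∷ʳ-∷ʳ l x s) (sum-∷ʳ-≡ᵇ l x m))
                     (shuffle (cond12 (l ∷ʳ x)) (gap12 x s) (x ≤ᵇ m) (sum l ≡ᵇ m ∸ x))

count12-suc : ∀ N k m → count12 N (suc k) m ≡ ∑[ q < N ] (𝟙 (suc q ≤ᵇ m) *ℤ count12∷ʳ N k (suc q) (m ∸ suc q))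
count12-suc N k m = begin
  count12 N (suc k) m
    ≡⟨ ∑words-∷ʳ N k (λ l → 𝟙 (cond12 l ∧ (sum l ≡ᵇ m))) ⟩
  ∑words N k (λ l → ∑[ q < N ] 𝟙 (cond12 (l ∷ʳ suc q) ∧ (sum (l ∷ʳ suc q) ≡ᵇ m)))
    ≡⟨ ∑words-cong N k (λ l _ _ → ∑-cong N (λ q → weight l (suc q))) ⟩
  ∑words N k (λ l → ∑[ q < N ] W q l)
    ≡⟨ ∑words-∑ N k N W ⟩
  ∑[ q < N ] ∑words N k (W q)
    ≡⟨ ∑-cong N (λ q → ∑words-*ˡ N k (𝟙 (suc q ≤ᵇ m)) _) ⟩
  ∑[ q < N ] (𝟙 (suc q ≤ᵇ m) *ℤ count12∷ʳ N k (suc q) (m ∸ suc q))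
    ∎
  where
  open ≡-Reasoning
  W : ℕ → List ℕ → ℤ
  W q l = 𝟙 (suc q ≤ᵇ m) *ℤ 𝟙 (cond12 (l ∷ʳ suc q) ∧ (sum l ≡ᵇ m ∸ suc q))
  shuffle : ∀ C le S → 𝟙 (C ∧ (le ∧ S)) ≡ 𝟙 le *ℤ 𝟙 (C ∧ S)
  shuffle C le S = begin
    𝟙 (C ∧ (le ∧ S))         ≡⟨ trans (𝟙-∧ C (le ∧ S)) (cong (𝟙 C *ℤ_) (𝟙-∧ le S)) ⟩
    𝟙 C *ℤ (𝟙 le *ℤ 𝟙 S)     ≡⟨ reorder (𝟙 C) (𝟙 le) (𝟙 S) ⟩
    𝟙 le *ℤ (𝟙 C *ℤ 𝟙 S)     ≡⟨ cong (𝟙 le *ℤ_) (𝟙-∧ C S) ⟨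
    𝟙 le *ℤ 𝟙 (C ∧ S)        ∎
    where
    reorder : ∀ c l s → c *ℤ (l *ℤ s) ≡ l *ℤ (c *ℤ s)
    reorder = solve-∀
  weight : ∀ l x → 𝟙 (cond12 (l ∷ʳ x) ∧ (sum (l ∷ʳ x) ≡ᵇ m)) ≡ 𝟙 (x ≤ᵇ m) *ℤ 𝟙 (cond12 (l ∷ʳ x) ∧ (sum l ≡ᵇ m ∸ x))
  weight l x = trans (cong (λ b → 𝟙 (cond12 (l ∷ʳ x) ∧ b)) (sum-∷ʳ-≡ᵇ l x m))
                     (shuffle (cond12 (l ∷ʳ x)) (x ≤ᵇ m) (sum l ≡ᵇ m ∸ x))

count12∷ʳ-< : ∀ N k s m → m < k * (s + 2) → count12∷ʳ N k s m ≡ 0ℤ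
count12∷ʳ-< N k s m m<k[s+2] = ∑words-zero N k vanish
  where
  vanish : ∀ l → All (InRange N) l → length l ≡ k → 𝟙 (cond12 (l ∷ʳ s) ∧ (sum l ≡ᵇ m)) ≡ 0ℤ
  vanish l _ refl with cond12 (l ∷ʳ s) in c
  ... | false = refl
  ... | true  = 𝟙-∧-sum≢ true {l} λ { refl → ℕ.<⇒≱ m<k[s+2] (length*≤sum (s + 2) l (cond12-∷ʳ⇒≥ l s c)) }

2≤m+2[1+k] : ∀ m k → 2 ≤ m + 2 * suc k
2≤m+2[1+k] m k = ℕ.≤-trans (ℕ.m≤m+n 2 (2 * k)) (ℕ.≤-trans (ℕ.≤-reflexive (sym (ℕ.*-suc 2 k))) (ℕ.m≤n+m _ m))

count12∷ʳ-2+ : ∀ N k s m → m + 2 * k ≤ N → count12∷ʳ N k (2 + s) (m + 2 * k) ≡ count12∷ʳ N k s m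
count12∷ʳ-2+ N zero s m _ = cong (λ x → 𝟙 (0 ≡ᵇ x)) (ℕ.+-identityʳ m)
count12∷ʳ-2+ 0 (suc k) s m bound = contradiction (ℕ.≤-trans (2≤m+2[1+k] m k) bound) λ ()
count12∷ʳ-2+ 1 (suc k) s m bound = contradiction (ℕ.≤-trans (2≤m+2[1+k] m k) bound) λ { (s≤s ()) }
count12∷ʳ-2+ (suc (suc N′)) (suc k) s m bound = begin
  count12∷ʳ N (suc k) (2 + s) M        ≡⟨ count12∷ʳ-suc N k (2 + s) M ⟩
  T 0 +ℤ (T 1 +ℤ ∑[ j < N′ ] T (2 + j)) ≡⟨ cong₂ (λ x y → x +ℤ (y +ℤ ∑[ j < N′ ] T (2 + j))) (T-small 0 (s≤s (s≤s z≤n))) (T-small 1 (s≤s (s≤s (ℕ.≤-trans (s≤s z≤n) (ℕ.m≤n+m 2 s))))) ⟩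
  0ℤ +ℤ (0ℤ +ℤ ∑[ j < N′ ] T (2 + j))   ≡⟨ trans (ℤ.+-identityˡ _) (ℤ.+-identityˡ _) ⟩
  ∑[ j < N′ ] T (2 + j)                 ≡⟨ ∑-cong N′ T≡U ⟩
  ∑ N′ U                                ≡⟨ trans (∑-init U (suc N′) (U-large (suc N′) (ℕ.n≤1+n N′))) (∑-init U N′ (U-large N′ ℕ.≤-refl)) ⟨
  ∑ N U                                 ≡⟨ count12∷ʳ-suc N k s m ⟨
  count12∷ʳ N (suc k) s m               ∎
  where
  open ≡-Reasoning
  N M : ℕ
  N = suc (suc N′)
  M = m + 2 * suc k
  R : ℕ → PS
  R = count12∷ʳ N k
  T U : ℕ → ℤ
  T q = 𝟙 (gap12 (suc q) (2 + s)) *ℤ (𝟙 (suc q ≤ᵇ M) *ℤ R (suc q) (M ∸ suc q))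
  U j = 𝟙 (gap12 (suc j) s) *ℤ (𝟙 (suc j ≤ᵇ m) *ℤ R (suc j) (m ∸ suc j))
  M≡ : ∀ m k → m + 2 * suc k ≡ 2 + (m + 2 * k)
  M≡ = solve-∀ℕ
  m+2k≤N′ : m + 2 * k ≤ N′
  m+2k≤N′ = ℕ.≤-pred (ℕ.≤-pred (subst (_≤ N) (M≡ m k) bound))
  m≤N′ : m ≤ N′
  m≤N′ = ℕ.≤-trans (ℕ.m≤m+n m (2 * k)) m+2k≤N′
  T-small : ∀ q → suc q < 2 + s + 2 → T q ≡ 0ℤ
  T-small q small = cong (λ b → 𝟙 b *ℤ (𝟙 (suc q ≤ᵇ M) *ℤ R (suc q) (M ∸ suc q))) (gap12-< {suc q} {2 + s} small)
  U-large : ∀ j → N′ ≤ j → U j ≡ 0ℤ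
  U-large j N′≤j = trans (cong (λ b → 𝟙 (gap12 (suc j) s) *ℤ (𝟙 b *ℤ R (suc j) (m ∸ suc j))) (≤ᵇ-false (s≤s (ℕ.≤-trans m≤N′ N′≤j))))
                         (ℤ.*-zeroʳ (𝟙 (gap12 (suc j) s)))
  T≡U : ∀ j → T (2 + j) ≡ U j
  T≡U j = cong₂ (λ g x → 𝟙 g *ℤ x) (gap12-2+ (suc j) s) (shifted j)
    where
    shifted : ∀ j → 𝟙 (3 + j ≤ᵇ M) *ℤ R (3 + j) (M ∸ (3 + j)) ≡ 𝟙 (suc j ≤ᵇ m) *ℤ R (suc j) (m ∸ suc j)
    shifted j with suc j ≤ᵇ m | ℕ.≤ᵇ-reflects-≤ (suc j) m
    ... | true  | ofʸ j<m = cong₂ (λ b x → 𝟙 b *ℤ x) (≤ᵇ-true 3+j≤M)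
                              (trans (cong (R (3 + j)) M∸[3+j]) (count12∷ʳ-2+ N k (suc j) (m ∸ suc j) bound′))
      where
      3+j≤M : 3 + j ≤ M
      3+j≤M = subst (3 + j ≤_) (sym (M≡ m k)) (s≤s (s≤s (ℕ.≤-trans j<m (ℕ.m≤m+n m (2 * k)))))
      M∸[3+j] : M ∸ (3 + j) ≡ (m ∸ suc j) + 2 * k
      M∸[3+j] = trans (cong (_∸ (3 + j)) (M≡ m k)) (ℕ.+-∸-comm (2 * k) j<m)
      bound′ : (m ∸ suc j) + 2 * k ≤ N
      bound′ = ℕ.≤-trans (ℕ.+-monoˡ-≤ (2 * k) (ℕ.m∸n≤m m (suc j)))
                         (ℕ.≤-trans m+2k≤N′ (ℕ.≤-trans (ℕ.n≤1+n N′) (ℕ.n≤1+n (suc N′))))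
    ... | false | ofⁿ j≮m = trans vanish (sym (ℤ.*-zeroˡ (R (suc j) (m ∸ suc j))))
      where
      M<3+j+2k : M < 3 + j + 2 * k
      M<3+j+2k = subst (_< 3 + j + 2 * k) (sym (M≡ m k)) (s≤s (s≤s (ℕ.+-monoˡ-< (2 * k) (ℕ.≰⇒> j≮m))))
      2k≤ : 2 * k ≤ k * (3 + j + 2)
      2k≤ = subst (_≤ k * (3 + j + 2)) (ℕ.*-comm k 2) (ℕ.*-monoʳ-≤ k (ℕ.m≤n+m 2 (3 + j)))
      vanish : 𝟙 (3 + j ≤ᵇ M) *ℤ R (3 + j) (M ∸ (3 + j)) ≡ 0ℤ
      vanish with 3 + j ≤ᵇ M | ℕ.≤ᵇ-reflects-≤ (3 + j) M
      ... | false | _          = ℤ.*-zeroˡ (R (3 + j) (M ∸ (3 + j)))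
      ... | true  | ofʸ 3+j≤M = trans (cong (1ℤ *ℤ_) (count12∷ʳ-< N k (3 + j) (M ∸ (3 + j)) small)) (ℤ.*-zeroʳ 1ℤ)
        where
        small : M ∸ (3 + j) < k * (3 + j + 2)
        small = ℕ.<-≤-trans (subst (M ∸ (3 + j) <_) (ℕ.m+n∸m≡n (3 + j) (2 * k)) (ℕ.∸-monoˡ-< M<3+j+2k 3+j≤M)) 2k≤

count12∷ʳ-shift : ∀ N k s M → M ≤ N → count12∷ʳ N k (2 + s) M ≡ (q^ (2 * k) ⊛ count12∷ʳ N k s) M
count12∷ʳ-shift N k s M M≤N with 2 * k ≤ᵇ M | ℕ.≤ᵇ-reflects-≤ (2 * k) M | q^-⊛-coeff (2 * k) (count12∷ʳ N k s) M
... | true  | ofʸ 2k≤M | eq = trans (cong (count12∷ʳ N k (2 + s)) (sym (ℕ.m∸n+n≡m 2k≤M)))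
                                     (trans (count12∷ʳ-2+ N k s (M ∸ 2 * k) (subst (_≤ N) (sym (ℕ.m∸n+n≡m 2k≤M)) M≤N)) (sym eq))
... | false | ofⁿ 2k≰M | eq = trans (count12∷ʳ-< N k (2 + s) M (ℕ.<-≤-trans (ℕ.≰⇒> 2k≰M) 2k≤)) (sym eq)
  where
  2k≤ : 2 * k ≤ k * (2 + s + 2)
  2k≤ = subst (_≤ k * (2 + s + 2)) (ℕ.*-comm k 2) (ℕ.*-monoʳ-≤ k (ℕ.m≤m+n 2 (s + 2)))

count12∷ʳ-1≡2 : ∀ N k m → count12∷ʳ N k 1 m ≡ count12∷ʳ N k 2 m
count12∷ʳ-1≡2 N zero    m = refl
count12∷ʳ-1≡2 N (suc k) m = trans (count12∷ʳ-suc N k 1 m) (trans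
  (∑-cong N (λ q → cong (λ b → 𝟙 b *ℤ (𝟙 (suc q ≤ᵇ m) *ℤ count12∷ʳ N k (suc q) (m ∸ suc q))) (gap12-1 (suc q))))
  (sym (count12∷ʳ-suc N k 2 m)))

count12∷ʳ-1 : ∀ N k M → M ≤ N → count12∷ʳ N k 1 M ≡ (q^ (2 * k) ⊛ count12∷ʳ N k 0) M
count12∷ʳ-1 N k M M≤N = trans (count12∷ʳ-1≡2 N k M) (count12∷ʳ-shift N k 0 M M≤N)

-- Split off the smallest part: it is 2, it is 3, or all parts are ≥ 4.
count12∷ʳ-0-unfold : ∀ N n m → m ≤ N → count12∷ʳ N (suc n) 0 m
  ≡ (q^ (2 * suc n) ⊛ count12∷ʳ N n 0) m +ℤ (q^ (4 * n + 3) ⊛ count12∷ʳ N n 0) m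
    +ℤ (q^ (2 * suc n) ⊛ count12∷ʳ N (suc n) 0) m
count12∷ʳ-0-unfold N n m m≤N = begin
  count12∷ʳ N (suc n) 0 m
    ≡⟨ count12∷ʳ-suc N n 0 m ⟩
  ∑[ q < N ] (𝟙 (gap12 (suc q) 0) *ℤ X q)
    ≡⟨ ∑-cong N split ⟩
  ∑[ q < N ] (𝟙 (q ≡ᵇ 1) *ℤ X q +ℤ 𝟙 (q ≡ᵇ 2) *ℤ X q +ℤ 𝟙 (gap12 (suc q) 2) *ℤ X q)
    ≡⟨ trans (∑-distrib-+ (λ q → 𝟙 (q ≡ᵇ 1) *ℤ X q +ℤ 𝟙 (q ≡ᵇ 2) *ℤ X q) (λ q → 𝟙 (gap12 (suc q) 2) *ℤ X q) N)
             (cong (_+ℤ ∑[ q < N ] (𝟙 (gap12 (suc q) 2) *ℤ X q)) (∑-distrib-+ (λ q → 𝟙 (q ≡ᵇ 1) *ℤ X q) (λ q → 𝟙 (q ≡ᵇ 2) *ℤ X q) N)) ⟩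
  ∑[ q < N ] (𝟙 (q ≡ᵇ 1) *ℤ X q) +ℤ ∑[ q < N ] (𝟙 (q ≡ᵇ 2) *ℤ X q) +ℤ ∑[ q < N ] (𝟙 (gap12 (suc q) 2) *ℤ X q)
    ≡⟨ cong₂ _+ℤ_ (cong₂ _+ℤ_ (∑-pick X 1 N (X-out 1)) (∑-pick X 2 N (X-out 2))) (sym (count12∷ʳ-suc N n 2 m)) ⟩
  X 1 +ℤ X 2 +ℤ count12∷ʳ N (suc n) 2 m
    ≡⟨ cong₂ _+ℤ_ (cong₂ _+ℤ_ smallest2 smallest3) (count12∷ʳ-shift N (suc n) 0 m m≤N) ⟩
  (q^ (2 * suc n) ⊛ K n) m +ℤ (q^ (4 * n + 3) ⊛ K n) m +ℤ (q^ (2 * suc n) ⊛ K (suc n)) m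
    ∎
  where
  open ≡-Reasoning
  K : ℕ → PS
  K j = count12∷ʳ N j 0
  R : ℕ → PS
  R = count12∷ʳ N n
  X : ℕ → ℤ
  X q = 𝟙 (suc q ≤ᵇ m) *ℤ R (suc q) (m ∸ suc q)
  split : ∀ q → 𝟙 (gap12 (suc q) 0) *ℤ X q ≡ 𝟙 (q ≡ᵇ 1) *ℤ X q +ℤ 𝟙 (q ≡ᵇ 2) *ℤ X q +ℤ 𝟙 (gap12 (suc q) 2) *ℤ X q
  split q = trans (cong (_*ℤ X q) (𝟙-gap12-0 (suc q))) (distrib (𝟙 (q ≡ᵇ 1)) (𝟙 (q ≡ᵇ 2)) (𝟙 (gap12 (suc q) 2)) (X q))
    where
    distrib : ∀ a b c x → (a +ℤ b +ℤ c) *ℤ x ≡ a *ℤ x +ℤ b *ℤ x +ℤ c *ℤ x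
    distrib = solve-∀
  X-out : ∀ e → N ≤ e → X e ≡ 0ℤ
  X-out e N≤e = trans (cong (λ b → 𝟙 b *ℤ R (suc e) (m ∸ suc e)) (≤ᵇ-false (s≤s (ℕ.≤-trans m≤N N≤e))))
                      (ℤ.*-zeroˡ (R (suc e) (m ∸ suc e)))
  exp₂ : ∀ n → 2 + 2 * n ≡ 2 * suc n
  exp₂ = solve-∀ℕ
  exp₃ : ∀ n → 3 + (2 * n + 2 * n) ≡ 4 * n + 3
  exp₃ = solve-∀ℕ
  smallest2 : X 1 ≡ (q^ (2 * suc n) ⊛ K n) m
  smallest2 = begin
    X 1                              ≡⟨ 𝟙-≤ᵇ-q^ 2 (R 2) m ⟩
    (q^ 2 ⊛ R 2) m                   ≡⟨ ⊛-cong-≤ (q^ 2) m (λ i i≤m → count12∷ʳ-shift N n 0 i (ℕ.≤-trans i≤m m≤N)) ⟩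
    (q^ 2 ⊛ (q^ (2 * n) ⊛ K n)) m    ≡⟨ q^-⊛-q^ 2 (2 * n) (K n) m ⟩
    (q^ (2 + 2 * n) ⊛ K n) m         ≡⟨ cong (λ e → (q^ e ⊛ K n) m) (exp₂ n) ⟩
    (q^ (2 * suc n) ⊛ K n) m         ∎
  smallest3 : X 2 ≡ (q^ (4 * n + 3) ⊛ K n) m
  smallest3 = begin
    X 2
      ≡⟨ 𝟙-≤ᵇ-q^ 3 (R 3) m ⟩
    (q^ 3 ⊛ R 3) m
      ≡⟨ ⊛-cong-≤ (q^ 3) m (λ i i≤m → let i≤N = ℕ.≤-trans i≤m m≤N in
           trans (count12∷ʳ-shift N n 1 i i≤N) (⊛-cong-≤ (q^ (2 * n)) i (λ i′ i′≤i → count12∷ʳ-1 N n i′ (ℕ.≤-trans i′≤i i≤N)))) ⟩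
    (q^ 3 ⊛ (q^ (2 * n) ⊛ (q^ (2 * n) ⊛ K n))) m
      ≡⟨ trans (q^-⊛-q^ 3 (2 * n) (q^ (2 * n) ⊛ K n) m) (q^-⊛-q^ (3 + 2 * n) (2 * n) (K n) m) ⟩
    (q^ (3 + 2 * n + 2 * n) ⊛ K n) m
      ≡⟨ cong (λ e → (q^ e ⊛ K n) m) (trans (ℕ.+-assoc 3 (2 * n) (2 * n)) (exp₃ n)) ⟩
    (q^ (4 * n + 3) ⊛ K n) m
      ∎

-- Split off the smallest part: it is 1, or all parts are ≥ 2.
count12-unfold : ∀ N n → count12 N (suc n) N ≡ (q^ (2 * n + 1) ⊛ count12∷ʳ N n 0) N +ℤ count12∷ʳ N (suc n) 0 N
count12-unfold N n = begin
  count12 N (suc n) N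
    ≡⟨ count12-suc N n N ⟩
  ∑ N Y
    ≡⟨ ∑-cong N split ⟩
  ∑[ q < N ] (𝟙 (q ≡ᵇ 0) *ℤ Y q +ℤ 𝟙 (gap12 (suc q) 0) *ℤ Y q)
    ≡⟨ ∑-distrib-+ (λ q → 𝟙 (q ≡ᵇ 0) *ℤ Y q) (λ q → 𝟙 (gap12 (suc q) 0) *ℤ Y q) N ⟩
  ∑[ q < N ] (𝟙 (q ≡ᵇ 0) *ℤ Y q) +ℤ ∑[ q < N ] (𝟙 (gap12 (suc q) 0) *ℤ Y q)
    ≡⟨ cong₂ _+ℤ_ (∑-pick Y 0 N Y-out) (sym (count12∷ʳ-suc N n 0 N)) ⟩
  Y 0 +ℤ count12∷ʳ N (suc n) 0 N
    ≡⟨ cong (_+ℤ count12∷ʳ N (suc n) 0 N) smallest1 ⟩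
  (q^ (2 * n + 1) ⊛ K n) N +ℤ count12∷ʳ N (suc n) 0 N
    ∎
  where
  open ≡-Reasoning
  K : ℕ → PS
  K j = count12∷ʳ N j 0
  R : ℕ → PS
  R = count12∷ʳ N n
  Y : ℕ → ℤ
  Y q = 𝟙 (suc q ≤ᵇ N) *ℤ R (suc q) (N ∸ suc q)
  split : ∀ q → Y q ≡ 𝟙 (q ≡ᵇ 0) *ℤ Y q +ℤ 𝟙 (gap12 (suc q) 0) *ℤ Y q
  split q = trans (sym (ℤ.*-identityˡ (Y q))) (trans (cong (_*ℤ Y q) (𝟙-gap12-1+ q)) (ℤ.*-distribʳ-+ (Y q) (𝟙 (q ≡ᵇ 0)) (𝟙 (gap12 (suc q) 0))))
  Y-out : N ≤ 0 → Y 0 ≡ 0ℤ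
  Y-out N≤0 = trans (cong (λ b → 𝟙 b *ℤ R 1 (N ∸ 1)) (≤ᵇ-false (s≤s N≤0))) (ℤ.*-zeroˡ (R 1 (N ∸ 1)))
  smallest1 : Y 0 ≡ (q^ (2 * n + 1) ⊛ K n) N
  smallest1 = begin
    Y 0                            ≡⟨ 𝟙-≤ᵇ-q^ 1 (R 1) N ⟩
    (q^ 1 ⊛ R 1) N                 ≡⟨ ⊛-cong-≤ (q^ 1) N (λ i i≤N → count12∷ʳ-1 N n i i≤N) ⟩
    (q^ 1 ⊛ (q^ (2 * n) ⊛ K n)) N  ≡⟨ q^-⊛-q^ 1 (2 * n) (K n) N ⟩
    (q^ (1 + 2 * n) ⊛ K n) N       ≡⟨ cong (λ e → (q^ e ⊛ K n) N) (ℕ.+-comm 1 (2 * n)) ⟩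
    (q^ (2 * n + 1) ⊛ K n) N       ∎

oddFactor : ℕ → PS
oddFactor i = one ⊕ q^ (2 * i + 1)

evenInverse : ℕ → PS
evenInverse i = geom (2 * suc i)

Φ : ℕ → PS
Φ n = q^ (n * n + n) ⊛ prodPS (map oddFactor (upTo n)) ⊛ prodPS (map evenInverse (upTo n))

oddFactor-⊛ : ∀ i f → oddFactor i ⊛ f ≋ f ⊕ q^ (2 * i + 1) ⊛ f
oddFactor-⊛ i f = ≋-trans (⊛-distribʳ-⊕ f one (q^ (2 * i + 1))) (⊕-cong (⊛-identityˡ f) ≋-refl)

Φ-suc : ∀ n → Φ (suc n) ≋ evenInverse n ⊛ (q^ (2 * suc n) ⊛ Φ n ⊕ q^ (4 * n + 3) ⊛ Φ n)
Φ-suc n = begin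
  q^ (suc n * suc n + suc n) ⊛ O (suc n) ⊛ E (suc n)
    ≈⟨ ⊛-cong (⊛-congˡ (q^ (suc n * suc n + suc n)) (prodPS-upTo-suc oddFactor n)) (prodPS-upTo-suc evenInverse n) ⟩
  (q^ (suc n * suc n + suc n) ⊛ (oddFactor n ⊛ O n)) ⊛ (evenInverse n ⊛ E n)
    ≈⟨ ⊛-swap (Q ⊛ (oddFactor n ⊛ O n)) (evenInverse n) (E n) ⟩
  evenInverse n ⊛ ((q^ (suc n * suc n + suc n) ⊛ (oddFactor n ⊛ O n)) ⊛ E n)
    ≈⟨ ⊛-congˡ (evenInverse n) (≋-trans (⊛-congʳ (E n) (⊛-swap Q (oddFactor n) (O n))) (⊛-assoc (oddFactor n) (Q ⊛ O n) (E n))) ⟩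
  evenInverse n ⊛ (oddFactor n ⊛ ((q^ (suc n * suc n + suc n) ⊛ O n) ⊛ E n))
    ≈⟨ ⊛-congˡ (evenInverse n) (⊛-congˡ (oddFactor n) split-exponent) ⟩
  evenInverse n ⊛ (oddFactor n ⊛ (q^ (2 * suc n) ⊛ Φ n))
    ≈⟨ ⊛-congˡ (evenInverse n) (≋-trans (oddFactor-⊛ n (q^ (2 * suc n) ⊛ Φ n)) (⊕-cong (≋-refl {q^ (2 * suc n) ⊛ Φ n}) (q^-⊛-q^ (2 * n + 1) (2 * suc n) (Φ n)))) ⟩
  evenInverse n ⊛ (q^ (2 * suc n) ⊛ Φ n ⊕ q^ (2 * n + 1 + 2 * suc n) ⊛ Φ n)
    ≡⟨ cong (λ e → evenInverse n ⊛ (q^ (2 * suc n) ⊛ Φ n ⊕ q^ e ⊛ Φ n)) (exp₃ n) ⟩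
  evenInverse n ⊛ (q^ (2 * suc n) ⊛ Φ n ⊕ q^ (4 * n + 3) ⊛ Φ n)
    ∎
  where
  open SetoidReasoning ≋-setoid
  Q : PS
  Q = q^ (suc n * suc n + suc n)
  O E : ℕ → PS
  O n = prodPS (map oddFactor (upTo n))
  E n = prodPS (map evenInverse (upTo n))
  exp₂ : ∀ n → suc n * suc n + suc n ≡ 2 * suc n + (n * n + n)
  exp₂ = solve-∀ℕ
  exp₃ : ∀ n → 2 * n + 1 + 2 * suc n ≡ 4 * n + 3
  exp₃ = solve-∀ℕ
  split-exponent : (q^ (suc n * suc n + suc n) ⊛ O n) ⊛ E n ≋ q^ (2 * suc n) ⊛ Φ n
  split-exponent = begin
    (q^ (suc n * suc n + suc n) ⊛ O n) ⊛ E n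
      ≡⟨ cong (λ e → (q^ e ⊛ O n) ⊛ E n) (exp₂ n) ⟩
    (q^ (2 * suc n + (n * n + n)) ⊛ O n) ⊛ E n
      ≈⟨ ⊛-congʳ (E n) (⊛-congʳ (O n) (mono-⊛-mono 1ℤ 1ℤ (2 * suc n) (n * n + n))) ⟨
    ((q^ (2 * suc n) ⊛ q^ (n * n + n)) ⊛ O n) ⊛ E n
      ≈⟨ ≋-trans (⊛-congʳ (E n) (⊛-assoc (q^ (2 * suc n)) (q^ (n * n + n)) (O n))) (⊛-assoc (q^ (2 * suc n)) (q^ (n * n + n) ⊛ O n) (E n)) ⟩
    q^ (2 * suc n) ⊛ Φ n
      ∎

Φ-unfold : ∀ n → Φ (suc n) ≋ (q^ (2 * suc n) ⊛ Φ n ⊕ q^ (4 * n + 3) ⊛ Φ n) ⊕ q^ (2 * suc n) ⊛ Φ (suc n)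
Φ-unfold n = ≋-trans (Φ-suc n) (≋-trans (geom-⊛ (2 * suc n) A (s≤s z≤n))
                                         (⊕-cong (≋-refl {A}) (⊛-congˡ (q^ (2 * suc n)) (≋-sym (Φ-suc n)))))
  where
  A : PS
  A = q^ (2 * suc n) ⊛ Φ n ⊕ q^ (4 * n + 3) ⊛ Φ n

count12∷ʳ-0≡Φ : ∀ N n m → m ≤ N → count12∷ʳ N n 0 m ≡ Φ n m
count12∷ʳ-0≡Φ N zero    m _   = trans (unit m) (sym (≋-trans (⊛-identityʳ (q^ 0 ⊛ one)) (⊛-identityʳ (q^ 0)) m))
  where
  unit : ∀ m → 𝟙 (0 ≡ᵇ m) ≡ one m
  unit zero    = refl
  unit (suc m) = refl
count12∷ʳ-0≡Φ N (suc n) m m≤N =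
  recurrence-unique (2 * suc n) 1ℤ {count12∷ʳ N (suc n) 0} {Φ (suc n)} {below (count12∷ʳ N n 0)} {below (Φ n)} N (s≤s z≤n)
    lower (λ m m≤N → with-1 (below (count12∷ʳ N n 0) m) _ (count12∷ʳ-0-unfold N n m m≤N))
          (λ m _ → with-1 (below (Φ n) m) _ (Φ-unfold n m)) m m≤N
  where
  with-1 : ∀ {x} a b → x ≡ a +ℤ b → x ≡ a +ℤ 1ℤ *ℤ b
  with-1 a b eq = trans eq (cong (a +ℤ_) (sym (ℤ.*-identityˡ b)))
  below : PS → PS
  below f = q^ (2 * suc n) ⊛ f ⊕ q^ (4 * n + 3) ⊛ f
  lower : ∀ m → m ≤ N → below (count12∷ʳ N n 0) m ≡ below (Φ n) m
  lower m m≤N = cong₂ _+ℤ_ (⊛-cong-≤ (q^ (2 * suc n)) {count12∷ʳ N n 0} {Φ n} m ih) (⊛-cong-≤ (q^ (4 * n + 3)) {count12∷ʳ N n 0} {Φ n} m ih)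
    where
    ih : ∀ i → i ≤ m → count12∷ʳ N n 0 i ≡ Φ n i
    ih i i≤m = count12∷ʳ-0≡Φ N n i (ℕ.≤-trans i≤m m≤N)

term1-coeff : ∀ n N → term1 n N ≡ + n *ℤ (Φ n N +ℤ (q^ (2 * n + 1) ⊛ Φ n) N)
term1-coeff n N = begin
  term1 n N                                   ≡⟨ term1≋ N ⟩
  (mono (+ n) 0 ⊛ (oddFactor n ⊛ Φ n)) N      ≡⟨ mono-⊛-coeff (+ n) 0 (oddFactor n ⊛ Φ n) N ⟩
  + n *ℤ (oddFactor n ⊛ Φ n) N                ≡⟨ cong (+ n *ℤ_) (oddFactor-⊛ n (Φ n) N) ⟩
  + n *ℤ (Φ n N +ℤ (q^ (2 * n + 1) ⊛ Φ n) N)  ∎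
  where
  C Q O E : PS
  C = mono (+ n) 0
  Q = q^ (n * n + n)
  O = prodPS (map oddFactor (upTo n))
  E = prodPS (map evenInverse (upTo n))
  scalar : mono (+ n) (n * n + n) ≋ C ⊛ Q
  scalar k = sym (trans (mono-⊛-mono (+ n) 1ℤ 0 (n * n + n) k) (cong (λ c → mono c (n * n + n) k) (ℤ.*-identityʳ (+ n))))
  term1≋ : term1 n ≋ C ⊛ (oddFactor n ⊛ Φ n)
  term1≋ = begin
    mono (+ n) (n * n + n) ⊛ prodPS (map oddFactor (upTo (suc n))) ⊛ E
      ≈⟨ ⊛-congʳ E (⊛-cong scalar (prodPS-upTo-suc oddFactor n)) ⟩
    ((C ⊛ Q) ⊛ (oddFactor n ⊛ O)) ⊛ E
      ≈⟨ ≋-trans (⊛-congʳ E (⊛-assoc C Q (oddFactor n ⊛ O))) (⊛-assoc C (Q ⊛ (oddFactor n ⊛ O)) E) ⟩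
    C ⊛ ((Q ⊛ (oddFactor n ⊛ O)) ⊛ E)
      ≈⟨ ⊛-congˡ C (≋-trans (⊛-congʳ E (⊛-swap Q (oddFactor n) O)) (⊛-assoc (oddFactor n) (Q ⊛ O) E)) ⟩
    C ⊛ (oddFactor n ⊛ Φ n)
      ∎
    where open SetoidReasoning ≋-setoid
  open ≡-Reasoning

g12-coeff : ∀ N → + g12 N ≡ rhs1 N
g12-coeff N = begin
  + g12 N
    ≡⟨ g12-expand N ⟩
  ∑[ k < suc N ] ((+ k +ℤ - 1ℤ) *ℤ count12 N k N +ℤ B k)
    ≡⟨ ℤ.+-identityʳ _ ⟨
  ∑[ k < suc N ] ((+ k +ℤ - 1ℤ) *ℤ count12 N k N +ℤ B k) +ℤ 0ℤ
    ≡⟨ cong (∑[ k < suc N ] ((+ k +ℤ - 1ℤ) *ℤ count12 N k N +ℤ B k) +ℤ_) C-top ⟨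
  ∑[ k < suc N ] ((+ k +ℤ - 1ℤ) *ℤ count12 N k N +ℤ B k) +ℤ + N *ℤ C N
    ≡⟨ ∑-telescope (λ k → count12 N k N) B C refl (count12-unfold N) N ⟩
  ∑[ m < N ] (+ suc m *ℤ (B (suc m) +ℤ C (suc m)))
    ≡⟨ ∑-cong N (λ m → sym (term1≡ (suc m))) ⟩
  ∑[ m < N ] term1 (suc m) N
    ≡⟨ sumℤ-upTo (λ m → term1 (suc m) N) N ⟨
  rhs1 N
    ∎
  where
  open ≡-Reasoning
  B C : ℕ → ℤ
  B k = count12∷ʳ N k 0 N
  C k = (q^ (2 * k + 1) ⊛ count12∷ʳ N k 0) N
  C-top : + N *ℤ C N ≡ 0ℤ
  C-top = trans (cong (+ N *ℤ_) (q^-⊛-< (2 * N + 1) (count12∷ʳ N N 0) N<2N+1)) (ℤ.*-zeroʳ (+ N))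
    where
    N<2N+1 : N < 2 * N + 1
    N<2N+1 = ℕ.<-≤-trans (ℕ.n<1+n N) (ℕ.≤-trans (ℕ.≤-reflexive (ℕ.+-comm 1 N)) (ℕ.+-monoˡ-≤ 1 (ℕ.m≤m+n N (N + 0))))
  term1≡ : ∀ n → term1 n N ≡ + n *ℤ (B n +ℤ C n)
  term1≡ n = trans (term1-coeff n N) (cong (λ x → + n *ℤ x) (sym (cong₂ _+ℤ_
    (count12∷ʳ-0≡Φ N n N ℕ.≤-refl)
    (⊛-cong-≤ (q^ (2 * n + 1)) {count12∷ʳ N n 0} {Φ n} N (λ i i≤N → count12∷ʳ-0≡Φ N n i i≤N)))))

-- Class 22

in156 : ℕ → Bool
in156 x = (x % 8 ≡ᵇ 1) ∨ (x % 8 ≡ᵇ 5) ∨ (x % 8 ≡ᵇ 6)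

-- l is a partition of n into parts from {1, 5, 6 mod 8}, none of them above b
part156≤ : ℕ → ℕ → List ℕ → Bool
part156≤ b n l = nonincreasing (b ∷ l) ∧ cond22 l ∧ (sum l ≡ᵇ n)

𝟙-part156≤-∷ : ∀ b n x l →
  𝟙 (part156≤ b n (x ∷ l)) ≡ 𝟙 (x ≤ᵇ b) *ℤ (𝟙 (in156 x ∧ (x ≤ᵇ n)) *ℤ 𝟙 (part156≤ x (n ∸ x) l))
𝟙-part156≤-∷ b n x l = begin
  𝟙 (((x ≤ᵇ b) ∧ ni) ∧ ((in156 x ∧ c) ∧ (x + sum l ≡ᵇ n)))
    ≡⟨ cong (λ e → 𝟙 (((x ≤ᵇ b) ∧ ni) ∧ ((in156 x ∧ c) ∧ e))) (trans (cong (_≡ᵇ n) (ℕ.+-comm x (sum l))) (+-≡ᵇ (sum l) x n)) ⟩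
  𝟙 (((x ≤ᵇ b) ∧ ni) ∧ ((in156 x ∧ c) ∧ ((x ≤ᵇ n) ∧ s)))
    ≡⟨ 𝟙-∧₆ (x ≤ᵇ b) ni (in156 x) c (x ≤ᵇ n) s ⟩
  𝟙 (x ≤ᵇ b) *ℤ (𝟙 (in156 x ∧ (x ≤ᵇ n)) *ℤ 𝟙 (ni ∧ c ∧ s))
    ∎
  where
  open ≡-Reasoning
  ni = nonincreasing (x ∷ l)
  c  = cond22 l
  s  = sum l ≡ᵇ n ∸ x
  𝟙-∧₆ : ∀ a b d e f g → 𝟙 ((a ∧ b) ∧ ((d ∧ e) ∧ (f ∧ g))) ≡ 𝟙 a *ℤ (𝟙 (d ∧ f) *ℤ 𝟙 (b ∧ e ∧ g))
  𝟙-∧₆ a b d e f g = begin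
    𝟙 ((a ∧ b) ∧ ((d ∧ e) ∧ (f ∧ g)))
      ≡⟨ trans (𝟙-∧ (a ∧ b) _) (cong₂ _*ℤ_ (𝟙-∧ a b) (trans (𝟙-∧ (d ∧ e) _) (cong₂ _*ℤ_ (𝟙-∧ d e) (𝟙-∧ f g)))) ⟩
    (𝟙 a *ℤ 𝟙 b) *ℤ ((𝟙 d *ℤ 𝟙 e) *ℤ (𝟙 f *ℤ 𝟙 g))
      ≡⟨ reorder (𝟙 a) (𝟙 b) (𝟙 d) (𝟙 e) (𝟙 f) (𝟙 g) ⟩
    𝟙 a *ℤ ((𝟙 d *ℤ 𝟙 f) *ℤ (𝟙 b *ℤ (𝟙 e *ℤ 𝟙 g)))
      ≡⟨ cong₂ (λ u v → 𝟙 a *ℤ (u *ℤ v)) (𝟙-∧ d f) (trans (𝟙-∧ b (e ∧ g)) (cong (𝟙 b *ℤ_) (𝟙-∧ e g))) ⟨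
    𝟙 a *ℤ (𝟙 (d ∧ f) *ℤ 𝟙 (b ∧ e ∧ g))
      ∎
    where
    reorder : ∀ a b d e f g → (a *ℤ b) *ℤ ((d *ℤ e) *ℤ (f *ℤ g)) ≡ a *ℤ ((d *ℤ f) *ℤ (b *ℤ (e *ℤ g)))
    reorder = solve-∀

Nonincreasing-part156≤ : ∀ b n x l → part156≤ b n (x ∷ l) ≡ true → Nonincreasing (x ∷ l)
Nonincreasing-part156≤ b n x l p = Nonincreasing-tail b (x ∷ l) (proj₁ (∧-true p))

part156≤-long : ∀ b m l → All (1 ≤_) l → m < length l → 𝟙 (part156≤ b m l) ≡ 0ℤ
part156≤-long b m l pos m<len = trans (cong 𝟙 (sym (Bool.∧-assoc (nonincreasing (b ∷ l)) (cond22 l) _)))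
  (𝟙-∧-sum≢ (nonincreasing (b ∷ l) ∧ cond22 l) {l} λ { refl →
    ℕ.<⇒≱ m<len (subst (_≤ sum l) (ℕ.*-identityʳ (length l)) (length*≤sum 1 l pos)) })

𝟙-≤ᵇ-suc : ∀ x b → 𝟙 (x ≤ᵇ suc b) ≡ 𝟙 (x ≤ᵇ b) +ℤ 𝟙 (x ≡ᵇ suc b)
𝟙-≤ᵇ-suc zero          b       = refl
𝟙-≤ᵇ-suc (suc zero)    zero    = refl
𝟙-≤ᵇ-suc (suc (suc p)) zero    = refl
𝟙-≤ᵇ-suc (suc zero)    (suc b) = refl
𝟙-≤ᵇ-suc (suc (suc p)) (suc b) = 𝟙-≤ᵇ-suc (suc p) b

-- conj l (suc y) ≡ 0 says that no part of l exceeds y.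
part156≤-lower : ∀ s y n l → y ≤ s → part156≤ s n l ∧ (conj l (suc y) ≡ᵇ 0) ≡ part156≤ y n l
part156≤-lower s y n l y≤s =
  trans (swap (nonincreasing (s ∷ l)) (cond22 l ∧ (sum l ≡ᵇ n)) (conj l (suc y) ≡ᵇ 0))
        (cong (_∧ (cond22 l ∧ (sum l ≡ᵇ n))) (lower l))
  where
  swap : ∀ a r c → (a ∧ r) ∧ c ≡ (a ∧ c) ∧ r
  swap true  true  c = sym (Bool.∧-identityʳ c)
  swap true  false c = sym (Bool.∧-zeroʳ c)
  swap false r     c = refl
  lower : ∀ l → nonincreasing (s ∷ l) ∧ (conj l (suc y) ≡ᵇ 0) ≡ nonincreasing (y ∷ l)
  lower []      = refl
  lower (z ∷ l) with nonincreasing (z ∷ l) in ni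
  ... | false = trans (cong (_∧ (conj (z ∷ l) (suc y) ≡ᵇ 0)) (Bool.∧-zeroʳ (z ≤ᵇ s))) (sym (Bool.∧-zeroʳ (z ≤ᵇ y)))
  ... | true with z ≤ᵇ y | ℕ.≤ᵇ-reflects-≤ z y
  ...   | true  | ofʸ z≤y = begin
    ((z ≤ᵇ s) ∧ true) ∧ (conj (z ∷ l) (suc y) ≡ᵇ 0)  ≡⟨ cong (λ c → ((z ≤ᵇ s) ∧ true) ∧ (c ≡ᵇ 0)) (conj-> (z ∷ l) ni (s≤s z≤y)) ⟩
    ((z ≤ᵇ s) ∧ true) ∧ true                         ≡⟨ trans (Bool.∧-identityʳ _) (Bool.∧-identityʳ _) ⟩
    (z ≤ᵇ s)                                         ≡⟨ ≤ᵇ-true (ℕ.≤-trans z≤y y≤s) ⟩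
    true                                             ∎
    where open ≡-Reasoning
  ...   | false | ofⁿ z≰y = trans (cong (λ c → ((z ≤ᵇ s) ∧ true) ∧ (c ≡ᵇ 0)) (conj-∷-≤ z l (ℕ.≰⇒> z≰y)))
                                  (Bool.∧-zeroʳ _)

-- The largest part is at most b, or it is b + 1.
∑-part156≤-suc : ∀ N b n (ω : List ℕ → ℤ) → b < N → n ≤ N →
  ∑words≤ N (λ l → 𝟙 (part156≤ (suc b) n l) *ℤ ω l)
    ≡ ∑words≤ N (λ l → 𝟙 (part156≤ b n l) *ℤ ω l)
      +ℤ 𝟙 (in156 (suc b) ∧ (suc b ≤ᵇ n)) *ℤ ∑words≤ N (λ l → 𝟙 (part156≤ (suc b) (n ∸ suc b) l) *ℤ ω (suc b ∷ l))
∑-part156≤-suc N b n ω b<N n≤N = begin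
  ∑words≤ N (λ l → 𝟙 (part156≤ (suc b) n l) *ℤ ω l)
    ≡⟨ ∑words≤-cong N (λ l _ → split l) ⟩
  ∑words≤ N (λ l → 𝟙 (part156≤ b n l) *ℤ ω l +ℤ Top l)
    ≡⟨ ∑words≤-distrib-+ N (λ l → 𝟙 (part156≤ b n l) *ℤ ω l) Top ⟩
  ∑words≤ N (λ l → 𝟙 (part156≤ b n l) *ℤ ω l) +ℤ ∑words≤ N Top
    ≡⟨ cong (∑words≤ N (λ l → 𝟙 (part156≤ b n l) *ℤ ω l) +ℤ_) (trans (∑words≤-∷ N Top long) (ℤ.+-identityˡ _)) ⟩
  ∑words≤ N (λ l → 𝟙 (part156≤ b n l) *ℤ ω l) +ℤ ∑[ p < N ] ∑words≤ N (λ l → Top (suc p ∷ l))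
    ≡⟨ cong (∑words≤ N (λ l → 𝟙 (part156≤ b n l) *ℤ ω l) +ℤ_) (trans (∑-cong N pull) (∑-pick Rest b N (λ N≤b → contradiction b<N (ℕ.≤⇒≯ N≤b)))) ⟩
  ∑words≤ N (λ l → 𝟙 (part156≤ b n l) *ℤ ω l) +ℤ Rest b
    ∎
  where
  open ≡-Reasoning
  Top : List ℕ → ℤ
  Top []      = 0ℤ
  Top (x ∷ l) = 𝟙 (x ≡ᵇ suc b) *ℤ (𝟙 (in156 x ∧ (x ≤ᵇ n)) *ℤ (𝟙 (part156≤ x (n ∸ x) l) *ℤ ω (x ∷ l)))
  Rest : ℕ → ℤ
  Rest p = 𝟙 (in156 (suc p) ∧ (suc p ≤ᵇ n)) *ℤ ∑words≤ N (λ l → 𝟙 (part156≤ (suc p) (n ∸ suc p) l) *ℤ ω (suc p ∷ l))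
  split : ∀ l → 𝟙 (part156≤ (suc b) n l) *ℤ ω l ≡ 𝟙 (part156≤ b n l) *ℤ ω l +ℤ Top l
  split []      = sym (ℤ.+-identityʳ _)
  split (x ∷ l) = begin
    𝟙 (part156≤ (suc b) n (x ∷ l)) *ℤ ω (x ∷ l)
      ≡⟨ cong (_*ℤ ω (x ∷ l)) (trans (𝟙-part156≤-∷ (suc b) n x l) (cong (_*ℤ (𝟙 (in156 x ∧ (x ≤ᵇ n)) *ℤ P)) (𝟙-≤ᵇ-suc x b))) ⟩
    ((𝟙 (x ≤ᵇ b) +ℤ 𝟙 (x ≡ᵇ suc b)) *ℤ (𝟙 (in156 x ∧ (x ≤ᵇ n)) *ℤ P)) *ℤ ω (x ∷ l)
      ≡⟨ distrib (𝟙 (x ≤ᵇ b)) (𝟙 (x ≡ᵇ suc b)) (𝟙 (in156 x ∧ (x ≤ᵇ n))) P (ω (x ∷ l)) ⟩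
    (𝟙 (x ≤ᵇ b) *ℤ (𝟙 (in156 x ∧ (x ≤ᵇ n)) *ℤ P)) *ℤ ω (x ∷ l) +ℤ Top (x ∷ l)
      ≡⟨ cong (λ y → y *ℤ ω (x ∷ l) +ℤ Top (x ∷ l)) (𝟙-part156≤-∷ b n x l) ⟨
    𝟙 (part156≤ b n (x ∷ l)) *ℤ ω (x ∷ l) +ℤ Top (x ∷ l)
      ∎
    where
    P : ℤ
    P = 𝟙 (part156≤ x (n ∸ x) l)
    distrib : ∀ u v a p w → ((u +ℤ v) *ℤ (a *ℤ p)) *ℤ w ≡ (u *ℤ (a *ℤ p)) *ℤ w +ℤ v *ℤ (a *ℤ (p *ℤ w))
    distrib = solve-∀
  n∸1+p<N : ∀ p → n ∸ suc p < N
  n∸1+p<N p = ℕ.≤-<-trans (ℕ.∸-monoʳ-≤ n (s≤s (z≤n {p}))) (pred< n n≤N)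
    where
    pred< : ∀ n → n ≤ N → n ∸ 1 < N
    pred< zero    _   = ℕ.≤-<-trans z≤n b<N
    pred< (suc n) n<N = n<N
  long : ∀ p l → All (InRange N) l → length l ≡ N → Top (suc p ∷ l) ≡ 0ℤ
  long p l inR refl = begin
    𝟙 (p ≡ᵇ b) *ℤ (A *ℤ (𝟙 (part156≤ (suc p) (n ∸ suc p) l) *ℤ ω (suc p ∷ l)))
      ≡⟨ cong (λ z → 𝟙 (p ≡ᵇ b) *ℤ (A *ℤ (z *ℤ ω (suc p ∷ l))))
              (part156≤-long (suc p) (n ∸ suc p) l (All.map proj₁ inR) (n∸1+p<N p)) ⟩
    𝟙 (p ≡ᵇ b) *ℤ (A *ℤ (0ℤ *ℤ ω (suc p ∷ l)))
      ≡⟨ vanish (𝟙 (p ≡ᵇ b)) A (ω (suc p ∷ l)) ⟩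
    0ℤ
      ∎
    where
    A : ℤ
    A = 𝟙 (in156 (suc p) ∧ (suc p ≤ᵇ n))
    vanish : ∀ e a w → e *ℤ (a *ℤ (0ℤ *ℤ w)) ≡ 0ℤ
    vanish = solve-∀
  pull : ∀ p → ∑words≤ N (λ l → Top (suc p ∷ l)) ≡ 𝟙 (p ≡ᵇ b) *ℤ Rest p
  pull p = trans (∑words≤-*ˡ N (𝟙 (p ≡ᵇ b)) (λ l → 𝟙 (in156 (suc p) ∧ (suc p ≤ᵇ n)) *ℤ Q l))
                 (cong (𝟙 (p ≡ᵇ b) *ℤ_) (∑words≤-*ˡ N (𝟙 (in156 (suc p) ∧ (suc p ≤ᵇ n))) Q))
    where
    Q : List ℕ → ℤ
    Q l = 𝟙 (part156≤ (suc p) (n ∸ suc p) l) *ℤ ω (suc p ∷ l)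

count156 : ℕ → ℕ → ℕ → ℤ
count156 N b n = ∑words≤ N (λ l → 𝟙 (part156≤ b n l))

hooks156 : ℕ → ℕ → ℕ → ℤ
hooks156 N b n = ∑words≤ N (λ l → 𝟙 (part156≤ b n l) *ℤ + numHooks 2 l)

count156-suc : ∀ N b n → b < N → n ≤ N →
  count156 N (suc b) n ≡ count156 N b n +ℤ 𝟙 (in156 (suc b)) *ℤ (q^ (suc b) ⊛ count156 N (suc b)) n
count156-suc N b n b<N n≤N = begin
  count156 N (suc b) n
    ≡⟨ ∑words≤-cong N (λ l _ → ℤ.*-identityʳ (𝟙 (part156≤ (suc b) n l))) ⟨
  ∑words≤ N (λ l → 𝟙 (part156≤ (suc b) n l) *ℤ 1ℤ)
    ≡⟨ ∑-part156≤-suc N b n (λ _ → 1ℤ) b<N n≤N ⟩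
  ∑words≤ N (λ l → 𝟙 (part156≤ b n l) *ℤ 1ℤ) +ℤ 𝟙 (in156 (suc b) ∧ (suc b ≤ᵇ n)) *ℤ ∑words≤ N (λ l → 𝟙 (part156≤ (suc b) (n ∸ suc b) l) *ℤ 1ℤ)
    ≡⟨ cong₂ (λ x y → x +ℤ 𝟙 (in156 (suc b) ∧ (suc b ≤ᵇ n)) *ℤ y)
             (∑words≤-cong N (λ l _ → ℤ.*-identityʳ (𝟙 (part156≤ b n l))))
             (∑words≤-cong N (λ l _ → ℤ.*-identityʳ (𝟙 (part156≤ (suc b) (n ∸ suc b) l)))) ⟩
  count156 N b n +ℤ 𝟙 (in156 (suc b) ∧ (suc b ≤ᵇ n)) *ℤ count156 N (suc b) (n ∸ suc b)
    ≡⟨ cong (count156 N b n +ℤ_) (𝟙-∧-≤ᵇ-q^ (in156 (suc b)) (suc b) (count156 N (suc b)) n) ⟩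
  count156 N b n +ℤ 𝟙 (in156 (suc b)) *ℤ (q^ (suc b) ⊛ count156 N (suc b)) n
    ∎
  where open ≡-Reasoning

-- A largest part s occurring exactly twice leaves a 2-hook in the last cell of the first row.
𝟙-firstRow-repeat : ∀ b n y l → 𝟙 (part156≤ (suc b) n (y ∷ l)) *ℤ 𝟙 (conj (y ∷ l) (suc b) ≡ᵇ 1)
  ≡ 𝟙 (y ≡ᵇ suc b) *ℤ (𝟙 (in156 (suc b) ∧ (suc b ≤ᵇ n)) *ℤ 𝟙 (part156≤ b (n ∸ suc b) l))
𝟙-firstRow-repeat b n y l with ℕ.<-cmp y (suc b)
... | tri< y<s y≢s _ = trans lhs≡0 (sym (𝟙-false-* (𝟙 (in156 (suc b) ∧ (suc b ≤ᵇ n)) *ℤ 𝟙 (part156≤ b (n ∸ suc b) l)) (≡ᵇ-false y≢s)))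
  where
  lhs≡0 : 𝟙 (part156≤ (suc b) n (y ∷ l)) *ℤ 𝟙 (conj (y ∷ l) (suc b) ≡ᵇ 1) ≡ 0ℤ
  lhs≡0 with part156≤ (suc b) n (y ∷ l) in p
  ... | false = ℤ.*-zeroˡ (𝟙 (conj (y ∷ l) (suc b) ≡ᵇ 1))
  ... | true  = trans (cong (λ c → 1ℤ *ℤ 𝟙 (c ≡ᵇ 1)) (conj-> (y ∷ l) (Nonincreasing-part156≤ (suc b) n y l p) y<s)) refl
... | tri≈ _ refl _ = begin
  𝟙 (part156≤ s n (s ∷ l)) *ℤ 𝟙 (conj (s ∷ l) s ≡ᵇ 1)
    ≡⟨ cong₂ _*ℤ_ (𝟙-part156≤-∷ s n s l) (cong (λ c → 𝟙 (c ≡ᵇ 1)) (conj-∷-≤ s l ℕ.≤-refl)) ⟩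
  𝟙 (s ≤ᵇ s) *ℤ (𝟙 A *ℤ 𝟙 (part156≤ s (n ∸ s) l)) *ℤ 𝟙 (conj l s ≡ᵇ 0)
    ≡⟨ reassoc (𝟙 (s ≤ᵇ s)) (𝟙 A) (𝟙 (part156≤ s (n ∸ s) l)) (𝟙 (conj l s ≡ᵇ 0)) ⟩
  𝟙 (s ≤ᵇ s) *ℤ (𝟙 A *ℤ (𝟙 (part156≤ s (n ∸ s) l) *ℤ 𝟙 (conj l s ≡ᵇ 0)))
    ≡⟨ cong₂ (λ u v → 𝟙 u *ℤ (𝟙 A *ℤ v)) (trans (≤ᵇ-true (ℕ.≤-refl {s})) (sym (≡ᵇ-refl s)))
             (trans (sym (𝟙-∧ (part156≤ s (n ∸ s) l) (conj l s ≡ᵇ 0))) (cong 𝟙 (part156≤-lower s b (n ∸ s) l (ℕ.n≤1+n b)))) ⟩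
  𝟙 (s ≡ᵇ s) *ℤ (𝟙 A *ℤ 𝟙 (part156≤ b (n ∸ s) l))
    ∎
  where
  open ≡-Reasoning
  s : ℕ
  s = suc b
  A : Bool
  A = in156 s ∧ (s ≤ᵇ n)
  reassoc : ∀ a b c d → a *ℤ (b *ℤ c) *ℤ d ≡ a *ℤ (b *ℤ (c *ℤ d))
  reassoc = solve-∀
... | tri> _ y≢s s<y = begin
  𝟙 (part156≤ (suc b) n (y ∷ l)) *ℤ 𝟙 (conj (y ∷ l) (suc b) ≡ᵇ 1)
    ≡⟨ cong (_*ℤ 𝟙 (conj (y ∷ l) (suc b) ≡ᵇ 1)) (trans (𝟙-part156≤-∷ (suc b) n y l) (𝟙-false-* Q (≤ᵇ-false s<y))) ⟩
  0ℤ *ℤ 𝟙 (conj (y ∷ l) (suc b) ≡ᵇ 1)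
    ≡⟨ ℤ.*-zeroˡ (𝟙 (conj (y ∷ l) (suc b) ≡ᵇ 1)) ⟩
  0ℤ
    ≡⟨ 𝟙-false-* (𝟙 (in156 (suc b) ∧ (suc b ≤ᵇ n)) *ℤ 𝟙 (part156≤ b (n ∸ suc b) l)) (≡ᵇ-false y≢s) ⟨
  𝟙 (y ≡ᵇ suc b) *ℤ (𝟙 (in156 (suc b) ∧ (suc b ≤ᵇ n)) *ℤ 𝟙 (part156≤ b (n ∸ suc b) l))
    ∎
  where
  open ≡-Reasoning
  Q : ℤ
  Q = 𝟙 (in156 y ∧ (y ≤ᵇ n)) *ℤ 𝟙 (part156≤ y (n ∸ y) l)

-- A second part below s - 1 leaves a 2-hook in the last but one cell of the first row.
𝟙-firstRow-gap : ∀ b n l → 𝟙 (part156≤ (suc b) n l) *ℤ 𝟙 ((2 ≤ᵇ suc b) ∧ (conj l b ≡ᵇ 0))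
  ≡ 𝟙 (2 ≤ᵇ suc b) *ℤ 𝟙 (part156≤ (b ∸ 1) n l)
𝟙-firstRow-gap zero    n l = trans (ℤ.*-zeroʳ (𝟙 (part156≤ 1 n l))) (sym (ℤ.*-zeroˡ (𝟙 (part156≤ 0 n l))))
𝟙-firstRow-gap (suc b) n l = trans (sym (𝟙-∧ (part156≤ (suc (suc b)) n l) (conj l (suc b) ≡ᵇ 0)))
  (trans (cong 𝟙 (part156≤-lower (suc (suc b)) b n l (ℕ.≤-trans (ℕ.n≤1+n b) (ℕ.n≤1+n (suc b)))))
         (sym (ℤ.*-identityˡ (𝟙 (part156≤ b n l)))))

𝟙-part156≤-hooks : ∀ b n l → 𝟙 (part156≤ (suc b) n l) *ℤ + numHooks 2 (suc b ∷ l)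
  ≡ 𝟙 (part156≤ (suc b) n l) *ℤ 𝟙 (conj l (suc b) ≡ᵇ 1)
    +ℤ 𝟙 (part156≤ (suc b) n l) *ℤ 𝟙 ((2 ≤ᵇ suc b) ∧ (conj l b ≡ᵇ 0))
    +ℤ 𝟙 (part156≤ (suc b) n l) *ℤ + numHooks 2 l
𝟙-part156≤-hooks b n l with part156≤ (suc b) n l in p
... | false = spread (+ numHooks 2 (suc b ∷ l)) (𝟙 (conj l (suc b) ≡ᵇ 1)) (𝟙 ((2 ≤ᵇ suc b) ∧ (conj l b ≡ᵇ 0))) (+ numHooks 2 l)
  where
  spread : ∀ h x y z → 0ℤ *ℤ h ≡ 0ℤ *ℤ x +ℤ 0ℤ *ℤ y +ℤ 0ℤ *ℤ z
  spread = solve-∀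
... | true  = trans (cong (1ℤ *ℤ_) (numHooks₂-∷ b l (proj₁ (∧-true p))))
                    (spread (𝟙 (conj l (suc b) ≡ᵇ 1)) (𝟙 ((2 ≤ᵇ suc b) ∧ (conj l b ≡ᵇ 0))) (+ numHooks 2 l))
  where
  spread : ∀ x y z → 1ℤ *ℤ (x +ℤ y +ℤ z) ≡ 1ℤ *ℤ x +ℤ 1ℤ *ℤ y +ℤ 1ℤ *ℤ z
  spread = solve-∀

∑-firstRow-repeat : ∀ N b n → b < N → n < N →
  ∑words≤ N (λ l → 𝟙 (part156≤ (suc b) n l) *ℤ 𝟙 (conj l (suc b) ≡ᵇ 1))
    ≡ 𝟙 (in156 (suc b) ∧ (suc b ≤ᵇ n)) *ℤ count156 N b (n ∸ suc b)
∑-firstRow-repeat N b n b<N n<N = begin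
  ∑words≤ N F
    ≡⟨ ∑words≤-∷ N F long ⟩
  F [] +ℤ ∑[ p < N ] ∑words≤ N (λ l → F (suc p ∷ l))
    ≡⟨ cong₂ _+ℤ_ (ℤ.*-zeroʳ (𝟙 (part156≤ (suc b) n []))) (∑-cong N pull) ⟩
  0ℤ +ℤ ∑[ p < N ] (𝟙 (p ≡ᵇ b) *ℤ Rest)
    ≡⟨ trans (ℤ.+-identityˡ _) (∑-pick (λ _ → Rest) b N (λ N≤b → contradiction b<N (ℕ.≤⇒≯ N≤b))) ⟩
  Rest
    ∎
  where
  open ≡-Reasoning
  F : List ℕ → ℤ
  F l = 𝟙 (part156≤ (suc b) n l) *ℤ 𝟙 (conj l (suc b) ≡ᵇ 1)
  A : ℤ
  A = 𝟙 (in156 (suc b) ∧ (suc b ≤ᵇ n))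
  Rest = A *ℤ count156 N b (n ∸ suc b)
  long : ∀ p l → All (InRange N) l → length l ≡ N → F (suc p ∷ l) ≡ 0ℤ
  long p l inR refl = trans (cong (_*ℤ 𝟙 (conj (suc p ∷ l) (suc b) ≡ᵇ 1))
                                  (part156≤-long (suc b) n (suc p ∷ l) (s≤s z≤n ∷ All.map proj₁ inR) (ℕ.m≤n⇒m≤1+n n<N)))
                            (ℤ.*-zeroˡ (𝟙 (conj (suc p ∷ l) (suc b) ≡ᵇ 1)))
  pull : ∀ p → ∑words≤ N (λ l → F (suc p ∷ l)) ≡ 𝟙 (p ≡ᵇ b) *ℤ Rest
  pull p = trans (∑words≤-cong N (λ l _ → 𝟙-firstRow-repeat b n (suc p) l))
           (trans (∑words≤-*ˡ N (𝟙 (p ≡ᵇ b)) (λ l → A *ℤ 𝟙 (part156≤ b (n ∸ suc b) l)))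
                  (cong (𝟙 (p ≡ᵇ b) *ℤ_) (∑words≤-*ˡ N A (λ l → 𝟙 (part156≤ b (n ∸ suc b) l)))))

∑-firstPart-hooks : ∀ N b n → b < N → n < N →
  ∑words≤ N (λ l → 𝟙 (part156≤ (suc b) n l) *ℤ + numHooks 2 (suc b ∷ l))
    ≡ 𝟙 (in156 (suc b) ∧ (suc b ≤ᵇ n)) *ℤ count156 N b (n ∸ suc b)
      +ℤ 𝟙 (2 ≤ᵇ suc b) *ℤ count156 N (b ∸ 1) n +ℤ hooks156 N (suc b) n
∑-firstPart-hooks N b n b<N n<N = begin
  ∑words≤ N (λ l → 𝟙 (P l) *ℤ + numHooks 2 (suc b ∷ l))
    ≡⟨ ∑words≤-cong N (λ l _ → 𝟙-part156≤-hooks b n l) ⟩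
  ∑words≤ N (λ l → 𝟙 (P l) *ℤ α l +ℤ 𝟙 (P l) *ℤ β l +ℤ 𝟙 (P l) *ℤ + numHooks 2 l)
    ≡⟨ trans (∑words≤-distrib-+ N (λ l → 𝟙 (P l) *ℤ α l +ℤ 𝟙 (P l) *ℤ β l) (λ l → 𝟙 (P l) *ℤ + numHooks 2 l))
             (cong (_+ℤ hooks156 N (suc b) n) (∑words≤-distrib-+ N (λ l → 𝟙 (P l) *ℤ α l) (λ l → 𝟙 (P l) *ℤ β l))) ⟩
  ∑words≤ N (λ l → 𝟙 (P l) *ℤ α l) +ℤ ∑words≤ N (λ l → 𝟙 (P l) *ℤ β l) +ℤ hooks156 N (suc b) n
    ≡⟨ cong (λ x → x +ℤ ∑words≤ N (λ l → 𝟙 (P l) *ℤ β l) +ℤ hooks156 N (suc b) n) (∑-firstRow-repeat N b n b<N n<N) ⟩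
  𝟙 (in156 (suc b) ∧ (suc b ≤ᵇ n)) *ℤ count156 N b (n ∸ suc b) +ℤ ∑words≤ N (λ l → 𝟙 (P l) *ℤ β l) +ℤ hooks156 N (suc b) n
    ≡⟨ cong (λ x → 𝟙 (in156 (suc b) ∧ (suc b ≤ᵇ n)) *ℤ count156 N b (n ∸ suc b) +ℤ x +ℤ hooks156 N (suc b) n)
            (trans (∑words≤-cong N (λ l _ → 𝟙-firstRow-gap b n l)) (∑words≤-*ˡ N (𝟙 (2 ≤ᵇ suc b)) (λ l → 𝟙 (part156≤ (b ∸ 1) n l)))) ⟩
  𝟙 (in156 (suc b) ∧ (suc b ≤ᵇ n)) *ℤ count156 N b (n ∸ suc b) +ℤ 𝟙 (2 ≤ᵇ suc b) *ℤ count156 N (b ∸ 1) n +ℤ hooks156 N (suc b) n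
    ∎
  where
  open ≡-Reasoning
  P : List ℕ → Bool
  P = part156≤ (suc b) n
  α β : List ℕ → ℤ
  α l = 𝟙 (conj l (suc b) ≡ᵇ 1)
  β l = 𝟙 ((2 ≤ᵇ suc b) ∧ (conj l b ≡ᵇ 0))

P≤ : ℕ → PS
P≤ zero    = one
P≤ (suc b) = if in156 (suc b) then geom (suc b) ⊛ P≤ b else P≤ b

P≤-in : ∀ {b} → in156 (suc b) ≡ true → P≤ (suc b) ≡ geom (suc b) ⊛ P≤ b
P≤-in {b} = cong (if_then geom (suc b) ⊛ P≤ b else P≤ b)

P≤-out : ∀ {b} → in156 (suc b) ≡ false → P≤ (suc b) ≡ P≤ b
P≤-out {b} = cong (if_then geom (suc b) ⊛ P≤ b else P≤ b)

P≤-suc : ∀ b m → P≤ (suc b) m ≡ P≤ b m +ℤ 𝟙 (in156 (suc b)) *ℤ (q^ (suc b) ⊛ P≤ (suc b)) m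
P≤-suc b m with in156 (suc b)
... | true  = trans (geom-⊛ (suc b) (P≤ b) (s≤s z≤n) m) (cong (P≤ b m +ℤ_) (sym (ℤ.*-identityˡ _)))
... | false = sym (trans (cong (P≤ b m +ℤ_) (ℤ.*-zeroˡ ((q^ (suc b) ⊛ P≤ b) m))) (ℤ.+-identityʳ (P≤ b m)))

count156-0 : ∀ N m → count156 N 0 m ≡ one m
count156-0 N m = begin
  count156 N 0 m                                       ≡⟨ ∑words≤-∷ N (λ l → 𝟙 (part156≤ 0 m l)) (λ _ _ _ _ → refl) ⟩
  𝟙 (0 ≡ᵇ m) +ℤ ∑[ p < N ] ∑words≤ N (λ _ → 0ℤ)       ≡⟨ cong (𝟙 (0 ≡ᵇ m) +ℤ_) (∑-zero N (λ _ _ → ∑-zero (suc N) (λ k _ → ∑words-const-0 N k))) ⟩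
  𝟙 (0 ≡ᵇ m) +ℤ 0ℤ                                     ≡⟨ trans (ℤ.+-identityʳ _) (unit m) ⟩
  one m                                                ∎
  where
  open ≡-Reasoning
  unit : ∀ m → 𝟙 (0 ≡ᵇ m) ≡ one m
  unit zero    = refl
  unit (suc m) = refl

count156≡P≤ : ∀ N b m → b ≤ N → m ≤ N → count156 N b m ≡ P≤ b m
count156≡P≤ N zero    m _   _   = count156-0 N m
count156≡P≤ N (suc b) m b<N m≤N =
  recurrence-unique (suc b) (𝟙 (in156 (suc b))) {count156 N (suc b)} {P≤ (suc b)} {count156 N b} {P≤ b} N (s≤s z≤n)
    (λ i i≤N → count156≡P≤ N b i (ℕ.<⇒≤ b<N) i≤N) (λ i i≤N → count156-suc N b i b<N i≤N) (λ i _ → P≤-suc b i) m m≤N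

-- generating function of the first-row 2-hooks of the partitions with largest part b + 1
E156 : ℕ → PS
E156 b = q^ (2 * suc b) ⊛ P≤ b ⊕ mono (𝟙 (2 ≤ᵇ suc b)) (suc b) ⊛ P≤ (b ∸ 1)

E156-< : ∀ b {m} → m < suc b → E156 b m ≡ 0ℤ
E156-< b {m} m<s = cong₂ _+ℤ_ (q^-⊛-< (2 * suc b) (P≤ b) (ℕ.<-≤-trans m<s (ℕ.m≤m+n (suc b) _)))
                              (trans (mono-⊛-coeff (𝟙 (2 ≤ᵇ suc b)) (suc b) (P≤ (b ∸ 1)) m)
                                     (cong (if_then 𝟙 (2 ≤ᵇ suc b) *ℤ P≤ (b ∸ 1) (m ∸ suc b) else 0ℤ) (≤ᵇ-false m<s)))

hooks156-suc : ∀ N b n → b < N → n ≤ N → hooks156 N (suc b) n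
  ≡ (hooks156 N b n +ℤ 𝟙 (in156 (suc b)) *ℤ E156 b n) +ℤ 𝟙 (in156 (suc b)) *ℤ (q^ (suc b) ⊛ hooks156 N (suc b)) n
hooks156-suc N b n b<N n≤N = begin
  hooks156 N (suc b) n
    ≡⟨ ∑-part156≤-suc N b n (λ l → + numHooks 2 l) b<N n≤N ⟩
  hooks156 N b n +ℤ 𝟙 (in156 s ∧ (s ≤ᵇ n)) *ℤ Z
    ≡⟨ cong (hooks156 N b n +ℤ_) largest ⟩
  hooks156 N b n +ℤ (𝟙 (in156 s) *ℤ E156 b n +ℤ 𝟙 (in156 s) *ℤ (q^ s ⊛ hooks156 N s) n)
    ≡⟨ ℤ.+-assoc (hooks156 N b n) _ _ ⟨
  (hooks156 N b n +ℤ 𝟙 (in156 s) *ℤ E156 b n) +ℤ 𝟙 (in156 s) *ℤ (q^ s ⊛ hooks156 N s) n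
    ∎
  where
  open ≡-Reasoning
  s : ℕ
  s = suc b
  Z : ℤ
  Z = ∑words≤ N (λ l → 𝟙 (part156≤ s (n ∸ s) l) *ℤ + numHooks 2 (s ∷ l))
  largest : 𝟙 (in156 s ∧ (s ≤ᵇ n)) *ℤ Z ≡ 𝟙 (in156 s) *ℤ E156 b n +ℤ 𝟙 (in156 s) *ℤ (q^ s ⊛ hooks156 N s) n
  largest with s ≤ᵇ n | ℕ.≤ᵇ-reflects-≤ s n
  ... | false | ofⁿ s≰n = begin
    𝟙 (in156 s ∧ false) *ℤ Z
      ≡⟨ 𝟙-false-* Z (Bool.∧-zeroʳ (in156 s)) ⟩
    0ℤ
      ≡⟨ cong₂ _+ℤ_ (ℤ.*-zeroʳ (𝟙 (in156 s))) (ℤ.*-zeroʳ (𝟙 (in156 s))) ⟨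
    𝟙 (in156 s) *ℤ 0ℤ +ℤ 𝟙 (in156 s) *ℤ 0ℤ
      ≡⟨ cong₂ (λ x y → 𝟙 (in156 s) *ℤ x +ℤ 𝟙 (in156 s) *ℤ y) (E156-< b n<s) (q^-⊛-< s (hooks156 N s) n<s) ⟨
    𝟙 (in156 s) *ℤ E156 b n +ℤ 𝟙 (in156 s) *ℤ (q^ s ⊛ hooks156 N s) n
      ∎
    where
    n<s : n < s
    n<s = ℕ.≰⇒> s≰n
  ... | true | ofʸ s≤n = begin
    𝟙 (in156 s ∧ true) *ℤ Z
      ≡⟨ cong (λ c → 𝟙 c *ℤ Z) (Bool.∧-identityʳ (in156 s)) ⟩
    u *ℤ Z
      ≡⟨ cong (u *ℤ_) (∑-firstPart-hooks N b (n ∸ s) b<N (ℕ.<-≤-trans (ℕ.∸-monoʳ-< (s≤s z≤n) s≤n) n≤N)) ⟩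
    u *ℤ (𝟙 (in156 s ∧ (s ≤ᵇ n ∸ s)) *ℤ count156 N b (n ∸ s ∸ s) +ℤ 𝟙 (2 ≤ᵇ s) *ℤ count156 N (b ∸ 1) (n ∸ s) +ℤ hooks156 N s (n ∸ s))
      ≡⟨ cong (λ x → u *ℤ (x +ℤ 𝟙 (2 ≤ᵇ s) *ℤ count156 N (b ∸ 1) (n ∸ s) +ℤ hooks156 N s (n ∸ s)))
              (𝟙-∧-≤ᵇ-q^ (in156 s) s (count156 N b) (n ∸ s)) ⟩
    u *ℤ (u *ℤ (q^ s ⊛ count156 N b) (n ∸ s) +ℤ 𝟙 (2 ≤ᵇ s) *ℤ count156 N (b ∸ 1) (n ∸ s) +ℤ hooks156 N s (n ∸ s))
      ≡⟨ cong (λ x → u *ℤ (u *ℤ x +ℤ 𝟙 (2 ≤ᵇ s) *ℤ count156 N (b ∸ 1) (n ∸ s) +ℤ hooks156 N s (n ∸ s))) twoRows ⟩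
    u *ℤ (u *ℤ (q^ (2 * s) ⊛ P≤ b) n +ℤ 𝟙 (2 ≤ᵇ s) *ℤ count156 N (b ∸ 1) (n ∸ s) +ℤ hooks156 N s (n ∸ s))
      ≡⟨ cong₂ (λ x y → u *ℤ (u *ℤ (q^ (2 * s) ⊛ P≤ b) n +ℤ x +ℤ y)) oneRow (sym (q^-⊛-≥ s (hooks156 N s) s≤n)) ⟩
    u *ℤ (u *ℤ A +ℤ B +ℤ C)
      ≡⟨ absorb u A B C (𝟙-idem (in156 s)) ⟩
    u *ℤ (A +ℤ B) +ℤ u *ℤ C
      ∎
    where
    n∸s≤N : n ∸ s ≤ N
    n∸s≤N = ℕ.≤-trans (ℕ.m∸n≤m n s) n≤N
    u A B C : ℤ
    u = 𝟙 (in156 s)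
    A = (q^ (2 * s) ⊛ P≤ b) n
    B = (mono (𝟙 (2 ≤ᵇ s)) s ⊛ P≤ (b ∸ 1)) n
    C = (q^ s ⊛ hooks156 N s) n
    absorb : ∀ u a b c → u *ℤ u ≡ u → u *ℤ (u *ℤ a +ℤ b +ℤ c) ≡ u *ℤ (a +ℤ b) +ℤ u *ℤ c
    absorb u a b c uu≡u = begin
      u *ℤ (u *ℤ a +ℤ b +ℤ c)           ≡⟨ expand u a b c ⟩
      (u *ℤ u) *ℤ a +ℤ u *ℤ (b +ℤ c)    ≡⟨ cong (λ x → x *ℤ a +ℤ u *ℤ (b +ℤ c)) uu≡u ⟩
      u *ℤ a +ℤ u *ℤ (b +ℤ c)           ≡⟨ collect u a b c ⟩
      u *ℤ (a +ℤ b) +ℤ u *ℤ c           ∎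
      where
      expand : ∀ u a b c → u *ℤ (u *ℤ a +ℤ b +ℤ c) ≡ (u *ℤ u) *ℤ a +ℤ u *ℤ (b +ℤ c)
      expand = solve-∀
      collect : ∀ u a b c → u *ℤ a +ℤ u *ℤ (b +ℤ c) ≡ u *ℤ (a +ℤ b) +ℤ u *ℤ c
      collect = solve-∀
    twoRows : (q^ s ⊛ count156 N b) (n ∸ s) ≡ (q^ (2 * s) ⊛ P≤ b) n
    twoRows = begin
      (q^ s ⊛ count156 N b) (n ∸ s)
        ≡⟨ ⊛-cong-≤ (q^ s) (n ∸ s) (λ i i≤ → count156≡P≤ N b i (ℕ.<⇒≤ b<N) (ℕ.≤-trans i≤ n∸s≤N)) ⟩
      (q^ s ⊛ P≤ b) (n ∸ s)
        ≡⟨ q^-⊛-≥ s (q^ s ⊛ P≤ b) s≤n ⟨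
      (q^ s ⊛ (q^ s ⊛ P≤ b)) n
        ≡⟨ q^-⊛-q^ s s (P≤ b) n ⟩
      (q^ (s + s) ⊛ P≤ b) n
        ≡⟨ cong (λ e → (q^ e ⊛ P≤ b) n) (cong (λ t → s + t) (sym (ℕ.+-identityʳ s))) ⟩
      (q^ (2 * s) ⊛ P≤ b) n
        ∎
    oneRow : 𝟙 (2 ≤ᵇ s) *ℤ count156 N (b ∸ 1) (n ∸ s) ≡ (mono (𝟙 (2 ≤ᵇ s)) s ⊛ P≤ (b ∸ 1)) n
    oneRow = begin
      𝟙 (2 ≤ᵇ s) *ℤ count156 N (b ∸ 1) (n ∸ s)
        ≡⟨ cong (𝟙 (2 ≤ᵇ s) *ℤ_) (count156≡P≤ N (b ∸ 1) (n ∸ s) (ℕ.≤-trans (ℕ.m∸n≤m b 1) (ℕ.<⇒≤ b<N)) n∸s≤N) ⟩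
      𝟙 (2 ≤ᵇ s) *ℤ P≤ (b ∸ 1) (n ∸ s)
        ≡⟨ trans (mono-⊛-coeff (𝟙 (2 ≤ᵇ s)) s (P≤ (b ∸ 1)) n) (cong (if_then 𝟙 (2 ≤ᵇ s) *ℤ P≤ (b ∸ 1) (n ∸ s) else 0ℤ) (≤ᵇ-true s≤n)) ⟨
      (mono (𝟙 (2 ≤ᵇ s)) s ⊛ P≤ (b ∸ 1)) n
        ∎

hooks156-0 : ∀ N m → hooks156 N 0 m ≡ 0ℤ
hooks156-0 N m = begin
  hooks156 N 0 m
    ≡⟨ ∑words≤-∷ N (λ l → 𝟙 (part156≤ 0 m l) *ℤ + numHooks 2 l) (λ _ _ _ _ → refl) ⟩
  𝟙 (0 ≡ᵇ m) *ℤ 0ℤ +ℤ ∑[ p < N ] ∑words≤ N (λ _ → 0ℤ)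
    ≡⟨ cong₂ _+ℤ_ (ℤ.*-zeroʳ (𝟙 (0 ≡ᵇ m))) (∑-zero N (λ _ _ → ∑-zero (suc N) (λ k _ → ∑words-const-0 N k))) ⟩
  0ℤ
    ∎
  where open ≡-Reasoning

δ156 : ℕ → PS
δ156 b = q^ (2 * suc b) ⊕ mono (𝟙 (2 ≤ᵇ suc b)) (suc b) ⊕ mono (- 𝟙 (in156 b)) (2 * suc b ∸ 1)

B≤ : ℕ → PS
B≤ zero    = 𝟎
B≤ (suc b) = if in156 (suc b) then δ156 b ⊕ B≤ b else B≤ b

-- Since P≤ (b - 1) = (1 - q^b) P≤ b when b ∈ S, the term q^(b+1) P≤ (b - 1) of E156 b
-- is q^(b+1) P≤ b - q^(2b+1) P≤ b.
E156≋P≤⊛δ156 : ∀ b → E156 b ≋ P≤ b ⊛ δ156 b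
E156≋P≤⊛δ156 b m = sym (begin
  (P≤ b ⊛ δ156 b) m
    ≡⟨ ⊛-comm (P≤ b) (δ156 b) m ⟩
  (δ156 b ⊛ P≤ b) m
    ≡⟨ trans (⊛-distribʳ-⊕ (P≤ b) (X ⊕ Y) Z m) (cong (_+ℤ (Z ⊛ P≤ b) m) (⊛-distribʳ-⊕ (P≤ b) X Y m)) ⟩
  (X ⊛ P≤ b) m +ℤ (Y ⊛ P≤ b) m +ℤ (Z ⊛ P≤ b) m
    ≡⟨ ℤ.+-assoc ((X ⊛ P≤ b) m) _ _ ⟩
  (X ⊛ P≤ b) m +ℤ ((Y ⊛ P≤ b) m +ℤ (Z ⊛ P≤ b) m)
    ≡⟨ cong ((X ⊛ P≤ b) m +ℤ_) (remove-last b) ⟩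
  E156 b m
    ∎)
  where
  open ≡-Reasoning
  X Y Z : PS
  X = q^ (2 * suc b)
  Y = mono (𝟙 (2 ≤ᵇ suc b)) (suc b)
  Z = mono (- 𝟙 (in156 b)) (2 * suc b ∸ 1)
  remove-last : ∀ b → (mono (𝟙 (2 ≤ᵇ suc b)) (suc b) ⊛ P≤ b) m +ℤ (mono (- 𝟙 (in156 b)) (2 * suc b ∸ 1) ⊛ P≤ b) m
                      ≡ (mono (𝟙 (2 ≤ᵇ suc b)) (suc b) ⊛ P≤ (b ∸ 1)) m
  remove-last zero = trans (cong₂ _+ℤ_ (mono-0-⊛ 1 one m) (mono-0-⊛ 1 one m)) (sym (mono-0-⊛ 1 one m))
  remove-last (suc b) with in156 (suc b)
  ... | false = trans (cong ((q^ (2 + b) ⊛ P≤ b) m +ℤ_) (mono-0-⊛ (2 * (2 + b) ∸ 1) (P≤ b) m)) (ℤ.+-identityʳ _)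
  ... | true  = begin
    (q^ s ⊛ G) m +ℤ (mono (- 1ℤ) (2 * s ∸ 1) ⊛ G) m
      ≡⟨ cong₂ _+ℤ_ (⊛-congˡ (q^ s) (geom-⊛ (suc b) (P≤ b) (s≤s z≤n)) m) (mono-neg-⊛ 1ℤ (2 * s ∸ 1) G m) ⟩
    (q^ s ⊛ (P≤ b ⊕ q^ (suc b) ⊛ G)) m +ℤ - (q^ (2 * s ∸ 1) ⊛ G) m
      ≡⟨ cong (_+ℤ - (q^ (2 * s ∸ 1) ⊛ G) m) (trans (⊛-distribˡ-⊕ (q^ s) (P≤ b) (q^ (suc b) ⊛ G) m)
                                                     (cong ((q^ s ⊛ P≤ b) m +ℤ_) (q^-⊛-q^ s (suc b) G m))) ⟩
    (q^ s ⊛ P≤ b) m +ℤ (q^ (s + suc b) ⊛ G) m +ℤ - (q^ (2 * s ∸ 1) ⊛ G) m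
      ≡⟨ cong (λ e → (q^ s ⊛ P≤ b) m +ℤ (q^ (s + suc b) ⊛ G) m +ℤ - (q^ e ⊛ G) m) (exponent b) ⟩
    (q^ s ⊛ P≤ b) m +ℤ (q^ (s + suc b) ⊛ G) m +ℤ - (q^ (s + suc b) ⊛ G) m
      ≡⟨ cancel ((q^ s ⊛ P≤ b) m) ((q^ (s + suc b) ⊛ G) m) ⟩
    (q^ s ⊛ P≤ b) m
      ∎
    where
    s : ℕ
    s = 2 + b
    G : PS
    G = geom (suc b) ⊛ P≤ b
    exponent : ∀ b → 2 * (2 + b) ∸ 1 ≡ 2 + b + suc b
    exponent b = cong (_∸ 1) (solve-∀ℕ′ b)
      where
      solve-∀ℕ′ : ∀ b → 2 * (2 + b) ≡ suc (2 + b + suc b)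
      solve-∀ℕ′ = solve-∀ℕ
    cancel : ∀ a x → a +ℤ x +ℤ - x ≡ a
    cancel = solve-∀

hooksGF : ℕ → PS
hooksGF b = P≤ b ⊛ B≤ b

hooksGF-suc : ∀ b m → hooksGF (suc b) m
  ≡ (hooksGF b m +ℤ 𝟙 (in156 (suc b)) *ℤ E156 b m) +ℤ 𝟙 (in156 (suc b)) *ℤ (q^ (suc b) ⊛ hooksGF (suc b)) m
hooksGF-suc b m with in156 (suc b)
... | false = sym (trans (cong₂ _+ℤ_ (cong (hooksGF b m +ℤ_) (ℤ.*-zeroˡ (E156 b m))) (ℤ.*-zeroˡ ((q^ (suc b) ⊛ hooksGF b) m)))
                         (trans (ℤ.+-identityʳ _) (ℤ.+-identityʳ _)))
... | true  = trans (T≋ m) (regroup (E156 b m) (hooksGF b m) _)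
  where
  s : ℕ
  s = suc b
  T : PS
  T = (geom s ⊛ P≤ b) ⊛ (δ156 b ⊕ B≤ b)
  T≋geom : T ≋ geom s ⊛ (E156 b ⊕ hooksGF b)
  T≋geom = ≋-trans (⊛-assoc (geom s) (P≤ b) (δ156 b ⊕ B≤ b))
           (⊛-congˡ (geom s) (≋-trans (⊛-distribˡ-⊕ (P≤ b) (δ156 b) (B≤ b)) (⊕-cong (≋-sym (E156≋P≤⊛δ156 b)) (≋-refl {hooksGF b}))))
  T≋ : T ≋ (E156 b ⊕ hooksGF b) ⊕ q^ s ⊛ T
  T≋ = ≋-trans T≋geom (≋-trans (geom-⊛ s (E156 b ⊕ hooksGF b) (s≤s z≤n)) (⊕-cong (≋-refl {E156 b ⊕ hooksGF b}) (⊛-congˡ (q^ s) (≋-sym T≋geom))))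
  regroup : ∀ e h x → (e +ℤ h) +ℤ x ≡ (h +ℤ 1ℤ *ℤ e) +ℤ 1ℤ *ℤ x
  regroup = solve-∀

hooks156≡hooksGF : ∀ N b m → b ≤ N → m ≤ N → hooks156 N b m ≡ hooksGF b m
hooks156≡hooksGF N zero    m _   _   = trans (hooks156-0 N m) (sym (⊛-identityˡ 𝟎 m))
hooks156≡hooksGF N (suc b) m b<N m≤N =
  recurrence-unique (suc b) (𝟙 (in156 (suc b))) {hooks156 N (suc b)} {hooksGF (suc b)}
    {λ i → hooks156 N b i +ℤ 𝟙 (in156 (suc b)) *ℤ E156 b i} {λ i → hooksGF b i +ℤ 𝟙 (in156 (suc b)) *ℤ E156 b i} N (s≤s z≤n)
    (λ i i≤N → cong (_+ℤ 𝟙 (in156 (suc b)) *ℤ E156 b i) (hooks156≡hooksGF N b i (ℕ.<⇒≤ b<N) i≤N))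
    (λ i i≤N → hooks156-suc N b i b<N i≤N) (λ i _ → hooksGF-suc b i) m m≤N

hooksGF-stable : ∀ b m → m ≤ b → hooksGF (suc b) m ≡ hooksGF b m
hooksGF-stable b m m≤b = begin
  hooksGF (suc b) m
    ≡⟨ hooksGF-suc b m ⟩
  (hooksGF b m +ℤ u *ℤ E156 b m) +ℤ u *ℤ (q^ (suc b) ⊛ hooksGF (suc b)) m
    ≡⟨ cong₂ (λ x y → (hooksGF b m +ℤ u *ℤ x) +ℤ u *ℤ y) (E156-< b (s≤s m≤b)) (q^-⊛-< (suc b) (hooksGF (suc b)) (s≤s m≤b)) ⟩
  (hooksGF b m +ℤ u *ℤ 0ℤ) +ℤ u *ℤ 0ℤ
    ≡⟨ vanish (hooksGF b m) u ⟩
  hooksGF b m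
    ∎
  where
  open ≡-Reasoning
  u : ℤ
  u = 𝟙 (in156 (suc b))
  vanish : ∀ h u → (h +ℤ u *ℤ 0ℤ) +ℤ u *ℤ 0ℤ ≡ h
  vanish = solve-∀

hooksGF-stable-+ : ∀ d b m → m ≤ b → hooksGF (d + b) m ≡ hooksGF b m
hooksGF-stable-+ zero    b m m≤b = refl
hooksGF-stable-+ (suc d) b m m≤b = trans (hooksGF-stable (d + b) m (ℕ.≤-trans m≤b (ℕ.m≤n+m b d))) (hooksGF-stable-+ d b m m≤b)

in156-+8* : ∀ r m → in156 (r + 8 * m) ≡ in156 r
in156-+8* r m = cong (λ y → (y ≡ᵇ 1) ∨ (y ≡ᵇ 5) ∨ (y ≡ᵇ 6))
                     (trans (cong (λ k → (r + k) % 8) (ℕ.*-comm 8 m)) ([m+kn]%n≡m%n r m 8))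

B≤-in : ∀ {b} → in156 (suc b) ≡ true → B≤ (suc b) ≡ δ156 b ⊕ B≤ b
B≤-in {b} = cong (if_then δ156 b ⊕ B≤ b else B≤ b)

B≤-out : ∀ {b} → in156 (suc b) ≡ false → B≤ (suc b) ≡ B≤ b
B≤-out {b} = cong (if_then δ156 b ⊕ B≤ b else B≤ b)

P≤-8+ : ∀ m → P≤ (8 + 8 * m) ≡ geom (6 + 8 * m) ⊛ (geom (5 + 8 * m) ⊛ (geom (1 + 8 * m) ⊛ P≤ (8 * m)))
P≤-8+ m =
  trans (P≤-out {7 + 8 * m} (in156-+8* 8 m)) (trans (P≤-out {6 + 8 * m} (in156-+8* 7 m)) (trans (P≤-in {5 + 8 * m} (in156-+8* 6 m))
  (cong (geom (6 + 8 * m) ⊛_) (trans (P≤-in {4 + 8 * m} (in156-+8* 5 m)) (cong (geom (5 + 8 * m) ⊛_)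
  (trans (P≤-out {3 + 8 * m} (in156-+8* 4 m)) (trans (P≤-out {2 + 8 * m} (in156-+8* 3 m)) (trans (P≤-out {1 + 8 * m} (in156-+8* 2 m)) (P≤-in {8 * m} (in156-+8* 1 m))))))))))

B≤-8+ : ∀ m → B≤ (8 + 8 * m) ≡ δ156 (5 + 8 * m) ⊕ (δ156 (4 + 8 * m) ⊕ (δ156 (8 * m) ⊕ B≤ (8 * m)))
B≤-8+ m =
  trans (B≤-out {7 + 8 * m} (in156-+8* 8 m)) (trans (B≤-out {6 + 8 * m} (in156-+8* 7 m)) (trans (B≤-in {5 + 8 * m} (in156-+8* 6 m))
  (cong (δ156 (5 + 8 * m) ⊕_) (trans (B≤-in {4 + 8 * m} (in156-+8* 5 m)) (cong (δ156 (4 + 8 * m) ⊕_)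
  (trans (B≤-out {3 + 8 * m} (in156-+8* 4 m)) (trans (B≤-out {2 + 8 * m} (in156-+8* 3 m)) (trans (B≤-out {1 + 8 * m} (in156-+8* 2 m)) (B≤-in {8 * m} (in156-+8* 1 m))))))))))

invProd156≋P≤ : ∀ M → invProd156 M ≋ P≤ (8 * M)
invProd156≋P≤ zero    = ≋-refl
invProd156≋P≤ (suc M) = begin
  invProd156 (suc M)
    ≈⟨ prodPS-upTo-suc (λ i → geom (8 * i + 1) ⊛ geom (8 * i + 5) ⊛ geom (8 * i + 6)) M ⟩
  geom (8 * M + 1) ⊛ geom (8 * M + 5) ⊛ geom (8 * M + 6) ⊛ invProd156 M
    ≈⟨ ⊛-congˡ (geom (8 * M + 1) ⊛ geom (8 * M + 5) ⊛ geom (8 * M + 6)) (invProd156≋P≤ M) ⟩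
  geom (8 * M + 1) ⊛ geom (8 * M + 5) ⊛ geom (8 * M + 6) ⊛ P≤ (8 * M)
    ≡⟨ cong₂ (λ a b → geom a ⊛ geom b ⊛ geom (8 * M + 6) ⊛ P≤ (8 * M)) (ℕ.+-comm (8 * M) 1) (ℕ.+-comm (8 * M) 5) ⟩
  g₁ ⊛ g₅ ⊛ geom (8 * M + 6) ⊛ P≤ (8 * M)
    ≡⟨ cong (λ a → g₁ ⊛ g₅ ⊛ geom a ⊛ P≤ (8 * M)) (ℕ.+-comm (8 * M) 6) ⟩
  g₁ ⊛ g₅ ⊛ g₆ ⊛ P≤ (8 * M)
    ≈⟨ reorder ⟩
  g₆ ⊛ (g₅ ⊛ (g₁ ⊛ P≤ (8 * M)))
    ≡⟨ trans (sym (P≤-8+ M)) (cong P≤ (sym (ℕ.*-suc 8 M))) ⟩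
  P≤ (8 * suc M)
    ∎
  where
  open SetoidReasoning ≋-setoid
  g₁ g₅ g₆ P : PS
  g₁ = geom (1 + 8 * M)
  g₅ = geom (5 + 8 * M)
  g₆ = geom (6 + 8 * M)
  P = P≤ (8 * M)
  reorder : g₁ ⊛ g₅ ⊛ g₆ ⊛ P ≋ g₆ ⊛ (g₅ ⊛ (g₁ ⊛ P))
  reorder = ≋-trans (⊛-assoc (g₁ ⊛ g₅) g₆ P) (≋-trans (⊛-assoc g₁ g₅ (g₆ ⊛ P))
            (≋-trans (⊛-swap g₁ g₅ (g₆ ⊛ P)) (≋-trans (⊛-congˡ g₅ (⊛-swap g₁ g₆ P)) (⊛-swap g₅ g₆ (g₁ ⊛ P)))))

A₁ A₂ : PS
A₁ = q^ 5 ⊕ q^ 6 ⊕ q^ 9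
A₂ = q^ 2 ⊕ q^ 10 ⊕ mono (- 1ℤ) 11 ⊕ q^ 12

-- bracket2 - B≤ (8m): the contribution of the parts ≥ 8m + 1
tail : ℕ → PS
tail m = mono (𝟙 (1 ≤ᵇ m)) (8 * m + 1) ⊕ q^ (8 * m) ⊛ (A₁ ⊛ geom 8) ⊕ q^ (16 * m) ⊛ (A₂ ⊛ geom 16)

tail-suc : ∀ m n → tail m n ≡ δ156 (5 + 8 * m) n +ℤ (δ156 (4 + 8 * m) n +ℤ δ156 (8 * m) n) +ℤ tail (suc m) n
tail-suc m n = begin
  tail m n
    ≡⟨ cong₂ (λ x y → mono (𝟙 (1 ≤ᵇ m)) (8 * m + 1) n +ℤ x +ℤ y) first second ⟩
  a +ℤ (m5 +ℤ m6 +ℤ m9 +ℤ R₁) +ℤ (m2 +ℤ m10 +ℤ - m11 +ℤ m12 +ℤ R₂)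
    ≡⟨ regroup a m2 m5 m6 m9 m10 m11 m12 R₁ R₂ ⟩
  (m12 +ℤ m6 +ℤ - m11) +ℤ ((m10 +ℤ m5 +ℤ 0ℤ) +ℤ (m2 +ℤ a +ℤ 0ℤ)) +ℤ (m9 +ℤ R₁ +ℤ R₂)
    ≡⟨ cong₂ _+ℤ_ (cong₂ _+ℤ_ (sym δ₅) (cong₂ _+ℤ_ (sym δ₄) (sym δ₀))) (sym next) ⟩
  δ156 (5 + 8 * m) n +ℤ (δ156 (4 + 8 * m) n +ℤ δ156 (8 * m) n) +ℤ tail (suc m) n
    ∎
  where
  open ≡-Reasoning
  e : ℕ → ℤ
  e k = (q^ k) n
  a m2 m5 m6 m9 m10 m11 m12 R₁ R₂ : ℤ
  a = mono (𝟙 (1 ≤ᵇ m)) (8 * m + 1) n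
  m2 = e (16 * m + 2)
  m5 = e (8 * m + 5)
  m6 = e (8 * m + 6)
  m9 = e (8 * m + 9)
  m10 = e (16 * m + 10)
  m11 = e (16 * m + 11)
  m12 = e (16 * m + 12)
  R₁ = (q^ (8 * m + 8) ⊛ (A₁ ⊛ geom 8)) n
  R₂ = (q^ (16 * m + 16) ⊛ (A₂ ⊛ geom 16)) n
  regroup : ∀ a m2 m5 m6 m9 m10 m11 m12 r₁ r₂ →
    a +ℤ (m5 +ℤ m6 +ℤ m9 +ℤ r₁) +ℤ (m2 +ℤ m10 +ℤ - m11 +ℤ m12 +ℤ r₂)
      ≡ (m12 +ℤ m6 +ℤ - m11) +ℤ ((m10 +ℤ m5 +ℤ 0ℤ) +ℤ (m2 +ℤ a +ℤ 0ℤ)) +ℤ (m9 +ℤ r₁ +ℤ r₂)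
  regroup = solve-∀
  shift : ∀ a k → (q^ a ⊛ q^ k) n ≡ e (a + k)
  shift a k = mono-⊛-mono 1ℤ 1ℤ a k n
  ex : ∀ {i j} → i ≡ j → e i ≡ e j
  ex = cong e
  first : (q^ (8 * m) ⊛ (A₁ ⊛ geom 8)) n ≡ m5 +ℤ m6 +ℤ m9 +ℤ R₁
  first = trans (q^-⊛-series (8 * m) 8 A₁ (s≤s z≤n) n) (cong₂ _+ℤ_
    (trans (⊛-distribˡ-⊕ (q^ (8 * m)) (q^ 5 ⊕ q^ 6) (q^ 9) n) (cong₂ _+ℤ_
      (trans (⊛-distribˡ-⊕ (q^ (8 * m)) (q^ 5) (q^ 6) n) (cong₂ _+ℤ_ (shift (8 * m) 5) (shift (8 * m) 6)))
      (shift (8 * m) 9)))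
    refl)
  second : (q^ (16 * m) ⊛ (A₂ ⊛ geom 16)) n ≡ m2 +ℤ m10 +ℤ - m11 +ℤ m12 +ℤ R₂
  second = trans (q^-⊛-series (16 * m) 16 A₂ (s≤s z≤n) n) (cong₂ _+ℤ_
    (trans (⊛-distribˡ-⊕ (q^ (16 * m)) (q^ 2 ⊕ q^ 10 ⊕ mono (- 1ℤ) 11) (q^ 12) n) (cong₂ _+ℤ_
      (trans (⊛-distribˡ-⊕ (q^ (16 * m)) (q^ 2 ⊕ q^ 10) (mono (- 1ℤ) 11) n) (cong₂ _+ℤ_
        (trans (⊛-distribˡ-⊕ (q^ (16 * m)) (q^ 2) (q^ 10) n) (cong₂ _+ℤ_ (shift (16 * m) 2) (shift (16 * m) 10)))
        (trans (mono-⊛-mono 1ℤ (- 1ℤ) (16 * m) 11 n) (mono-neg (16 * m + 11) n))))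
      (shift (16 * m) 12)))
    refl)
  δ₀ : δ156 (8 * m) n ≡ m2 +ℤ a +ℤ 0ℤ
  δ₀ = cong-+₃ (ex (exp m)) (cong₂ (λ c k → mono c k n) (two≤ m) (ℕ.+-comm 1 (8 * m)))
               (trans (cong (λ c → mono (- 𝟙 c) (2 * suc (8 * m) ∸ 1) n) (in156-+8* 0 m)) (mono-0 _ n))
    where
    exp : ∀ m → 2 * suc (8 * m) ≡ 16 * m + 2
    exp = solve-∀ℕ
    two≤ : ∀ m → 𝟙 (2 ≤ᵇ suc (8 * m)) ≡ 𝟙 (1 ≤ᵇ m)
    two≤ zero    = refl
    two≤ (suc m) = refl
  δ₄ : δ156 (4 + 8 * m) n ≡ m10 +ℤ m5 +ℤ 0ℤ
  δ₄ = cong-+₃ (ex (exp m)) (ex (ℕ.+-comm 5 (8 * m)))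
               (trans (cong (λ c → mono (- 𝟙 c) (2 * suc (4 + 8 * m) ∸ 1) n) (in156-+8* 4 m)) (mono-0 _ n))
    where
    exp : ∀ m → 2 * suc (4 + 8 * m) ≡ 16 * m + 10
    exp = solve-∀ℕ
  δ₅ : δ156 (5 + 8 * m) n ≡ m12 +ℤ m6 +ℤ - m11
  δ₅ = cong-+₃ (ex (exp₁ m)) (ex (ℕ.+-comm 6 (8 * m)))
               (trans (cong (λ c → mono (- 𝟙 c) (2 * suc (5 + 8 * m) ∸ 1) n) (in156-+8* 5 m))
                      (trans (mono-neg _ n) (cong -_ (ex (cong (_∸ 1) (exp₂ m))))))
    where
    exp₁ : ∀ m → 2 * suc (5 + 8 * m) ≡ 16 * m + 12
    exp₁ = solve-∀ℕ
    exp₂ : ∀ m → 2 * suc (5 + 8 * m) ≡ suc (16 * m + 11)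
    exp₂ = solve-∀ℕ
  next : tail (suc m) n ≡ m9 +ℤ R₁ +ℤ R₂
  next = cong-+₃ (ex (exp₉ m)) (cong (λ k → (q^ k ⊛ (A₁ ⊛ geom 8)) n) (exp₈ m))
                 (cong (λ k → (q^ k ⊛ (A₂ ⊛ geom 16)) n) (exp₁₆ m))
    where
    exp₉ : ∀ m → 8 * suc m + 1 ≡ 8 * m + 9
    exp₉ = solve-∀ℕ
    exp₈ : ∀ m → 8 * suc m ≡ 8 * m + 8
    exp₈ = solve-∀ℕ
    exp₁₆ : ∀ m → 16 * suc m ≡ 16 * m + 16
    exp₁₆ = solve-∀ℕ

B≤⊕tail : ∀ m → B≤ (8 * m) ⊕ tail m ≋ bracket2
B≤⊕tail zero    n = trans (ℤ.+-identityˡ _)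
  (trans (cong-+₃ (mono-0 1 n) (⊛-identityˡ (A₁ ⊛ geom 8) n) (⊛-identityˡ (A₂ ⊛ geom 16) n))
         (cong (_+ℤ (A₂ ⊛ geom 16) n) (ℤ.+-identityˡ ((A₁ ⊛ geom 8) n))))
B≤⊕tail (suc m) n = begin
  B≤ (8 * suc m) n +ℤ tail (suc m) n
    ≡⟨ cong (λ b → B≤ b n +ℤ tail (suc m) n) (ℕ.*-suc 8 m) ⟩
  B≤ (8 + 8 * m) n +ℤ tail (suc m) n
    ≡⟨ cong (λ f → f n +ℤ tail (suc m) n) (B≤-8+ m) ⟩
  δ₅ +ℤ (δ₄ +ℤ (δ₀ +ℤ B≤ (8 * m) n)) +ℤ tail (suc m) n
    ≡⟨ regroup δ₅ δ₄ δ₀ (B≤ (8 * m) n) (tail (suc m) n) ⟩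
  B≤ (8 * m) n +ℤ (δ₅ +ℤ (δ₄ +ℤ δ₀) +ℤ tail (suc m) n)
    ≡⟨ cong (B≤ (8 * m) n +ℤ_) (tail-suc m n) ⟨
  B≤ (8 * m) n +ℤ tail m n
    ≡⟨ B≤⊕tail m n ⟩
  bracket2 n
    ∎
  where
  open ≡-Reasoning
  δ₀ = δ156 (8 * m) n
  δ₄ = δ156 (4 + 8 * m) n
  δ₅ = δ156 (5 + 8 * m) n
  regroup : ∀ a b c d t → a +ℤ (b +ℤ (c +ℤ d)) +ℤ t ≡ d +ℤ (a +ℤ (b +ℤ c) +ℤ t)
  regroup = solve-∀

tail-< : ∀ m {n} → n < 8 * m → tail m n ≡ 0ℤ
tail-< m {n} n<8m = cong-+₃ (cong (if_then 𝟙 (1 ≤ᵇ m) else 0ℤ) (≡ᵇ-false n≢8m+1))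
                            (q^-⊛-< (8 * m) (A₁ ⊛ geom 8) n<8m)
                            (q^-⊛-< (16 * m) (A₂ ⊛ geom 16) (ℕ.<-≤-trans n<8m (ℕ.*-monoˡ-≤ m (ℕ.m≤m+n 8 8))))
  where
  n≢8m+1 : n ≢ 8 * m + 1
  n≢8m+1 refl = ℕ.<⇒≱ n<8m (ℕ.m≤m+n (8 * m) 1)

B≤-< : ∀ m {n} → n < 8 * m → B≤ (8 * m) n ≡ bracket2 n
B≤-< m {n} n<8m = trans (sym (trans (cong (B≤ (8 * m) n +ℤ_) (tail-< m n<8m)) (ℤ.+-identityʳ _))) (B≤⊕tail m n)

g22-expand : ∀ N → + g22 N ≡ hooks156 N N N
g22-expand N = trans (∑-partitions cond22 (numHooks 2) N) (∑words≤-cong N weight)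
  where
  bounded : ∀ l → All (InRange N) l → nonincreasing l ≡ nonincreasing (N ∷ l)
  bounded []      _                = refl
  bounded (x ∷ l) ((_ , x≤N) ∷ _) = cong (_∧ nonincreasing (x ∷ l)) (sym (≤ᵇ-true x≤N))
  regroup : ∀ a s c h → (a *ℤ s) *ℤ (c *ℤ h) ≡ (a *ℤ (c *ℤ s)) *ℤ h
  regroup = solve-∀
  weight : ∀ l → All (InRange N) l →
    𝟙 (isPartitionOf N l) *ℤ (𝟙 (cond22 l) *ℤ + numHooks 2 l) ≡ 𝟙 (part156≤ N N l) *ℤ + numHooks 2 l
  weight l inR = begin
    𝟙 (nonincreasing l ∧ allᵇ (1 ≤ᵇ_) l ∧ S) *ℤ (𝟙 C *ℤ h)
      ≡⟨ cong₂ (λ a p → 𝟙 (a ∧ p ∧ S) *ℤ (𝟙 C *ℤ h)) (bounded l inR) (allᵇ-positive l inR) ⟩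
    𝟙 (ni ∧ S) *ℤ (𝟙 C *ℤ h)
      ≡⟨ cong (_*ℤ (𝟙 C *ℤ h)) (𝟙-∧ ni S) ⟩
    (𝟙 ni *ℤ 𝟙 S) *ℤ (𝟙 C *ℤ h)
      ≡⟨ regroup (𝟙 ni) (𝟙 S) (𝟙 C) h ⟩
    (𝟙 ni *ℤ (𝟙 C *ℤ 𝟙 S)) *ℤ h
      ≡⟨ cong (_*ℤ h) (trans (𝟙-∧ ni (C ∧ S)) (cong (𝟙 ni *ℤ_) (𝟙-∧ C S))) ⟨
    𝟙 (ni ∧ C ∧ S) *ℤ h
      ∎
    where
    open ≡-Reasoning
    ni C S : Bool
    ni = nonincreasing (N ∷ l)
    C = cond22 l
    S = sum l ≡ᵇ N
    h : ℤ
    h = + numHooks 2 l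

g22-coeff : ∀ N → + g22 N ≡ rhs2 N
g22-coeff N = begin
  + g22 N                        ≡⟨ g22-expand N ⟩
  hooks156 N N N                 ≡⟨ hooks156≡hooksGF N N N ℕ.≤-refl ℕ.≤-refl ⟩
  hooksGF N N                    ≡⟨ trans (cong (λ b → hooksGF b N) (exp N)) (hooksGF-stable-+ (7 * N + 8) N N ℕ.≤-refl) ⟨
  (P≤ b ⊛ B≤ b) N                ≡⟨ ⊛-cong-≤ (P≤ b) N (λ i i≤N → B≤-< (suc N) (ℕ.≤-<-trans i≤N N<b)) ⟩
  (P≤ b ⊛ bracket2) N            ≡⟨ ⊛-congʳ bracket2 (invProd156≋P≤ (suc N)) N ⟨
  rhs2 N                         ∎
  where
  open ≡-Reasoning
  b : ℕ
  b = 8 * suc N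
  exp : ∀ N → 8 * suc N ≡ 7 * N + 8 + N
  exp = solve-∀ℕ
  N<b : N < b
  N<b = ℕ.<-≤-trans (ℕ.n<1+n N) (ℕ.m≤n*m (suc N) 8)

proposition5p2 : ((N : ℕ) → + g12 N ≡ rhs1 N) × ((N : ℕ) → + g22 N ≡ rhs2 N)
proposition5p2 = g12-coeff , g22-coeff
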